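{- (1) For all $n\ge k\ge1$, $S_{\mathrm{odd}}(n,k)$ equals the number of partitions with leader of $[n]$ into $k$ blocks. (2) For all $n\ge k\ge1$, $s_{\mathrm{odd}}(n,k)$ equals the number of permutations with leader of $[n]$ with $k$ cycles. (3) For $n\ge0$ and $\mathbf{k}=(1,2,2,\ldots,2)$ (one entry $1$ followed by $n$ entries $2$, i.e. the multiset $\{0^1,1^2,\ldots,n^2\}$), for every positive integer $m$: $B_{\mathbf{k}}(m)=S_{\mathrm{odd}}(n+m,m)$ and $b_{\mathbf{k}}(m)=s_{\mathrm{odd}}(m,m-n)$. (4) For $n\ge1$ and every positive integer $m$, $$S_{\mathrm{odd}}(n+m,m)=\sum_{1\le i_1\le\cdots\le i_n\le m} i_1^2 i_2\cdots i_n,\qquad s_{\mathrm{odd}}(m,m-n)=\sum_{1\le i_1<\cdots<i_n<m} i_1^2 i_2\cdots i_n.$$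
   Context: $S_{\mathrm{odd}}(n,k)$ and $s_{\mathrm{odd}}(n,k)$ ($n,k\ge0$ integers) are defined by $S_{\mathrm{odd}}(0,0)=s_{\mathrm{odd}}(0,0)=0$, $S_{\mathrm{odd}}(n,k)=s_{\mathrm{odd}}(n,k)=0$ if $n<k$ (and all values with a negative argument are $0$), and for $n\ge1$: $S_{\mathrm{odd}}(n,k)=S_{\mathrm{odd}}(n-1,k-1)+kS_{\mathrm{odd}}(n-1,k)+\delta_{n,k}$, $s_{\mathrm{odd}}(n,k)=s_{\mathrm{odd}}(n-1,k-1)+(n-1)s_{\mathrm{odd}}(n-1,k)+\delta_{n,k}$, with $\delta$ the Kronecker delta. For a set partition $\pi=\{B_1,\ldots,B_k\}$ of $[n]$ indexed so that $\min B_1<\cdots<\min B_k$, the pair $(\ell,\pi)$ is a partition with leader if $\min B_\ell=\ell$. For a permutation $\sigma$ of $[n]$ written as a product of cycles $\sigma^{(1)}\cdots\sigma^{(k)}$ with $\min\sigma^{(1)}<\cdots<\min\sigma^{(k)}$, the pair $(\ell,\sigma)$ is a permutation with leader if $\min\sigma^{(\ell)}=\ell$. Stirling polynomials: for a tuple $\mathbf{k}=(k_1,\ldots,k_N)$ of positive integers (elements may be relabeled $0,\ldots,n$ in order), $K=\sum k_i$, a Stirling permutation of the multiset with $k_i$ copies of the $i$-th element is a word $\sigma(1)\cdots\sigma(K)$ such that $\sigma(i)=\sigma(j)$, $i<s<j$ imply $\sigma(s)\ge\sigma(i)$; index $i$ is a descent if $i<K$ and $\sigma(i)>\sigma(i+1)$,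 or $i=K$; $A_{\mathbf{k},i}$ counts those with exactly $i$ descents; $\sum_{m\ge0}B_{\mathbf{k}}(m)x^m=\frac{\sum_{i=1}^{N}A_{\mathbf{k},i}x^i}{(1-x)^{K+1}}$, $\sum_{m\ge0}b_{\mathbf{k}}(m)x^m=\frac{\sum_{i=K-N+1}^{K}A_{\mathbf{k},K+1-i}x^i}{(1-x)^{K+1}}$. -}

module Defs where

open import Data.Nat using (ℕ; zero; suc; _+_; _*_; _∸_; _≤_; _<_; _≤?_)
open import Data.Bool using (if_then_else_)
open import Data.Fin as Fin using (Fin; toℕ)
open import Data.Vec as Vec using (Vec; []; _∷_; lookup)
open import Data.List as List using (List; length; filter; map; upTo)
open import Data.Nat.ListAction using (sum)
open import Data.List.Relation.Unary.Unique.Propositional using (Unique)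
open import Data.List.Membership.Propositional using (_∈_)
open import Data.Product using (Σ; ∃; _×_; _,_)
open import Data.Sum using (_⊎_)
open import Function.Bundles using (_⇔_)
open import Relation.Nullary using (does)
open import Relation.Binary.PropositionalEquality using (_≡_)

-- Odd Stirling numbers (recursions of the paper).
-- All values with n = 0 are 0 (S(0,0)=0 and n<k gives 0); k = 0 with
-- n ≥ 1 gives 0 (negative argument k-1, and δ_{n,0}=0).

δ : ℕ → ℕ → ℕ
δ zero    zero    = 1
δ zero    (suc _) = 0
δ (suc _) zero    = 0
δ (suc m) (suc n) = δ m n

Sodd : ℕ → ℕ → ℕ
Sodd zero    k       = 0
Sodd (suc n) zero    = 0
Sodd (suc n) (suc k) = Sodd n k + suc k * Sodd n (suc k) + δ (suc n) (suc k)

sodd : ℕ → ℕ → ℕ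
sodd zero    k       = 0
sodd (suc n) zero    = 0
sodd (suc n) (suc k) = sodd n k + n * sodd n (suc k) + δ (suc n) (suc k)

-- s_odd(m, m - n) where m - n is an integer (value 0 if m - n < 0)
soddSub : ℕ → ℕ → ℕ
soddSub m n = if does (n ≤? m) then sodd m (m ∸ n) else 0

-- "The number of elements a : A with P a is N": there is a duplicate-free
-- list enumerating exactly the elements satisfying P, of length N.

HasCount : (A : Set) → (A → Set) → ℕ → Set
HasCount A P N =
  Σ (List A) λ xs → Unique xs × (∀ a → (a ∈ xs) ⇔ P a) × length xs ≡ N

-- Set partitions of [n] into k blocks B_1,…,B_k with min B_1 < … < min B_k,
-- encoded by the labelling v : Vec (Fin k) n, v[x] = index of block of x
-- (everything 0-based: element x+1 of [n] is position x, block B_{b+1} is b).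

IsBlockMin : ∀ {n k} → Vec (Fin k) n → Fin k → Fin n → Set
IsBlockMin v b p = lookup v p ≡ b × (∀ q → lookup v q ≡ b → p Fin.≤ q)

IsOrderedSetPartition : ∀ {n k} → Vec (Fin k) n → Set
IsOrderedSetPartition {n} {k} v =
  (∀ (b : Fin k) → ∃ λ p → IsBlockMin v b p) ×
  (∀ (b b' : Fin k) (p p' : Fin n) → b Fin.< b' →
     IsBlockMin v b p → IsBlockMin v b' p' → p Fin.< p')

-- (ℓ, π) partition with leader: min B_ℓ = ℓ (0-based: block ℓ has min ℓ)
IsPartitionWithLeader : ∀ {n k} → Fin k × Vec (Fin k) n → Set
IsPartitionWithLeader (ℓ , v) =
  IsOrderedSetPartition v × (∃ λ p → IsBlockMin v ℓ p × toℕ p ≡ toℕ ℓ)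

-- Permutations of [n] as the vector σ of images (0-based).

IsPermutation : ∀ {n} → Vec (Fin n) n → Set
IsPermutation σ = ∀ i j → lookup σ i ≡ lookup σ j → i ≡ j

iter : ∀ {n} → Vec (Fin n) n → ℕ → Fin n → Fin n
iter σ zero    x = x
iter σ (suc t) x = lookup σ (iter σ t x)

IsCycleMin : ∀ {n} → Vec (Fin n) n → Fin n → Set
IsCycleMin σ x = ∀ t → x Fin.≤ iter σ t x

-- σ has k cycles (= k cycle minima, one per cycle)
HasCycles : ∀ {n} → Vec (Fin n) n → ℕ → Set
HasCycles {n} σ k = HasCount (Fin n) (IsCycleMin σ) k

-- (ℓ, σ) permutation with leader, k cycles: the ℓ-th cycle in the order of
-- increasing minima has minimum ℓ; 0-based: x with toℕ x = ℓ is a cycle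
-- minimum and exactly ℓ cycle minima are smaller than x.
IsPermutationWithLeader : ∀ {n k} → Fin k × Vec (Fin n) n → Set
IsPermutationWithLeader {n} {k} (ℓ , σ) =
  IsPermutation σ × HasCycles σ k ×
  (∃ λ (x : Fin n) → toℕ x ≡ toℕ ℓ × IsCycleMin σ x ×
     HasCount (Fin n) (λ y → y Fin.< x × IsCycleMin σ y) (toℕ ℓ))

multiplicity : ∀ {N} → Fin N → List (Fin N) → ℕ
multiplicity a w = length (filter (Fin._≟ a) w)

IsStirlingPermutation : ∀ {N} → Vec ℕ N → List (Fin N) → Set
IsStirlingPermutation {N} kk w =
  (∀ (a : Fin N) → multiplicity a w ≡ lookup kk a) ×
  (∀ (i s j : Fin (length w)) → i Fin.< s → s Fin.< j →
     List.lookup w i ≡ List.lookup w j → List.lookup w i Fin.≤ List.lookup w s)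

-- index d (0-based position; d+1 in the paper) is a descent
IsDescent : ∀ {N} (w : List (Fin N)) → Fin (length w) → Set
IsDescent w d =
  (suc (toℕ d) ≡ length w) ⊎
  (∃ λ (e : Fin (length w)) → toℕ e ≡ suc (toℕ d) × List.lookup w e Fin.< List.lookup w d)

IsStirlingDescentCount : ∀ {N} → Vec ℕ N → ℕ → ℕ → Set
IsStirlingDescentCount {N} kk i c =
  HasCount (List (Fin N))
    (λ w → IsStirlingPermutation kk w × HasCount (Fin (length w)) (IsDescent w) i) c

Series : Set
Series = ℕ → ℕ

-- Σ_{j=lo}^{hi} f j  (empty if hi < lo)
sumRange : ℕ → ℕ → (ℕ → ℕ) → ℕ
sumRange lo hi f = sum (map (λ t → f (lo + t)) (upTo (suc hi ∸ lo)))

_⋆_ : Series → Series → Series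
(f ⋆ g) m = sumRange 0 m (λ j → f j * g (m ∸ j))

geometric : Series
geometric _ = 1

one : Series
one zero    = 1
one (suc _) = 0

invOneMinusXPow : ℕ → Series
invOneMinusXPow zero    = one
invOneMinusXPow (suc r) = geometric ⋆ invOneMinusXPow r

window : ℕ → ℕ → (ℕ → ℕ) → Series
window lo hi A j = if does (lo ≤? j) then (if does (j ≤? hi) then A j else 0) else 0

-- B_k and b_k, where N = length of k, K = sum of k, A i = A_{k,i}
Bpoly : (N K : ℕ) → (ℕ → ℕ) → Series
Bpoly N K A = window 1 N A ⋆ invOneMinusXPow (suc K)

bpoly : (N K : ℕ) → (ℕ → ℕ) → Series
bpoly N K A = window (suc K ∸ N) K (λ i → A (suc K ∸ i)) ⋆ invOneMinusXPow (suc K)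

oneTwos : (n : ℕ) → Vec ℕ (suc n)
oneTwos n = 1 ∷ Vec.replicate n 2

sumWeak : (n : ℕ) → ℕ → ℕ → (Vec ℕ n → ℕ) → ℕ
sumWeak zero    lo m f = f []
sumWeak (suc n) lo m f = sumRange lo m (λ i → sumWeak n i m (λ v → f (i ∷ v)))

sumStrict : (n : ℕ) → ℕ → ℕ → (Vec ℕ n → ℕ) → ℕ
sumStrict zero    lo m f = f []
sumStrict (suc n) lo m f = sumRange lo (m ∸ 1) (λ i → sumStrict n (suc i) m (λ v → f (i ∷ v)))

weight : ∀ {n} → Vec ℕ n → ℕ
weight []      = 1
weight (i ∷ v) = i * i * Vec.foldr _ _*_ 1 v

-- (1), (2): removing the largest element from a set partition (permutation) of [n + 1] into k + 1 blocks (cycles)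
-- either deletes a singleton block (a fixed point), necessarily the last one, or removes it from one of the k + 1
-- blocks (from after one of the n other points) of a partition (permutation) of [n] with k + 1 blocks (cycles).
-- Following the leader through this decomposition gives the three terms of the recurrence; the Kronecker term is
-- the case where the new singleton is the leader itself, which forces n = k.
-- (3): removing the two copies of the largest letter from a Stirling permutation leaves a smaller one, and putting
-- them back into one of its gaps keeps the number of descents exactly when the gap follows a descent. Hence
-- A_{n+1}(i) = i A_n(i) + (2n + 3 − i) A_n(i − 1), and for polynomials related in this way the coefficient of x^m in
-- A_{n+1}(x)/(1 − x)^{2n+3} is m times that in A_n(x)/(1 − x)^{2n+2}. Thus B(n + 1, m + 1) = B(n + 1, m) +
-- (m + 1) B(n, m + 1), the recurrence of S_odd(n + m, m), and likewise the reversed polynomials give that of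
-- s_odd(m, m − n).
-- (4): splitting off the terms whose largest index is m shows that both sums satisfy the same two recurrences.

module Submission where

module Count where

  open import Defs using (HasCount)
  open import Data.Nat using (ℕ; suc; _+_; _*_; _∸_; _≤_; z≤n; s≤s)
  open import Data.Nat.Properties using (≤-antisym; m+n∸m≡n; +-comm; +-suc; +-assoc; <⇒≱; n<1+n)
  open import Data.Fin using (Fin)
  open import Data.List using (List; []; _∷_; _++_; map; length; filter; allFin)
  open import Data.List.Properties using (length-++; length-map; length-tabulate)
  open import Data.List.Relation.Unary.All as All using (All; []; _∷_)
  open import Data.List.Relation.Unary.Any using (here; there)
  open import Data.List.Relation.Unary.Unique.Propositional using (Unique; []; _∷_)
  import Data.List.Relation.Unary.Unique.Propositional.Properties as Unique
  open import Data.List.Membership.Propositional using (_∈_)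
  open import Data.List.Membership.Propositional.Properties
    using (∈-++⁺ˡ; ∈-++⁺ʳ; ∈-++⁻; ∈-map⁺; ∈-map⁻; ∈-filter⁺; ∈-filter⁻; ∈-allFin)
  open import Data.Product using (∃; _×_; _,_; proj₁; proj₂; map₁)
  open import Data.Sum as Sum using (_⊎_; inj₁; inj₂; [_,_]′)
  open import Data.Unit using (⊤)
  open import Data.Empty using (⊥; ⊥-elim)
  open import Function using (_∘_; _∘′_)
  open import Function.Bundles using (_⇔_; mk⇔; Equivalence)
  open import Relation.Nullary using (¬_; yes; no)
  open import Relation.Nullary.Decidable using (¬?; map′)
  open import Relation.Unary using (Decidable)
  open import Relation.Binary.Definitions using (DecidableEquality)
  open import Relation.Binary.PropositionalEquality hiding (resp)
  import Data.List.Membership.DecPropositional as DecMembership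

  open Equivalence

  private
    variable
      A B : Set
      P Q : A → Set
      N M : ℕ

  resp : (∀ a → P a ⇔ Q a) → HasCount A P N → HasCount A Q N
  resp P⇔Q (xs , u , mem , len) =
    xs , u , (λ a → mk⇔ (to (P⇔Q a) ∘′ to (mem a)) (from (mem a) ∘′ from (P⇔Q a))) , len

  none : (∀ a → ¬ P a) → HasCount A P 0
  none ¬P = [] , [] , (λ a → mk⇔ (λ ()) (⊥-elim ∘ ¬P a)) , refl

  single : (a₀ : A) → (∀ a → P a → a ≡ a₀) → P a₀ → HasCount A P 1
  single a₀ unique Pa₀ =
    a₀ ∷ [] , [] ∷ [] , (λ a → mk⇔ (λ { (here refl) → Pa₀ }) (λ Pa → here (unique a Pa))) , refl

  ⊎⁺ : HasCount A P N → HasCount A Q M → (∀ a → P a → ¬ Q a) → HasCount A (λ a → P a ⊎ Q a) (N + M)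
  ⊎⁺ (xs , uxs , mxs , refl) (ys , uys , mys , refl) disjoint =
    xs ++ ys ,
    Unique.++⁺ uxs uys (λ (a∈xs , a∈ys) → disjoint _ (to (mxs _) a∈xs) (to (mys _) a∈ys)) ,
    (λ a → mk⇔ (Sum.map (to (mxs a)) (to (mys a)) ∘ ∈-++⁻ xs)
               [ ∈-++⁺ˡ ∘ from (mxs a) , ∈-++⁺ʳ xs ∘ from (mys a) ]′) ,
    length-++ xs

  module _ (f : A → B) (injective : ∀ {a a′} → P a → P a′ → f a ≡ f a′ → a ≡ a′) where

    private
      map-unique : ∀ {xs} → All P xs → Unique xs → Unique (map f xs)
      map-unique [] [] = []
      map-unique {x ∷ xs} (Px ∷ Pxs) (x∉xs ∷ uxs) = fresh Pxs x∉xs ∷ map-unique Pxs uxs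
        where
        fresh : ∀ {ys} → All P ys → All (λ y → x ≢ y) ys → All (λ z → f x ≢ z) (map f ys)
        fresh [] [] = []
        fresh (Py ∷ Pys) (x≢y ∷ x≢ys) = (x≢y ∘ injective Px Py) ∷ fresh Pys x≢ys

    image⁺ : HasCount A P N → HasCount B (λ b → ∃ λ a → P a × f a ≡ b) N
    image⁺ (xs , uxs , mxs , len) =
      map f xs ,
      map-unique (All.tabulate (to (mxs _))) uxs ,
      (λ b → mk⇔ (λ b∈ → let a , a∈ , b≡fa = ∈-map⁻ f b∈ in a , to (mxs a) a∈ , sym b≡fa)
                 (λ { (a , Pa , refl) → ∈-map⁺ f (from (mxs a) Pa) })) ,
      trans (length-map f xs) len

  module _ {R : A → B → Set} {c : ℕ} (fibre : ∀ a → P a → HasCount B (R a) c) where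

    private
      elements : ∀ {a} → P a → List B
      elements {a} Pa = proj₁ (fibre a Pa)

      elements⇔ : ∀ {a} (Pa : P a) b → b ∈ elements Pa ⇔ R a b
      elements⇔ {a} Pa = proj₁ (proj₂ (proj₂ (fibre a Pa)))

      pairs : ∀ {xs} → All P xs → List (A × B)
      pairs [] = []
      pairs {x ∷ _} (Px ∷ Pxs) = map (x ,_) (elements Px) ++ pairs Pxs

      pairs⁻ : ∀ {xs} (Pxs : All P xs) {a b} → (a , b) ∈ pairs Pxs → a ∈ xs × R a b
      pairs⁻ {x ∷ _} (Px ∷ Pxs) ab∈ with ∈-++⁻ (map (x ,_) (elements Px)) ab∈
      ... | inj₁ ab∈ys with ∈-map⁻ (x ,_) ab∈ys
      ...   | b , b∈ys , refl = here refl , to (elements⇔ Px b) b∈ys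
      pairs⁻ (Px ∷ Pxs) ab∈ | inj₂ ab∈rest = map₁ there (pairs⁻ Pxs ab∈rest)

      pairs⁺ : ∀ {xs} (Pxs : All P xs) {a b} → a ∈ xs → R a b → (a , b) ∈ pairs Pxs
      pairs⁺ {x ∷ _} (Px ∷ Pxs) (here refl) Rab = ∈-++⁺ˡ (∈-map⁺ (x ,_) (from (elements⇔ Px _) Rab))
      pairs⁺ {x ∷ _} (Px ∷ Pxs) (there a∈) Rab = ∈-++⁺ʳ (map (x ,_) (elements Px)) (pairs⁺ Pxs a∈ Rab)

      pairs-unique : ∀ {xs} (Pxs : All P xs) → Unique xs → Unique (pairs Pxs)
      pairs-unique [] [] = []
      pairs-unique {x ∷ _} (Px ∷ Pxs) (x∉xs ∷ uxs) =
        Unique.++⁺ (Unique.map⁺ (cong proj₂) (proj₁ (proj₂ (fibre x Px))))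
                   (pairs-unique Pxs uxs)
                   (λ (ab∈ys , ab∈rest) → let b , _ , eq = ∈-map⁻ (x ,_) ab∈ys in
                      All.lookup x∉xs (subst (_∈ _) (cong proj₁ eq) (proj₁ (pairs⁻ Pxs ab∈rest))) refl)

      pairs-length : ∀ {xs} (Pxs : All P xs) → length (pairs Pxs) ≡ length xs * c
      pairs-length [] = refl
      pairs-length {x ∷ xs} (Px ∷ Pxs) = begin
        length (map (x ,_) (elements Px) ++ pairs Pxs)          ≡⟨ length-++ (map (x ,_) (elements Px)) ⟩
        length (map (x ,_) (elements Px)) + length (pairs Pxs)
          ≡⟨ cong₂ _+_ (trans (length-map (x ,_) (elements Px)) (proj₂ (proj₂ (proj₂ (fibre x Px))))) (pairs-length Pxs) ⟩
        c + length xs * c                                       ∎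
        where open ≡-Reasoning

    Σ⁺ : HasCount A P N → HasCount (A × B) (λ (a , b) → P a × R a b) (N * c)
    Σ⁺ (xs , uxs , mxs , refl) =
      pairs Pxs ,
      pairs-unique Pxs uxs ,
      (λ (a , b) → mk⇔ (λ ab∈ → let a∈ , Rab = pairs⁻ Pxs ab∈ in to (mxs a) a∈ , Rab)
                       (λ (Pa , Rab) → pairs⁺ Pxs (from (mxs a) Pa) Rab)) ,
      pairs-length Pxs
      where Pxs = All.tabulate (to (mxs _))

  private
    remove : ∀ {a : A} ys → a ∈ ys → List A
    remove (_ ∷ ys) (here _) = ys
    remove (y ∷ ys) (there a∈) = y ∷ remove ys a∈

    length-remove : ∀ {a : A} ys (a∈ : a ∈ ys) → suc (length (remove ys a∈)) ≡ length ys
    length-remove (_ ∷ _) (here _) = refl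
    length-remove (_ ∷ ys) (there a∈) = cong suc (length-remove ys a∈)

    ∈-remove : ∀ {a b : A} ys (a∈ : a ∈ ys) → b ∈ ys → b ≢ a → b ∈ remove ys a∈
    ∈-remove (_ ∷ _) (here refl) (here refl) b≢a = ⊥-elim (b≢a refl)
    ∈-remove (_ ∷ _) (here _) (there b∈) _ = b∈
    ∈-remove (_ ∷ _) (there _) (here b≡y) _ = here b≡y
    ∈-remove (_ ∷ ys) (there a∈) (there b∈) b≢a = there (∈-remove ys a∈ b∈ b≢a)

    unique-length-≤ : ∀ (xs ys : List A) → Unique xs → (∀ {a} → a ∈ xs → a ∈ ys) → length xs ≤ length ys
    unique-length-≤ [] ys _ _ = z≤n
    unique-length-≤ (x ∷ xs) ys (x∉xs ∷ uxs) xs⊆ys =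
      subst (suc (length xs) ≤_) (length-remove ys x∈ys)
        (s≤s (unique-length-≤ xs (remove ys x∈ys) uxs
                (λ a∈xs → ∈-remove ys x∈ys (xs⊆ys (there a∈xs)) (λ a≡x → All.lookup x∉xs a∈xs (sym a≡x)))))
      where x∈ys = xs⊆ys (here refl)

  mono : HasCount A P N → HasCount A Q M → (∀ a → P a → Q a) → N ≤ M
  mono (xs , uxs , mxs , refl) (ys , _ , mys , refl) P⊆Q =
    unique-length-≤ xs ys uxs (λ a∈ → from (mys _) (P⊆Q _ (to (mxs _) a∈)))

  functional : HasCount A P N → HasCount A P M → N ≡ M
  functional hN hM = ≤-antisym (mono hN hM (λ _ p → p)) (mono hM hN (λ _ p → p))

  private
    filter-count : ∀ {xs : List A} → Unique xs → (∀ a → a ∈ xs ⇔ P a) → (Q? : Decidable Q) →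
      HasCount A (λ a → P a × Q a) (length (filter Q? xs))
    filter-count {xs = xs} uxs mxs Q? =
      filter Q? xs ,
      Unique.filter⁺ Q? uxs ,
      (λ a → mk⇔ (λ a∈ → let a∈xs , Qa = ∈-filter⁻ Q? a∈ in to (mxs a) a∈xs , Qa)
                 (λ (Pa , Qa) → ∈-filter⁺ Q? (from (mxs a) Pa) Qa)) ,
      refl

    length-filter-¬filter : (Q? : Decidable Q) (xs : List A) →
      length (filter Q? xs) + length (filter (¬? ∘ Q?) xs) ≡ length xs
    length-filter-¬filter Q? [] = refl
    length-filter-¬filter Q? (x ∷ xs) with Q? x
    ... | yes _ = cong suc (length-filter-¬filter Q? xs)
    ... | no _ = trans (+-suc _ _) (cong suc (length-filter-¬filter Q? xs))

  partition⁺ : HasCount A P N → (Q? : Decidable Q) → ∃ λ K → ∃ λ L →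
    HasCount A (λ a → P a × Q a) K × HasCount A (λ a → P a × ¬ Q a) L × K + L ≡ N
  partition⁺ (xs , uxs , mxs , len) Q? =
    _ , _ , filter-count uxs mxs Q? , filter-count uxs mxs (¬? ∘ Q?) ,
    trans (length-filter-¬filter Q? xs) len

  restrict : HasCount A P N → Decidable Q → ∃ λ K → HasCount A (λ a → P a × Q a) K
  restrict hP Q? = let K , _ , hPQ , _ = partition⁺ hP Q? in K , hPQ

  complement : HasCount A P N → HasCount A (λ a → P a × Q a) M → Decidable Q →
    HasCount A (λ a → P a × ¬ Q a) (N ∸ M)
  complement {M = M} hP hPQ Q? with partition⁺ hP Q?
  ... | K , L , hPQ′ , hP¬Q , refl rewrite functional hPQ′ hPQ = subst (HasCount _ _) (sym (m+n∸m≡n M L)) hP¬Q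

  allFin⁺ : ∀ n → HasCount (Fin n) (λ _ → ⊤) n
  allFin⁺ n = allFin n , Unique.allFin⁺ n , (λ i → mk⇔ _ (λ _ → ∈-allFin i)) , length-tabulate (λ i → i)

  decidable : DecidableEquality A → HasCount A P N → Decidable P
  decidable _≟_ (xs , _ , mxs , _) a = map′ (to (mxs a)) (from (mxs a)) (a ∈? xs)
    where open DecMembership _≟_ using (_∈?_)

  one-outside : ∀ {R : A → Set} {k a b} → HasCount A P (suc k) → HasCount A R k → (∀ a → R a → P a) →
    P a → P b → ¬ R a → ¬ R b → a ≢ b → ⊥
  one-outside {P = P} {R = R} {k} {a} {b} hP hR R⊆P Pa Pb ¬Ra ¬Rb a≢b =
    <⇒≱ (n<1+n (suc k)) (subst (_≤ suc k) (trans (+-assoc k 1 1) (+-comm k 2)) (mono extended hP ⊆P))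
    where
    extended : HasCount _ (λ z → (R z ⊎ z ≡ a) ⊎ z ≡ b) (k + 1 + 1)
    extended = ⊎⁺ (⊎⁺ hR (single a (λ _ eq → eq) refl) (λ { _ Rz refl → ¬Ra Rz }))
                  (single b (λ _ eq → eq) refl)
                  (λ { _ (inj₁ Rz) refl → ¬Rb Rz ; _ (inj₂ refl) z≡b → a≢b z≡b })
    ⊆P : ∀ z → (R z ⊎ z ≡ a) ⊎ z ≡ b → P z
    ⊆P z (inj₁ (inj₁ Rz)) = R⊆P z Rz
    ⊆P _ (inj₁ (inj₂ refl)) = Pa
    ⊆P _ (inj₂ refl) = Pb

module CountOnFin where

  open import Defs using (HasCount)
  open import Data.Nat as ℕ using (ℕ; suc)
  open import Data.Nat.Properties using (+-comm; suc-injective)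
  open import Data.Fin using (Fin; toℕ; inject₁; fromℕ; fromℕ<)
  open import Data.Fin.Properties using (_≟_; toℕ-injective; toℕ-fromℕ<; inject₁-injective; fromℕ≢inject₁)
  open import Data.Fin.Relation.Unary.Top using (view; ‵fromℕ; ‵inject₁)
  open import Data.Product using (∃; _×_; _,_; proj₂)
  open import Data.Sum using (_⊎_; inj₁; inj₂)
  open import Function using (_∘_)
  open import Function.Bundles using (_⇔_; mk⇔; Equivalence)
  open import Relation.Nullary using (¬_; contradiction)
  open import Relation.Nullary.Decidable using (map′)
  open import Relation.Binary.PropositionalEquality

  open Equivalence

  module _ {n} {P : Fin n → Set} {Q : Fin (suc n) → Set} (Q⇔P : ∀ z → Q (inject₁ z) ⇔ P z) where

    private
      image⇔Q : ∀ z → (∃ λ z′ → P z′ × inject₁ z′ ≡ z) → Q z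
      image⇔Q _ (z′ , Pz′ , refl) = from (Q⇔P z′) Pz′

    inject₁⁺ : ∀ {c} → ¬ Q (fromℕ n) → HasCount (Fin n) P c → HasCount (Fin (suc n)) Q c
    inject₁⁺ ¬Qlast hP =
      Count.resp (λ z → mk⇔ (image⇔Q z) (preimage z)) (Count.image⁺ inject₁ (λ _ _ → inject₁-injective) hP)
      where
      preimage : ∀ z → Q z → ∃ λ z′ → P z′ × inject₁ z′ ≡ z
      preimage z Qz with view z
      ... | ‵inject₁ z′ = z′ , to (Q⇔P z′) Qz , refl
      ... | ‵fromℕ = contradiction Qz ¬Qlast

    inject₁-fromℕ⁺ : ∀ {c} → Q (fromℕ n) → HasCount (Fin n) P c → HasCount (Fin (suc n)) Q (suc c)
    inject₁-fromℕ⁺ Qlast hP =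
      subst (HasCount _ _) (+-comm _ 1)
        (Count.resp (λ z → mk⇔ (sound z) (complete z))
          (Count.⊎⁺ (Count.image⁺ inject₁ (λ _ _ → inject₁-injective) hP) (Count.single (fromℕ n) (λ _ eq → eq) refl)
            (λ { _ (z′ , _ , refl) eq → fromℕ≢inject₁ (sym eq) })))
      where
      sound : ∀ z → (∃ λ z′ → P z′ × inject₁ z′ ≡ z) ⊎ z ≡ fromℕ n → Q z
      sound z (inj₁ image) = image⇔Q z image
      sound _ (inj₂ refl) = Qlast
      complete : ∀ z → Q z → (∃ λ z′ → P z′ × inject₁ z′ ≡ z) ⊎ z ≡ fromℕ n
      complete z Qz with view z
      ... | ‵inject₁ z′ = inj₁ (z′ , to (Q⇔P z′) Qz , refl)
      ... | ‵fromℕ = inj₂ refl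

    private
      -- A count of Q makes Q, hence P, decidable; so P has some count, which the ⁺ direction then pins down.
      some-count : ∀ {c′} → HasCount (Fin (suc n)) Q c′ → ∃ λ K → HasCount (Fin n) P K
      some-count hQ =
        let P? = λ z → map′ (to (Q⇔P z)) (from (Q⇔P z)) (Count.decidable _≟_ hQ (inject₁ z))
            K , hK = Count.restrict (Count.allFin⁺ n) P?
        in K , Count.resp (λ z → mk⇔ proj₂ (_ ,_)) hK

    inject₁⁻ : ∀ {c} → ¬ Q (fromℕ n) → HasCount (Fin (suc n)) Q c → HasCount (Fin n) P c
    inject₁⁻ ¬Qlast hQ = let K , hK = some-count hQ in subst (HasCount _ _) (Count.functional (inject₁⁺ ¬Qlast hK) hQ) hK

    inject₁-fromℕ⁻ : ∀ {c} → Q (fromℕ n) → HasCount (Fin (suc n)) Q (suc c) → HasCount (Fin n) P c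
    inject₁-fromℕ⁻ Qlast hQ =
      let K , hK = some-count hQ in subst (HasCount _ _) (suc-injective (Count.functional (inject₁-fromℕ⁺ Qlast hK) hQ)) hK

  module _ {k} {Q : ℕ → Set} (bounded : ∀ d → Q d → d ℕ.< k) where

    private
      toℕ-image⇔ : ∀ d → (∃ λ i → Q (toℕ i) × toℕ i ≡ d) ⇔ Q d
      toℕ-image⇔ d = mk⇔ (λ { (i , Qi , refl) → Qi })
                         (λ Qd → fromℕ< (bounded d Qd) , subst Q (sym (toℕ-fromℕ< _)) Qd , toℕ-fromℕ< _)

    toℕ⁺ : ∀ {c} → HasCount (Fin k) (Q ∘ toℕ) c → HasCount ℕ Q c
    toℕ⁺ hQ = Count.resp toℕ-image⇔ (Count.image⁺ toℕ (λ _ _ → toℕ-injective) hQ)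

    toℕ⁻ : ∀ {c} → HasCount ℕ Q c → HasCount (Fin k) (Q ∘ toℕ) c
    toℕ⁻ hQ = subst (HasCount _ _) (Count.functional (toℕ⁺ hK) hQ) hK
      where
      restricted = Count.restrict (Count.allFin⁺ k) (λ i → Count.decidable ℕ._≟_ hQ (toℕ i))
      hK = Count.resp (λ i → mk⇔ proj₂ (_ ,_)) (proj₂ restricted)

module Sums where

  open import Defs using (sumRange)
  open import Data.Nat using (ℕ; zero; suc; _+_; _*_; _∸_; _≤_; _<_; _≤?_; z≤n; s≤s)
  open import Data.Nat.Properties
  open import Data.Nat.ListAction using (sum)
  open import Data.Nat.ListAction.Properties using (sum-++)
  open import Data.List using (applyUpTo; _∷ʳ_)
  open import Data.List.Properties using (map-upTo; applyUpTo-∷ʳ)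
  open import Algebra.Properties.CommutativeSemigroup +-commutativeSemigroup using (interchange)
  open import Function using (_∘_)
  open import Relation.Nullary using (yes; no; contradiction)
  open import Relation.Binary.PropositionalEquality
  open ≡-Reasoning

  private
    sumUpTo : (ℕ → ℕ) → ℕ → ℕ
    sumUpTo f k = sum (applyUpTo f k)

    sumRange≡sumUpTo : ∀ lo hi f → sumRange lo hi f ≡ sumUpTo (λ t → f (lo + t)) (suc hi ∸ lo)
    sumRange≡sumUpTo lo hi f = cong sum (map-upTo (λ t → f (lo + t)) (suc hi ∸ lo))

    sumUpTo-suc : ∀ f k → sumUpTo f (suc k) ≡ sumUpTo f k + f k
    sumUpTo-suc f k = begin
      sum (applyUpTo f (suc k))  ≡⟨ cong sum (applyUpTo-∷ʳ f k) ⟨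
      sum (applyUpTo f k ∷ʳ f k) ≡⟨ sum-++ (applyUpTo f k) _ ⟩
      sumUpTo f k + (f k + 0)    ≡⟨ cong (sumUpTo f k +_) (+-identityʳ (f k)) ⟩
      sumUpTo f k + f k          ∎

    sumUpTo-cong : ∀ f g k → (∀ t → t < k → f t ≡ g t) → sumUpTo f k ≡ sumUpTo g k
    sumUpTo-cong f g zero _ = refl
    sumUpTo-cong f g (suc k) f≗g =
      cong₂ _+_ (f≗g 0 (s≤s z≤n)) (sumUpTo-cong (f ∘ suc) (g ∘ suc) k (λ t t<k → f≗g (suc t) (s≤s t<k)))

    sumUpTo-+ : ∀ f g k → sumUpTo (λ t → f t + g t) k ≡ sumUpTo f k + sumUpTo g k
    sumUpTo-+ f g zero = refl
    sumUpTo-+ f g (suc k) = trans (cong (f 0 + g 0 +_) (sumUpTo-+ (f ∘ suc) (g ∘ suc) k)) (interchange (f 0) (g 0) _ _)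

    sumUpTo-* : ∀ c f k → sumUpTo (λ t → c * f t) k ≡ c * sumUpTo f k
    sumUpTo-* c f zero = sym (*-zeroʳ c)
    sumUpTo-* c f (suc k) = trans (cong (c * f 0 +_) (sumUpTo-* c (f ∘ suc) k)) (sym (*-distribˡ-+ c (f 0) _))

    sumUpTo-reverse : ∀ f k → sumUpTo (λ t → f (k ∸ t)) (suc k) ≡ sumUpTo f (suc k)
    sumUpTo-reverse f zero = refl
    sumUpTo-reverse f (suc k) = begin
      f (suc k) + sumUpTo (λ t → f (k ∸ t)) (suc k)  ≡⟨ cong (f (suc k) +_) (sumUpTo-reverse f k) ⟩
      f (suc k) + sumUpTo f (suc k)                   ≡⟨ +-comm (f (suc k)) _ ⟩
      sumUpTo f (suc k) + f (suc k)                   ≡⟨ sumUpTo-suc f (suc k) ⟨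
      sumUpTo f (suc (suc k))                         ∎

  sumRange-cong : ∀ lo hi {f g} → (∀ i → lo ≤ i → i ≤ hi → f i ≡ g i) → sumRange lo hi f ≡ sumRange lo hi g
  sumRange-cong lo hi {f} {g} f≗g = begin
    sumRange lo hi f                             ≡⟨ sumRange≡sumUpTo lo hi f ⟩
    sumUpTo (λ t → f (lo + t)) (suc hi ∸ lo)
      ≡⟨ sumUpTo-cong _ _ (suc hi ∸ lo) (λ t t< → f≗g (lo + t) (m≤m+n lo t) (in-range t t<)) ⟩
    sumUpTo (λ t → g (lo + t)) (suc hi ∸ lo)     ≡⟨ sumRange≡sumUpTo lo hi g ⟨
    sumRange lo hi g                             ∎
    where
    in-range : ∀ t → t < suc hi ∸ lo → lo + t ≤ hi
    in-range t t< with lo ≤? suc hi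
    ... | yes lo≤ = ≤-pred (subst (suc (lo + t) ≤_) (m+[n∸m]≡n lo≤) (subst (_≤ lo + (suc hi ∸ lo)) (+-suc lo t) (+-monoʳ-≤ lo t<)))
    ... | no lo≰ = contradiction (subst (t <_) (m≤n⇒m∸n≡0 (<⇒≤ (≰⇒> lo≰))) t<) n≮0

  sumRange-+ : ∀ lo hi f g → sumRange lo hi (λ i → f i + g i) ≡ sumRange lo hi f + sumRange lo hi g
  sumRange-+ lo hi f g = begin
    sumRange lo hi (λ i → f i + g i)                        ≡⟨ sumRange≡sumUpTo lo hi (λ i → f i + g i) ⟩
    sumUpTo (λ t → f (lo + t) + g (lo + t)) (suc hi ∸ lo)   ≡⟨ sumUpTo-+ (λ t → f (lo + t)) (λ t → g (lo + t)) (suc hi ∸ lo) ⟩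
    sumUpTo (λ t → f (lo + t)) (suc hi ∸ lo) + sumUpTo (λ t → g (lo + t)) (suc hi ∸ lo)
      ≡⟨ cong₂ _+_ (sumRange≡sumUpTo lo hi f) (sumRange≡sumUpTo lo hi g) ⟨
    sumRange lo hi f + sumRange lo hi g ∎

  sumRange-* : ∀ c lo hi f → sumRange lo hi (λ i → c * f i) ≡ c * sumRange lo hi f
  sumRange-* c lo hi f = begin
    sumRange lo hi (λ i → c * f i)                 ≡⟨ sumRange≡sumUpTo lo hi (λ i → c * f i) ⟩
    sumUpTo (λ t → c * f (lo + t)) (suc hi ∸ lo)   ≡⟨ sumUpTo-* c (λ t → f (lo + t)) (suc hi ∸ lo) ⟩
    c * sumUpTo (λ t → f (lo + t)) (suc hi ∸ lo)   ≡⟨ cong (c *_) (sumRange≡sumUpTo lo hi f) ⟨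
    c * sumRange lo hi f            ∎

  sumRange-suc : ∀ lo hi f → lo ≤ suc hi → sumRange lo (suc hi) f ≡ sumRange lo hi f + f (suc hi)
  sumRange-suc lo hi f lo≤ = begin
    sumRange lo (suc hi) f                                     ≡⟨ sumRange≡sumUpTo lo (suc hi) f ⟩
    sumUpTo (λ t → f (lo + t)) (suc (suc hi) ∸ lo)             ≡⟨ cong (sumUpTo _) (+-∸-assoc 1 lo≤) ⟩
    sumUpTo (λ t → f (lo + t)) (suc (suc hi ∸ lo))             ≡⟨ sumUpTo-suc _ (suc hi ∸ lo) ⟩
    sumUpTo (λ t → f (lo + t)) (suc hi ∸ lo) + f (lo + (suc hi ∸ lo))
      ≡⟨ cong₂ _+_ (sym (sumRange≡sumUpTo lo hi f)) (cong f (m+[n∸m]≡n lo≤)) ⟩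
    sumRange lo hi f + f (suc hi)                              ∎

  sumRange-empty : ∀ lo hi f → hi < lo → sumRange lo hi f ≡ 0
  sumRange-empty lo hi f hi<lo = trans (sumRange≡sumUpTo lo hi f) (cong (sumUpTo _) (m≤n⇒m∸n≡0 hi<lo))

  sumRange-single : ∀ m f → sumRange m m f ≡ f m
  sumRange-single m f = begin
    sumRange m m f                        ≡⟨ sumRange≡sumUpTo m m f ⟩
    sumUpTo (λ t → f (m + t)) (suc m ∸ m)  ≡⟨ cong (sumUpTo _) (m+n∸n≡m 1 m) ⟩
    f (m + 0) + 0                          ≡⟨ +-identityʳ _ ⟩
    f (m + 0)                              ≡⟨ cong f (+-identityʳ m) ⟩
    f m                                    ∎

  sumRange-reverse : ∀ k f → sumRange 0 k (λ t → f (k ∸ t)) ≡ sumRange 0 k f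
  sumRange-reverse k f = trans (sumRange≡sumUpTo 0 k _) (trans (sumUpTo-reverse f k) (sym (sumRange≡sumUpTo 0 k f)))

module OddStirling where

  open import Defs using (δ; Sodd; sodd; soddSub)
  open import Data.Nat using (zero; suc; _+_; _*_; _∸_; _≤_; _<_; _≤?_; z≤n; s≤s)
  open import Data.Nat.Properties
  open import Data.Bool using (if_then_else_)
  open import Relation.Nullary using (contradiction)
  open import Relation.Binary.Definitions using (tri<; tri≈; tri>)
  open import Function using (_∘_)
  open import Relation.Nullary.Decidable using (dec-true; dec-false)
  open import Relation.Binary.PropositionalEquality
  open ≡-Reasoning

  δ-refl : ∀ n → δ n n ≡ 1
  δ-refl zero = refl
  δ-refl (suc n) = δ-refl n

  δ-≢ : ∀ {m n} → m ≢ n → δ m n ≡ 0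
  δ-≢ {zero} {zero} m≢n = contradiction refl m≢n
  δ-≢ {zero} {suc n} _ = refl
  δ-≢ {suc m} {zero} _ = refl
  δ-≢ {suc m} {suc n} m≢n = δ-≢ (m≢n ∘ cong suc)

  Sodd-< : ∀ {n k} → n < k → Sodd n k ≡ 0
  Sodd-< {zero} _ = refl
  Sodd-< {suc n} {suc k} (s≤s n<k) = begin
    Sodd n k + suc k * Sodd n (suc k) + δ n k   ≡⟨ cong₂ (λ a b → a + suc k * b + δ n k) (Sodd-< n<k) (Sodd-< (m<n⇒m<1+n n<k)) ⟩
    suc k * 0 + δ n k                           ≡⟨ cong₂ _+_ (*-zeroʳ (suc k)) (δ-≢ (<⇒≢ n<k)) ⟩
    0                                           ∎

  sodd-< : ∀ {n k} → n < k → sodd n k ≡ 0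
  sodd-< {zero} _ = refl
  sodd-< {suc n} {suc k} (s≤s n<k) = begin
    sodd n k + n * sodd n (suc k) + δ n k   ≡⟨ cong₂ (λ a b → a + n * b + δ n k) (sodd-< n<k) (sodd-< (m<n⇒m<1+n n<k)) ⟩
    n * 0 + δ n k                           ≡⟨ cong₂ _+_ (*-zeroʳ n) (δ-≢ (<⇒≢ n<k)) ⟩
    0                                       ∎

  Sodd-diag : ∀ n → Sodd n n ≡ n
  Sodd-diag zero = refl
  Sodd-diag (suc n) = begin
    Sodd n n + suc n * Sodd n (suc n) + δ n n  ≡⟨ cong₂ (λ a b → a + suc n * b + δ n n) (Sodd-diag n) (Sodd-< (n<1+n n)) ⟩
    n + suc n * 0 + δ n n                      ≡⟨ cong₂ (λ a b → n + a + b) (*-zeroʳ (suc n)) (δ-refl n) ⟩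
    n + 0 + 1                                  ≡⟨ cong (_+ 1) (+-identityʳ n) ⟩
    n + 1                                      ≡⟨ +-comm n 1 ⟩
    suc n                                      ∎

  sodd-diag : ∀ n → sodd n n ≡ n
  sodd-diag zero = refl
  sodd-diag (suc n) = begin
    sodd n n + n * sodd n (suc n) + δ n n  ≡⟨ cong₂ (λ a b → a + n * b + δ n n) (sodd-diag n) (sodd-< (n<1+n n)) ⟩
    n + n * 0 + δ n n                      ≡⟨ cong₂ (λ a b → n + a + b) (*-zeroʳ n) (δ-refl n) ⟩
    n + 0 + 1                              ≡⟨ cong (_+ 1) (+-identityʳ n) ⟩
    n + 1                                  ≡⟨ +-comm n 1 ⟩
    suc n                                  ∎

  Sodd-offdiag : ∀ n k → k < n → Sodd (suc n) (suc k) ≡ Sodd n k + suc k * Sodd n (suc k)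
  Sodd-offdiag n k k<n = trans (cong (Sodd n k + suc k * Sodd n (suc k) +_) (δ-≢ (>⇒≢ k<n))) (+-identityʳ _)

  sodd-offdiag : ∀ n k → k < n → sodd (suc n) (suc k) ≡ sodd n k + n * sodd n (suc k)
  sodd-offdiag n k k<n = trans (cong (sodd n k + n * sodd n (suc k) +_) (δ-≢ (>⇒≢ k<n))) (+-identityʳ _)

  soddSub-≤ : ∀ {m n} → n ≤ m → soddSub m n ≡ sodd m (m ∸ n)
  soddSub-≤ {m} {n} n≤m = cong (λ b → if b then sodd m (m ∸ n) else 0) (dec-true (n ≤? m) n≤m)

  soddSub-> : ∀ {m n} → m < n → soddSub m n ≡ 0
  soddSub-> {m} {n} m<n = cong (λ b → if b then sodd m (m ∸ n) else 0) (dec-false (n ≤? m) (<⇒≱ m<n))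

  soddSub-zero : ∀ m → soddSub m 0 ≡ m
  soddSub-zero m = trans (soddSub-≤ {m} z≤n) (sodd-diag m)

  soddSub-suc : ∀ m n → soddSub (suc m) (suc n) ≡ soddSub m (suc n) + m * soddSub m n
  soddSub-suc m n with <-cmp n m
  ... | tri> _ _ m<n = begin
    soddSub (suc m) (suc n)             ≡⟨ soddSub-> (s≤s m<n) ⟩
    0                                   ≡⟨ cong₂ _+_ (soddSub-> (m<n⇒m<1+n m<n)) (trans (cong (m *_) (soddSub-> m<n)) (*-zeroʳ m)) ⟨
    soddSub m (suc n) + m * soddSub m n ∎
  ... | tri≈ _ refl _ = begin
    soddSub (suc m) (suc m)             ≡⟨ soddSub-≤ {suc m} ≤-refl ⟩
    sodd (suc m) (m ∸ m)                ≡⟨ cong (sodd (suc m)) (n∸n≡0 m) ⟩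
    0
      ≡⟨ cong₂ _+_ (soddSub-> (n<1+n m))
                   (trans (cong (m *_) (soddSub-≤ {m} ≤-refl)) (trans (cong (λ k → m * sodd m k) (n∸n≡0 m)) (sodd-zero m))) ⟨
    soddSub m (suc m) + m * soddSub m m ∎
    where
    sodd-zero : ∀ m → m * sodd m 0 ≡ 0
    sodd-zero zero = refl
    sodd-zero (suc m) = *-zeroʳ (suc m)
  ... | tri< (s≤s {n = m′} n≤m′) _ _ = begin
    soddSub (suc (suc m′)) (suc n)                  ≡⟨ soddSub-≤ (s≤s (m≤n⇒m≤1+n n≤m′)) ⟩
    sodd (suc (suc m′)) (suc m′ ∸ n)                ≡⟨ cong (sodd (suc (suc m′))) (+-∸-assoc 1 n≤m′) ⟩
    sodd (suc (suc m′)) (suc (m′ ∸ n))              ≡⟨ sodd-offdiag (suc m′) (m′ ∸ n) (s≤s (m∸n≤m m′ n)) ⟩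
    sodd (suc m′) (m′ ∸ n) + suc m′ * sodd (suc m′) (suc (m′ ∸ n))
      ≡⟨ cong₂ (λ a b → a + suc m′ * b) (soddSub-≤ (s≤s n≤m′))
                                          (trans (soddSub-≤ (m≤n⇒m≤1+n n≤m′)) (cong (sodd (suc m′)) (+-∸-assoc 1 n≤m′))) ⟨
    soddSub (suc m′) (suc n) + suc m′ * soddSub (suc m′) n ∎

  Sodd-suc-+ : ∀ n m → Sodd (suc n + suc m) (suc m) ≡ Sodd (suc n + m) m + suc m * Sodd (n + suc m) (suc m)
  Sodd-suc-+ n m = begin
    Sodd (suc (n + suc m)) (suc m)
      ≡⟨ Sodd-offdiag (n + suc m) m (m≤n+m (suc m) n) ⟩
    Sodd (n + suc m) m + suc m * Sodd (n + suc m) (suc m)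
      ≡⟨ cong (λ k → Sodd k m + suc m * Sodd (n + suc m) (suc m)) (+-suc n m) ⟩
    Sodd (suc n + m) m + suc m * Sodd (n + suc m) (suc m) ∎

module Triangle where

  open import Defs using (δ; HasCount)
  open OddStirling using (δ-refl; δ-≢)
  open import Data.Nat using (ℕ; zero; suc; _+_; _*_; _<_; s≤s; _≟_)
  open import Data.Nat.Properties using (*-zeroʳ; <⇒≤; ≤-refl)
  open import Data.Product using (_×_; _,_; proj₁)
  open import Function.Bundles using (mk⇔)
  open import Relation.Nullary using (yes; no)
  open import Relation.Binary.PropositionalEquality

  triangle : (ℕ → ℕ → ℕ) → ℕ → ℕ → ℕ
  triangle c zero zero = 1
  triangle c zero (suc k) = 0
  triangle c (suc n) zero = 0
  triangle c (suc n) (suc k) = triangle c n k + c n k * triangle c n (suc k)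

  triangle-< : ∀ c {n k} → n < k → triangle c n k ≡ 0
  triangle-< c {zero} {suc k} _ = refl
  triangle-< c {suc n} {suc k} (s≤s n<k) =
    cong₂ _+_ (triangle-< c n<k) (trans (cong (c n k *_) (triangle-< c (s≤s (<⇒≤ n<k)))) (*-zeroʳ (c n k)))

  triangle-diag : ∀ c n → triangle c n n ≡ 1
  triangle-diag c zero = refl
  triangle-diag c (suc n) = cong₂ _+_ (triangle-diag c n) (trans (cong (c n n *_) (triangle-< c {n} ≤-refl)) (*-zeroʳ (c n n)))

  stirling₂ : ℕ → ℕ → ℕ
  stirling₂ = triangle (λ _ k → suc k)

  stirling₁ : ℕ → ℕ → ℕ
  stirling₁ = triangle (λ n _ → n)

  δ-count : ∀ {A : ℕ → Set} {P : ∀ {j} → A j → Set} c n k → HasCount (A n) P (triangle c n n) →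
    HasCount (A k) (λ a → P a × n ≡ k) (δ n k)
  δ-count c n k hP with n ≟ k
  ... | yes refl = subst (HasCount _ _) (trans (triangle-diag c n) (sym (δ-refl n)))
                     (Count.resp (λ a → mk⇔ (_, refl) proj₁) hP)
  ... | no n≢k = subst (HasCount _ _) (sym (δ-≢ n≢k)) (Count.none (λ _ (_ , n≡k) → n≢k n≡k))

module ClosedForms where

  open import Defs using (Sodd; soddSub; sumRange; sumWeak; sumStrict; weight)
  open Sums
  open OddStirling
  open import Data.Nat using (ℕ; zero; suc; _+_; _*_; _∸_; _≤_; z≤n; s≤s)
  open import Data.Nat.Properties
  open import Algebra.Properties.CommutativeSemigroup *-commutativeSemigroup using (x∙yz≈y∙xz)
  open import Data.Vec as Vec using (Vec; _∷_)
  open import Relation.Binary.PropositionalEquality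
  open ≡-Reasoning

  product : ∀ {n} → Vec ℕ n → ℕ
  product = Vec.foldr _ _*_ 1

  sumWeak-* : ∀ n c lo m (f : Vec ℕ n → ℕ) → sumWeak n lo m (λ v → c * f v) ≡ c * sumWeak n lo m f
  sumWeak-* zero c lo m f = refl
  sumWeak-* (suc n) c lo m f = begin
    sumRange lo m (λ i → sumWeak n i m (λ v → c * f (i ∷ v)))
      ≡⟨ sumRange-cong lo m (λ i _ _ → sumWeak-* n c i m (λ v → f (i ∷ v))) ⟩
    sumRange lo m (λ i → c * sumWeak n i m (λ v → f (i ∷ v)))  ≡⟨ sumRange-* c lo m (λ i → sumWeak n i m (λ v → f (i ∷ v))) ⟩
    c * sumRange lo m (λ i → sumWeak n i m (λ v → f (i ∷ v)))  ∎

  sumStrict-* : ∀ n c lo m (f : Vec ℕ n → ℕ) → sumStrict n lo m (λ v → c * f v) ≡ c * sumStrict n lo m f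
  sumStrict-* zero c lo m f = refl
  sumStrict-* (suc n) c lo m f = begin
    sumRange lo (m ∸ 1) (λ i → sumStrict n (suc i) m (λ v → c * f (i ∷ v)))
      ≡⟨ sumRange-cong lo (m ∸ 1) (λ i _ _ → sumStrict-* n c (suc i) m (λ v → f (i ∷ v))) ⟩
    sumRange lo (m ∸ 1) (λ i → c * sumStrict n (suc i) m (λ v → f (i ∷ v)))
      ≡⟨ sumRange-* c lo (m ∸ 1) (λ i → sumStrict n (suc i) m (λ v → f (i ∷ v))) ⟩
    c * sumRange lo (m ∸ 1) (λ i → sumStrict n (suc i) m (λ v → f (i ∷ v)))  ∎

  complete : ℕ → ℕ → ℕ → ℕ
  complete n lo m = sumWeak n lo m product

  elementary : ℕ → ℕ → ℕ → ℕ
  elementary n lo m = sumStrict n lo m product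

  weighted : (ℕ → ℕ) → ℕ → ℕ → ℕ → ℕ
  weighted g n lo m = sumRange lo m (λ i → g i * complete n i m)

  weightedStrict : (ℕ → ℕ) → ℕ → ℕ → ℕ → ℕ
  weightedStrict g n lo m = sumRange lo (m ∸ 1) (λ i → g i * elementary n (suc i) m)

  complete-suc : ∀ n lo m → complete (suc n) lo m ≡ weighted (λ i → i) n lo m
  complete-suc n lo m = sumRange-cong lo m (λ i _ _ → sumWeak-* n i i m product)

  elementary-suc : ∀ n lo m → elementary (suc n) lo m ≡ weightedStrict (λ i → i) n lo m
  elementary-suc n lo m = sumRange-cong lo (m ∸ 1) (λ i _ _ → sumStrict-* n i (suc i) m product)

  private
    *-+-distrib-swap : ∀ a b c d → a * (b + c * d) ≡ a * b + c * (a * d)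
    *-+-distrib-swap a b c d = trans (*-distribˡ-+ a b (c * d)) (cong (a * b +_) (x∙yz≈y∙xz a c d))

  mutual
    complete-extend : ∀ n lo m → lo ≤ suc m → complete (suc n) lo (suc m) ≡ complete (suc n) lo m + suc m * complete n lo (suc m)
    complete-extend zero lo m lo≤ = begin
      complete 1 lo (suc m)                    ≡⟨ complete-suc 0 lo (suc m) ⟩
      sumRange lo (suc m) (λ i → i * 1)        ≡⟨ sumRange-suc lo m (λ i → i * 1) lo≤ ⟩
      sumRange lo m (λ i → i * 1) + suc m * 1  ≡⟨ cong (_+ suc m * 1) (complete-suc 0 lo m) ⟨
      complete 1 lo m + suc m * 1              ∎
    complete-extend (suc n) lo m lo≤ = begin
      complete (suc (suc n)) lo (suc m)        ≡⟨ complete-suc (suc n) lo (suc m) ⟩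
      weighted (λ i → i) (suc n) lo (suc m)    ≡⟨ weighted-extend (λ i → i) n lo m lo≤ ⟩
      weighted (λ i → i) (suc n) lo m + suc m * weighted (λ i → i) n lo (suc m)
        ≡⟨ cong₂ (λ a b → a + suc m * b) (complete-suc (suc n) lo m) (complete-suc n lo (suc m)) ⟨
      complete (suc (suc n)) lo m + suc m * complete (suc n) lo (suc m) ∎

    weighted-extend : ∀ g n lo m → lo ≤ suc m →
      weighted g (suc n) lo (suc m) ≡ weighted g (suc n) lo m + suc m * weighted g n lo (suc m)
    weighted-extend g n lo m lo≤ = begin
      sumRange lo (suc m) (term (suc n) (suc m))                        ≡⟨ sumRange-suc lo m (term (suc n) (suc m)) lo≤ ⟩
      sumRange lo m (term (suc n) (suc m)) + term (suc n) (suc m) (suc m)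
        ≡⟨ cong₂ _+_ (sumRange-cong lo m split) (cong (g (suc m) *_) diagonal) ⟩
      sumRange lo m (λ i → term (suc n) m i + suc m * term n (suc m) i) + g (suc m) * (suc m * complete n (suc m) (suc m))
        ≡⟨ cong₂ _+_ (sumRange-+ lo m (term (suc n) m) (λ i → suc m * term n (suc m) i)) (x∙yz≈y∙xz (g (suc m)) (suc m) _) ⟩
      weighted g (suc n) lo m + sumRange lo m (λ i → suc m * term n (suc m) i) + suc m * term n (suc m) (suc m)
        ≡⟨ cong (λ s → weighted g (suc n) lo m + s + suc m * term n (suc m) (suc m)) (sumRange-* (suc m) lo m (term n (suc m))) ⟩
      weighted g (suc n) lo m + suc m * sumRange lo m (term n (suc m)) + suc m * term n (suc m) (suc m)
        ≡⟨ +-assoc (weighted g (suc n) lo m) (suc m * sumRange lo m (term n (suc m))) _ ⟩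
      weighted g (suc n) lo m + (suc m * sumRange lo m (term n (suc m)) + suc m * term n (suc m) (suc m))
        ≡⟨ cong (weighted g (suc n) lo m +_) (*-distribˡ-+ (suc m) (sumRange lo m (term n (suc m))) (term n (suc m) (suc m))) ⟨
      weighted g (suc n) lo m + suc m * (sumRange lo m (term n (suc m)) + term n (suc m) (suc m))
        ≡⟨ cong (λ s → weighted g (suc n) lo m + suc m * s) (sumRange-suc lo m (term n (suc m)) lo≤) ⟨
      weighted g (suc n) lo m + suc m * weighted g n lo (suc m) ∎
      where
      term : ℕ → ℕ → ℕ → ℕ
      term n m i = g i * complete n i m
      split : ∀ i → lo ≤ i → i ≤ m → term (suc n) (suc m) i ≡ term (suc n) m i + suc m * term n (suc m) i
      split i _ i≤m = trans (cong (g i *_) (complete-extend n i m (m≤n⇒m≤1+n i≤m))) (*-+-distrib-swap (g i) _ (suc m) _)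
      diagonal : complete (suc n) (suc m) (suc m) ≡ suc m * complete n (suc m) (suc m)
      diagonal = trans (complete-suc n (suc m) (suc m)) (sumRange-single (suc m) (λ i → i * complete n i (suc m)))

  mutual
    elementary-extend : ∀ n lo m → lo ≤ m → elementary (suc n) lo (suc m) ≡ elementary (suc n) lo m + m * elementary n lo m
    elementary-extend zero .zero zero z≤n = refl
    elementary-extend zero lo (suc m) lo≤ = begin
      elementary 1 lo (suc (suc m))              ≡⟨ elementary-suc 0 lo (suc (suc m)) ⟩
      sumRange lo (suc m) (λ i → i * 1)          ≡⟨ sumRange-suc lo m (λ i → i * 1) lo≤ ⟩
      sumRange lo m (λ i → i * 1) + suc m * 1    ≡⟨ cong (_+ suc m * 1) (elementary-suc 0 lo (suc m)) ⟨
      elementary 1 lo (suc m) + suc m * 1        ∎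
    elementary-extend (suc n) lo m lo≤ = begin
      elementary (suc (suc n)) lo (suc m)        ≡⟨ elementary-suc (suc n) lo (suc m) ⟩
      weightedStrict (λ i → i) (suc n) lo (suc m) ≡⟨ weightedStrict-extend (λ i → i) n lo m lo≤ ⟩
      weightedStrict (λ i → i) (suc n) lo m + m * weightedStrict (λ i → i) n lo m
        ≡⟨ cong₂ (λ a b → a + m * b) (elementary-suc (suc n) lo m) (elementary-suc n lo m) ⟨
      elementary (suc (suc n)) lo m + m * elementary (suc n) lo m ∎

    weightedStrict-extend : ∀ g n lo m → lo ≤ m →
      weightedStrict g (suc n) lo (suc m) ≡ weightedStrict g (suc n) lo m + m * weightedStrict g n lo m
    weightedStrict-extend g n .zero zero z≤n = begin
      g 0 * elementary (suc n) 1 1 + 0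
        ≡⟨ cong (λ e → g 0 * e + 0) (trans (elementary-suc n 1 1) (sumRange-empty 1 0 (λ i → i * elementary n (suc i) 1) ≤-refl)) ⟩
      g 0 * 0 + 0
        ≡⟨ cong (λ e → g 0 * e + 0) (trans (elementary-suc n 1 0) (sumRange-empty 1 0 (λ i → i * elementary n (suc i) 0) ≤-refl)) ⟨
      g 0 * elementary (suc n) 1 0 + 0                     ≡⟨ +-identityʳ _ ⟨
      g 0 * elementary (suc n) 1 0 + 0 + 0                 ∎
    weightedStrict-extend g n lo (suc m) lo≤ = begin
      sumRange lo (suc m) (term (suc n) (suc (suc m)))     ≡⟨ sumRange-suc lo m (term (suc n) (suc (suc m))) lo≤ ⟩
      sumRange lo m (term (suc n) (suc (suc m))) + term (suc n) (suc (suc m)) (suc m)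
        ≡⟨ cong₂ _+_ (sumRange-cong lo m split) beyond ⟩
      sumRange lo m (λ i → term (suc n) (suc m) i + suc m * term n (suc m) i) + 0
        ≡⟨ +-identityʳ _ ⟩
      sumRange lo m (λ i → term (suc n) (suc m) i + suc m * term n (suc m) i)
        ≡⟨ sumRange-+ lo m (term (suc n) (suc m)) (λ i → suc m * term n (suc m) i) ⟩
      weightedStrict g (suc n) lo (suc m) + sumRange lo m (λ i → suc m * term n (suc m) i)
        ≡⟨ cong (weightedStrict g (suc n) lo (suc m) +_) (sumRange-* (suc m) lo m (term n (suc m))) ⟩
      weightedStrict g (suc n) lo (suc m) + suc m * weightedStrict g n lo (suc m) ∎
      where
      term : ℕ → ℕ → ℕ → ℕ
      term n m i = g i * elementary n (suc i) m
      split : ∀ i → lo ≤ i → i ≤ m → term (suc n) (suc (suc m)) i ≡ term (suc n) (suc m) i + suc m * term n (suc m) i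
      split i _ i≤m = trans (cong (g i *_) (elementary-extend n (suc i) (suc m) (s≤s i≤m))) (*-+-distrib-swap (g i) _ (suc m) _)
      beyond : term (suc n) (suc (suc m)) (suc m) ≡ 0
      beyond = begin
        g (suc m) * elementary (suc n) (suc (suc m)) (suc (suc m))
          ≡⟨ cong (g (suc m) *_) (elementary-suc n (suc (suc m)) (suc (suc m))) ⟩
        g (suc m) * weightedStrict (λ i → i) n (suc (suc m)) (suc (suc m))
          ≡⟨ cong (g (suc m) *_) (sumRange-empty (suc (suc m)) (suc m) (λ i → i * elementary n (suc i) (suc (suc m))) ≤-refl) ⟩
        g (suc m) * 0                                                ≡⟨ *-zeroʳ (g (suc m)) ⟩
        0                                                            ∎

  square : ℕ → ℕ
  square i = i * i

  sumWeak-weight : ∀ n m → sumWeak (suc n) 1 m weight ≡ weighted square n 1 m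
  sumWeak-weight n m = sumRange-cong 1 m (λ i _ _ → sumWeak-* n (i * i) i m product)

  sumStrict-weight : ∀ n m → sumStrict (suc n) 1 m weight ≡ weightedStrict square n 1 m
  sumStrict-weight n m = sumRange-cong 1 (m ∸ 1) (λ i _ _ → sumStrict-* n (i * i) (suc i) m product)

  Sodd-weighted : ∀ n m → Sodd (suc n + m) m ≡ weighted square n 1 m
  Sodd-weighted zero zero = refl
  Sodd-weighted zero (suc m) = begin
    Sodd (suc (suc m)) (suc m)                            ≡⟨ Sodd-offdiag (suc m) m (n<1+n m) ⟩
    Sodd (suc m) m + suc m * Sodd (suc m) (suc m)
      ≡⟨ cong₂ (λ a b → a + suc m * b) (Sodd-weighted zero m) (Sodd-diag (suc m)) ⟩
    weighted square 0 1 m + suc m * suc m                 ≡⟨ cong (weighted square 0 1 m +_) (*-identityʳ (suc m * suc m)) ⟨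
    weighted square 0 1 m + square (suc m) * 1            ≡⟨ sumRange-suc 1 m (λ i → square i * 1) (s≤s z≤n) ⟨
    weighted square 0 1 (suc m)                           ∎
  Sodd-weighted (suc n) zero = refl
  Sodd-weighted (suc n) (suc m) = begin
    Sodd (suc (suc n) + suc m) (suc m)                    ≡⟨ Sodd-suc-+ (suc n) m ⟩
    Sodd (suc (suc n) + m) m + suc m * Sodd (suc n + suc m) (suc m)
      ≡⟨ cong₂ (λ a b → a + suc m * b) (Sodd-weighted (suc n) m) (Sodd-weighted n (suc m)) ⟩
    weighted square (suc n) 1 m + suc m * weighted square n 1 (suc m)  ≡⟨ weighted-extend square n 1 m (s≤s z≤n) ⟨
    weighted square (suc n) 1 (suc m)                     ∎

  soddSub-weightedStrict : ∀ n m → soddSub m (suc n) ≡ weightedStrict square n 1 m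
  soddSub-weightedStrict n zero = refl
  soddSub-weightedStrict zero (suc zero) = refl
  soddSub-weightedStrict zero (suc (suc m)) = begin
    soddSub (suc (suc m)) 1                               ≡⟨ soddSub-suc (suc m) 0 ⟩
    soddSub (suc m) 1 + suc m * soddSub (suc m) 0
      ≡⟨ cong₂ (λ a b → a + suc m * b) (soddSub-weightedStrict zero (suc m)) (soddSub-zero (suc m)) ⟩
    weightedStrict square 0 1 (suc m) + suc m * suc m
      ≡⟨ cong (weightedStrict square 0 1 (suc m) +_) (*-identityʳ (suc m * suc m)) ⟨
    weightedStrict square 0 1 (suc m) + square (suc m) * 1 ≡⟨ sumRange-suc 1 m (λ i → square i * 1) (s≤s z≤n) ⟨
    weightedStrict square 0 1 (suc (suc m))               ∎
  soddSub-weightedStrict (suc n) (suc zero) = refl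
  soddSub-weightedStrict (suc n) (suc (suc m)) = begin
    soddSub (suc (suc m)) (suc (suc n))                   ≡⟨ soddSub-suc (suc m) (suc n) ⟩
    soddSub (suc m) (suc (suc n)) + suc m * soddSub (suc m) (suc n)
      ≡⟨ cong₂ (λ a b → a + suc m * b) (soddSub-weightedStrict (suc n) (suc m)) (soddSub-weightedStrict n (suc m)) ⟩
    weightedStrict square (suc n) 1 (suc m) + suc m * weightedStrict square n 1 (suc m)
      ≡⟨ weightedStrict-extend square n 1 (suc m) (s≤s z≤n) ⟨
    weightedStrict square (suc n) 1 (suc (suc m))         ∎

  Sodd-sumWeak : ∀ n m → 1 ≤ n → Sodd (n + m) m ≡ sumWeak n 1 m weight
  Sodd-sumWeak (suc n) m _ = trans (Sodd-weighted n m) (sym (sumWeak-weight n m))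

  soddSub-sumStrict : ∀ n m → 1 ≤ n → soddSub m n ≡ sumStrict n 1 m weight
  soddSub-sumStrict (suc n) m _ = trans (soddSub-weightedStrict n m) (sym (sumStrict-weight n m))

module Snoc where

  open import Data.Nat as ℕ using (ℕ; zero; suc)
  open import Data.Fin using (Fin; zero; suc; toℕ; inject₁; fromℕ; _≤_; _<_)
  open import Data.Fin.Properties using (toℕ-inject₁; toℕ-fromℕ; inject₁ℕ<; inject₁-injective)
  open import Data.Fin.Relation.Unary.Top using (view; ‵fromℕ; ‵inject₁)
  open import Data.Vec using (Vec; []; _∷_; lookup; map; _∷ʳ_)
  open import Data.Vec.Properties using (∷-injective; ∷ʳ-injectiveˡ; lookup-map; tabulate∘lookup; tabulate-cong)
  open import Data.Product using (∃; _,_)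
  open import Function using (_∘_)
  open import Relation.Nullary using (contradiction)
  open import Relation.Binary.PropositionalEquality

  private
    variable
      A : Set
      n : ℕ

  inject₁<fromℕ : ∀ (i : Fin n) → inject₁ i < fromℕ n
  inject₁<fromℕ {n} i = subst (toℕ (inject₁ i) ℕ.<_) (sym (toℕ-fromℕ n)) (inject₁ℕ< i)

  inject₁-mono-≤ : ∀ {i j : Fin n} → i ≤ j → inject₁ i ≤ inject₁ j
  inject₁-mono-≤ {i = i} {j} = subst₂ ℕ._≤_ (sym (toℕ-inject₁ i)) (sym (toℕ-inject₁ j))

  inject₁-cancel-≤ : ∀ {i j : Fin n} → inject₁ i ≤ inject₁ j → i ≤ j
  inject₁-cancel-≤ {i = i} {j} = subst₂ ℕ._≤_ (toℕ-inject₁ i) (toℕ-inject₁ j)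

  inject₁-mono-< : ∀ {i j : Fin n} → i < j → inject₁ i < inject₁ j
  inject₁-mono-< {i = i} {j} = subst₂ ℕ._<_ (sym (toℕ-inject₁ i)) (sym (toℕ-inject₁ j))

  inject₁-cancel-< : ∀ {i j : Fin n} → inject₁ i < inject₁ j → i < j
  inject₁-cancel-< {i = i} {j} = subst₂ ℕ._<_ (toℕ-inject₁ i) (toℕ-inject₁ j)

  lookup-∷ʳ-inject₁ : ∀ (w : Vec A n) x i → lookup (w ∷ʳ x) (inject₁ i) ≡ lookup w i
  lookup-∷ʳ-inject₁ (_ ∷ _) x zero = refl
  lookup-∷ʳ-inject₁ (_ ∷ w) x (suc i) = lookup-∷ʳ-inject₁ w x i

  lookup-∷ʳ-fromℕ : ∀ (w : Vec A n) x → lookup (w ∷ʳ x) (fromℕ n) ≡ x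
  lookup-∷ʳ-fromℕ [] x = refl
  lookup-∷ʳ-fromℕ (_ ∷ w) x = lookup-∷ʳ-fromℕ w x

  lookup-ext : ∀ (u v : Vec A n) → (∀ i → lookup u i ≡ lookup v i) → u ≡ v
  lookup-ext u v u≗v = trans (sym (tabulate∘lookup u)) (trans (tabulate-cong u≗v) (tabulate∘lookup v))

  map-inject₁-injective : ∀ {k} (w w′ : Vec (Fin k) n) → map inject₁ w ≡ map inject₁ w′ → w ≡ w′
  map-inject₁-injective [] [] _ = refl
  map-inject₁-injective (a ∷ w) (b ∷ w′) eq with ∷-injective eq
  ... | a≡b , w≡w′ = cong₂ _∷_ (inject₁-injective a≡b) (map-inject₁-injective w w′ w≡w′)

  avoiding-fromℕ : ∀ {k} (w : Vec (Fin (suc k)) n) → (∀ q → lookup w q ≢ fromℕ k) → ∃ λ w′ → w ≡ map inject₁ w′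
  avoiding-fromℕ [] _ = [] , refl
  avoiding-fromℕ (a ∷ w) avoids with view a | avoiding-fromℕ w (avoids ∘ suc)
  ... | ‵fromℕ | _ = contradiction refl (avoids zero)
  ... | ‵inject₁ a′ | w′ , refl = a′ ∷ w′ , refl

  addSingleton : ∀ {k} → Vec (Fin k) n → Vec (Fin (suc k)) (suc n)
  addSingleton {k = k} w = map inject₁ w ∷ʳ fromℕ k

  addSingleton-injective : ∀ {k} (w w′ : Vec (Fin k) n) → addSingleton w ≡ addSingleton w′ → w ≡ w′
  addSingleton-injective w w′ eq = map-inject₁-injective w w′ (∷ʳ-injectiveˡ (map inject₁ w) (map inject₁ w′) eq)

  lookup-addSingleton-inject₁ : ∀ {k} (w : Vec (Fin k) n) i → lookup (addSingleton w) (inject₁ i) ≡ inject₁ (lookup w i)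
  lookup-addSingleton-inject₁ w i = trans (lookup-∷ʳ-inject₁ (map inject₁ w) _ i) (lookup-map i inject₁ w)

  lookup-addSingleton-fromℕ : ∀ {k} (w : Vec (Fin k) n) → lookup (addSingleton w) (fromℕ n) ≡ fromℕ k
  lookup-addSingleton-fromℕ w = lookup-∷ʳ-fromℕ (map inject₁ w) _

module Partitions where

  open import Defs using (HasCount; IsBlockMin; IsOrderedSetPartition; IsPartitionWithLeader; Sodd; δ)
  open Triangle using (stirling₂; δ-count)
  open Snoc
  open import Data.Nat using (ℕ; zero; suc; _+_)
  open import Data.Nat.Properties using (≤-refl; ≤-antisym; <⇒≤; <⇒≱; ≤∧≢⇒<; *-comm)
  open import Data.Fin as Fin using (Fin; zero; suc; inject₁; fromℕ)
  open import Data.Fin.Properties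
    using (toℕ-injective; toℕ-fromℕ; toℕ-inject₁; inject₁-injective; fromℕ≢inject₁; ≤fromℕ; any?; _≟_)
  open import Data.Fin.Relation.Unary.Top using (view; ‵fromℕ; ‵inject₁)
  open import Data.Vec using (Vec; []; _∷_; lookup; map; _∷ʳ_; initLast)
  open import Data.Vec.Properties using (lookup-map; ∷ʳ-injective)
  open import Data.Product using (∃; _×_; _,_; proj₁; proj₂; uncurry)
  open import Data.Sum using (inj₁; inj₂)
  open import Function using (_∘_)
  open import Function.Bundles using (mk⇔)
  open import Relation.Nullary using (yes; no; contradiction)
  open import Relation.Binary.PropositionalEquality

  private
    variable
      k n : ℕ

  blockMin-unique : ∀ {v : Vec (Fin k) n} {b p p′} → IsBlockMin v b p → IsBlockMin v b p′ → p ≡ p′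
  blockMin-unique {p = p} {p′} (vp≡b , p-min) (vp′≡b , p′-min) = toℕ-injective (≤-antisym (p-min p′ vp′≡b) (p′-min p vp≡b))

  module _ {w : Vec (Fin k) n} {x : Fin k} where

    blockMin-∷ʳ⁺ : ∀ {b p} → IsBlockMin w b p → IsBlockMin (w ∷ʳ x) b (inject₁ p)
    blockMin-∷ʳ⁺ {b} {p} (wp≡b , p-min) = trans (lookup-∷ʳ-inject₁ w x p) wp≡b , minimal
      where
      minimal : ∀ q → lookup (w ∷ʳ x) q ≡ b → inject₁ p Fin.≤ q
      minimal q vq≡b with view q
      ... | ‵inject₁ q′ = inject₁-mono-≤ (p-min q′ (trans (sym (lookup-∷ʳ-inject₁ w x q′)) vq≡b))
      ... | ‵fromℕ = <⇒≤ (inject₁<fromℕ p)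

    blockMin-∷ʳ⁻ : ∀ {b p} → IsBlockMin (w ∷ʳ x) b (inject₁ p) → IsBlockMin w b p
    blockMin-∷ʳ⁻ {b} {p} (vp≡b , p-min) =
      trans (sym (lookup-∷ʳ-inject₁ w x p)) vp≡b ,
      λ q wq≡b → inject₁-cancel-≤ (p-min (inject₁ q) (trans (lookup-∷ʳ-inject₁ w x q) wq≡b))

    blockMin-∷ʳ-fromℕ⁻ : ∀ {b} → IsBlockMin (w ∷ʳ x) b (fromℕ n) → x ≡ b × (∀ q → lookup w q ≢ b)
    blockMin-∷ʳ-fromℕ⁻ {b} (vn≡b , n-min) =
      trans (sym (lookup-∷ʳ-fromℕ w x)) vn≡b ,
      λ q wq≡b → <⇒≱ (inject₁<fromℕ q) (n-min (inject₁ q) (trans (lookup-∷ʳ-inject₁ w x q) wq≡b))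

    blockMin-∷ʳ-fromℕ⁺ : ∀ {b} → x ≡ b → (∀ q → lookup w q ≢ b) → IsBlockMin (w ∷ʳ x) b (fromℕ n)
    blockMin-∷ʳ-fromℕ⁺ {b} x≡b b∉w = trans (lookup-∷ʳ-fromℕ w x) x≡b , minimal
      where
      minimal : ∀ q → lookup (w ∷ʳ x) q ≡ b → fromℕ n Fin.≤ q
      minimal q vq≡b with view q
      ... | ‵inject₁ q′ = contradiction (trans (sym (lookup-∷ʳ-inject₁ w x q′)) vq≡b) (b∉w q′)
      ... | ‵fromℕ = ≤-refl

    blockMin-∷ʳ-inject₁ : IsOrderedSetPartition w → ∀ {b p} → IsBlockMin (w ∷ʳ x) b p →
      ∃ λ p₀ → p ≡ inject₁ p₀ × IsBlockMin w b p₀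
    blockMin-∷ʳ-inject₁ (mins , _) {b} {p} p-min with view p
    ... | ‵inject₁ p₀ = p₀ , refl , blockMin-∷ʳ⁻ p-min
    ... | ‵fromℕ = let q , wq≡b , _ = mins b in contradiction wq≡b (proj₂ (blockMin-∷ʳ-fromℕ⁻ p-min) q)

    ordered-∷ʳ⁺ : IsOrderedSetPartition w → IsOrderedSetPartition (w ∷ʳ x)
    ordered-∷ʳ⁺ ordered@(mins , _) = (λ b → let p , p-min = mins b in inject₁ p , blockMin-∷ʳ⁺ p-min) , increasing
      where
      increasing : ∀ b b′ p p′ → b Fin.< b′ → IsBlockMin (w ∷ʳ x) b p → IsBlockMin (w ∷ʳ x) b′ p′ → p Fin.< p′
      increasing b b′ p p′ b<b′ p-min p′-min with blockMin-∷ʳ-inject₁ ordered p-min | blockMin-∷ʳ-inject₁ ordered p′-min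
      ... | p₀ , refl , p₀-min | p₀′ , refl , p₀′-min = inject₁-mono-< (proj₂ ordered b b′ p₀ p₀′ b<b′ p₀-min p₀′-min)

    ordered-∷ʳ⁻ : IsOrderedSetPartition (w ∷ʳ x) → (∃ λ q → lookup w q ≡ x) → IsOrderedSetPartition w
    ordered-∷ʳ⁻ (mins , increasing) (q , wq≡x) =
      minsʷ ,
      λ b b′ p p′ b<b′ p-min p′-min →
        inject₁-cancel-< (increasing b b′ _ _ b<b′ (blockMin-∷ʳ⁺ p-min) (blockMin-∷ʳ⁺ p′-min))
      where
      minsʷ : ∀ b → ∃ λ p → IsBlockMin w b p
      minsʷ b with mins b
      ... | p , p-min with view p
      ...   | ‵inject₁ p₀ = p₀ , blockMin-∷ʳ⁻ p-min
      ...   | ‵fromℕ = let x≡b , b∉w = blockMin-∷ʳ-fromℕ⁻ p-min in contradiction (trans wq≡x x≡b) (b∉w q)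

  new-block-is-last : ∀ {w : Vec (Fin (suc k)) n} {x} → IsOrderedSetPartition (w ∷ʳ x) →
    (∀ q → lookup w q ≢ x) → x ≡ fromℕ k
  new-block-is-last {k} {n} {w} {x} (mins , increasing) x∉w with x ≟ fromℕ k
  ... | yes x≡last = x≡last
  ... | no x≢last =
    contradiction (≤fromℕ p) (<⇒≱ (increasing x (fromℕ k) (fromℕ n) p x<last (blockMin-∷ʳ-fromℕ⁺ {w = w} {x = x} refl x∉w) p-min))
    where
    p = proj₁ (mins (fromℕ k))
    p-min = proj₂ (mins (fromℕ k))
    x<last : x Fin.< fromℕ k
    x<last = ≤∧≢⇒< (≤fromℕ x) (x≢last ∘ toℕ-injective)

  module _ {w′ : Vec (Fin k) n} where

    private
      lookup-map-inject₁ : ∀ q → lookup (map inject₁ w′) q ≡ inject₁ (lookup w′ q)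
      lookup-map-inject₁ q = lookup-map q inject₁ w′

      last∉map : ∀ q → lookup (map inject₁ w′) q ≢ fromℕ k
      last∉map q eq = fromℕ≢inject₁ (sym (trans (sym (lookup-map-inject₁ q)) eq))

    blockMin-addSingleton-last : IsBlockMin (addSingleton w′) (fromℕ k) (fromℕ n)
    blockMin-addSingleton-last = blockMin-∷ʳ-fromℕ⁺ {w = map inject₁ w′} {x = fromℕ k} refl last∉map

    blockMin-addSingleton⁺ : ∀ {b p} → IsBlockMin w′ b p → IsBlockMin (addSingleton w′) (inject₁ b) (inject₁ p)
    blockMin-addSingleton⁺ (wp≡b , p-min) =
      blockMin-∷ʳ⁺ {w = map inject₁ w′} {x = fromℕ k} (trans (lookup-map-inject₁ _) (cong inject₁ wp≡b) ,
                    λ q eq → p-min q (inject₁-injective (trans (sym (lookup-map-inject₁ q)) eq)))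

    blockMin-addSingleton⁻ : ∀ {b p} → IsBlockMin (addSingleton w′) (inject₁ b) p →
      ∃ λ p₀ → p ≡ inject₁ p₀ × IsBlockMin w′ b p₀
    blockMin-addSingleton⁻ {b} {p} p-min with view p
    ... | ‵inject₁ p₀ =
      let vp≡b , p₀-min = blockMin-∷ʳ⁻ {w = map inject₁ w′} {x = fromℕ k} p-min in
      p₀ , refl , inject₁-injective (trans (sym (lookup-map-inject₁ p₀)) vp≡b) ,
      λ q wq≡b → p₀-min q (trans (lookup-map-inject₁ q) (cong inject₁ wq≡b))
    ... | ‵fromℕ = contradiction (proj₁ (blockMin-∷ʳ-fromℕ⁻ {w = map inject₁ w′} {x = fromℕ k} p-min)) fromℕ≢inject₁

    ordered-addSingleton⁺ : IsOrderedSetPartition w′ → IsOrderedSetPartition (addSingleton w′)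
    ordered-addSingleton⁺ (mins , increasing) = minsˢ , increasingˢ
      where
      minsˢ : ∀ b → ∃ λ p → IsBlockMin (addSingleton w′) b p
      minsˢ b with view b
      ... | ‵inject₁ b₀ = let p , p-min = mins b₀ in inject₁ p , blockMin-addSingleton⁺ p-min
      ... | ‵fromℕ = fromℕ n , blockMin-addSingleton-last
      increasingˢ : ∀ b b′ p p′ → b Fin.< b′ →
        IsBlockMin (addSingleton w′) b p → IsBlockMin (addSingleton w′) b′ p′ → p Fin.< p′
      increasingˢ b b′ p p′ b<b′ p-min p′-min with view b | view b′
      ... | ‵fromℕ | _ = contradiction (≤fromℕ b′) (<⇒≱ b<b′)
      ... | ‵inject₁ b₀ | ‵fromℕ
        with blockMin-addSingleton⁻ p-min | blockMin-unique {v = addSingleton w′} p′-min blockMin-addSingleton-last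
      ...   | p₀ , refl , _ | refl = inject₁<fromℕ p₀
      increasingˢ b b′ p p′ b<b′ p-min p′-min | ‵inject₁ b₀ | ‵inject₁ b₀′
        with blockMin-addSingleton⁻ p-min | blockMin-addSingleton⁻ p′-min
      ... | p₀ , refl , p₀-min | p₀′ , refl , p₀′-min =
        inject₁-mono-< (increasing b₀ b₀′ p₀ p₀′ (inject₁-cancel-< b<b′) p₀-min p₀′-min)

    ordered-addSingleton⁻ : IsOrderedSetPartition (addSingleton w′) → IsOrderedSetPartition w′
    ordered-addSingleton⁻ (mins , increasing) =
      (λ b → let p₀ , _ , p₀-min = blockMin-addSingleton⁻ (proj₂ (mins (inject₁ b))) in p₀ , p₀-min) ,
      λ b b′ p p′ b<b′ p-min p′-min →
        inject₁-cancel-< (increasing _ _ _ _ (inject₁-mono-< b<b′) (blockMin-addSingleton⁺ p-min) (blockMin-addSingleton⁺ p′-min))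

    addSingleton≢∷ʳ : ∀ {w x} → IsOrderedSetPartition w → addSingleton w′ ≢ w ∷ʳ x
    addSingleton≢∷ʳ {w} {x} (mins , _) eq with ∷ʳ-injective (map inject₁ w′) w eq
    ... | map≡w , last≡x = last∉map q (trans (cong (λ u → lookup u q) map≡w) (trans wq≡x (sym last≡x)))
      where
      q = proj₁ (mins x)
      wq≡x = proj₁ (proj₂ (mins x))

  data LastElement : Vec (Fin (suc k)) (suc n) → Set where
    singleton : (w′ : Vec (Fin k) n) → IsOrderedSetPartition w′ → LastElement (addSingleton w′)
    joined : (w : Vec (Fin (suc k)) n) (x : Fin (suc k)) → IsOrderedSetPartition w → LastElement (w ∷ʳ x)

  lastElement : ∀ (v : Vec (Fin (suc k)) (suc n)) → IsOrderedSetPartition v → LastElement v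
  lastElement v ordered with initLast v
  ... | w , x , refl with any? (λ q → lookup w q ≟ x)
  ...   | yes x∈w = joined w x (ordered-∷ʳ⁻ {w = w} {x = x} ordered x∈w)
  ...   | no x∉w with new-block-is-last {w = w} ordered (λ q wq≡x → x∉w (q , wq≡x))
  ...     | refl with avoiding-fromℕ w (λ q wq≡x → x∉w (q , wq≡x))
  ...       | w′ , refl = singleton w′ (ordered-addSingleton⁻ {w′ = w′} ordered)

  module _ {ℓ : Fin (suc k)} {w : Vec (Fin (suc k)) n} {x : Fin (suc k)} where

    leader-∷ʳ⁺ : IsPartitionWithLeader (ℓ , w) → IsPartitionWithLeader (ℓ , w ∷ʳ x)
    leader-∷ʳ⁺ (ordered , p , p-min , p≡ℓ) =
      ordered-∷ʳ⁺ {w = w} {x = x} ordered , inject₁ p , blockMin-∷ʳ⁺ {w = w} {x = x} p-min , trans (toℕ-inject₁ p) p≡ℓ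

    leader-∷ʳ⁻ : IsOrderedSetPartition w → IsPartitionWithLeader (ℓ , w ∷ʳ x) → IsPartitionWithLeader (ℓ , w)
    leader-∷ʳ⁻ orderedʷ (_ , p , p-min , p≡ℓ) with blockMin-∷ʳ-inject₁ {w = w} {x = x} orderedʷ p-min
    ... | p₀ , refl , p₀-min = orderedʷ , p₀ , p₀-min , trans (sym (toℕ-inject₁ p₀)) p≡ℓ

  module _ {w′ : Vec (Fin k) n} where

    leader-addSingleton⁺ : ∀ {ℓ′} → IsPartitionWithLeader (ℓ′ , w′) → IsPartitionWithLeader (inject₁ ℓ′ , addSingleton w′)
    leader-addSingleton⁺ {ℓ′} (ordered , p , p-min , p≡ℓ) =
      ordered-addSingleton⁺ {w′ = w′} ordered , inject₁ p , blockMin-addSingleton⁺ {w′ = w′} p-min ,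
      trans (toℕ-inject₁ p) (trans p≡ℓ (sym (toℕ-inject₁ ℓ′)))

    leader-addSingleton⁻ : ∀ {ℓ′} → IsPartitionWithLeader (inject₁ ℓ′ , addSingleton w′) → IsPartitionWithLeader (ℓ′ , w′)
    leader-addSingleton⁻ {ℓ′} (ordered , p , p-min , p≡ℓ) with blockMin-addSingleton⁻ {w′ = w′} p-min
    ... | p₀ , refl , p₀-min =
      ordered-addSingleton⁻ {w′ = w′} ordered , p₀ , p₀-min , trans (sym (toℕ-inject₁ p₀)) (trans p≡ℓ (toℕ-inject₁ ℓ′))

    leader-last⁺ : IsOrderedSetPartition w′ → n ≡ k → IsPartitionWithLeader (fromℕ k , addSingleton w′)
    leader-last⁺ ordered refl = ordered-addSingleton⁺ {w′ = w′} ordered , fromℕ n , blockMin-addSingleton-last {w′ = w′} , refl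

    leader-last⁻ : IsPartitionWithLeader (fromℕ k , addSingleton w′) → n ≡ k
    leader-last⁻ (_ , p , p-min , p≡ℓ) with blockMin-unique {v = addSingleton w′} p-min (blockMin-addSingleton-last {w′ = w′})
    ... | refl = trans (sym (toℕ-fromℕ n)) (trans p≡ℓ (toℕ-fromℕ k))

  private
    ∷ʳ-pair-injective : ∀ {A : Set} {n} {a a′ : Vec A n × A} → uncurry _∷ʳ_ a ≡ uncurry _∷ʳ_ a′ → a ≡ a′
    ∷ʳ-pair-injective {a = w , x} {w′ , x′} eq with ∷ʳ-injective w w′ eq
    ... | refl , refl = refl

    snocWithLeader : ∀ {A B : Set} {n} → (A × Vec B n) × B → A × Vec B (suc n)
    snocWithLeader ((ℓ , w) , x) = ℓ , w ∷ʳ x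

    snocWithLeader-injective : ∀ {A B : Set} {n} {a a′ : (A × Vec B n) × B} → snocWithLeader a ≡ snocWithLeader a′ → a ≡ a′
    snocWithLeader-injective {a = (ℓ , w) , x} {(ℓ′ , w′) , x′} eq
      with cong proj₁ eq | ∷ʳ-pair-injective {a = w , x} {w′ , x′} (cong proj₂ eq)
    ... | refl | refl = refl

  ordered-count : ∀ n k → HasCount (Vec (Fin k) n) IsOrderedSetPartition (stirling₂ n k)
  ordered-count zero zero = Count.single [] (λ { [] _ → refl }) ((λ ()) , (λ ()))
  ordered-count zero (suc k) = Count.none (λ { [] (mins , _) → contradiction (proj₁ (mins zero)) (λ ()) })
  ordered-count (suc n) zero = Count.none (λ { (() ∷ _) _ })
  ordered-count (suc n) (suc k) =
    subst (HasCount _ _) (cong (stirling₂ n k +_) (*-comm (stirling₂ n (suc k)) (suc k)))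
      (Count.resp (λ v → mk⇔ (sound v) (complete v)) (Count.⊎⁺ singletons joins disjoint))
    where
    singletons = Count.image⁺ addSingleton (λ _ _ → addSingleton-injective _ _) (ordered-count n k)
    joins = Count.image⁺ (uncurry _∷ʳ_) (λ _ _ → ∷ʳ-pair-injective)
              (Count.Σ⁺ (λ _ _ → Count.allFin⁺ (suc k)) (ordered-count n (suc k)))
    disjoint : ∀ v → _ → _ → _
    disjoint v (w′ , _ , refl) ((w , x) , (ordered , _) , eq) = addSingleton≢∷ʳ {w′ = w′} ordered (sym eq)
    sound : ∀ v → _ → IsOrderedSetPartition v
    sound v (inj₁ (w′ , ordered , refl)) = ordered-addSingleton⁺ {w′ = w′} ordered
    sound v (inj₂ ((w , x) , (ordered , _) , refl)) = ordered-∷ʳ⁺ {w = w} {x = x} ordered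
    complete : ∀ v → IsOrderedSetPartition v → _
    complete v ordered with lastElement v ordered
    ... | singleton w′ orderedʷ = inj₁ (w′ , orderedʷ , refl)
    ... | joined w x orderedʷ = inj₂ ((w , x) , (orderedʷ , _) , refl)

  leader-count : ∀ n k → HasCount (Fin k × Vec (Fin k) n) IsPartitionWithLeader (Sodd n k)
  leader-count zero zero = Count.none (λ { (() , _) _ })
  leader-count (suc n) zero = Count.none (λ { (() , _) _ })
  leader-count zero (suc k) = Count.none (λ { (_ , []) ((mins , _) , _) → contradiction (proj₁ (mins zero)) (λ ()) })
  leader-count (suc n) (suc k) =
    subst (HasCount _ _) (cong (λ c → Sodd n k + c + δ n k) (*-comm (Sodd n (suc k)) (suc k)))
      (Count.resp (λ v → mk⇔ (sound v) (complete v)) (Count.⊎⁺ (Count.⊎⁺ oldLeader joins disjoint₁) newLeader disjoint₂))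
    where
    oldLeader = Count.image⁺ (λ (ℓ′ , w′) → inject₁ ℓ′ , addSingleton w′)
                  (λ _ _ eq → cong₂ _,_ (inject₁-injective (cong proj₁ eq)) (addSingleton-injective _ _ (cong proj₂ eq)))
                  (leader-count n k)
    joins = Count.image⁺ snocWithLeader (λ _ _ → snocWithLeader-injective)
              (Count.Σ⁺ (λ _ _ → Count.allFin⁺ (suc k)) (leader-count n (suc k)))
    newLeader = Count.image⁺ (λ w′ → fromℕ k , addSingleton w′) (λ _ _ eq → addSingleton-injective _ _ (cong proj₂ eq))
                  (δ-count {A = λ j → Vec (Fin j) n} {P = IsOrderedSetPartition} _ n k (ordered-count n n))
    disjoint₁ : ∀ v → _ → _ → _
    disjoint₁ v ((_ , w′) , _ , refl) (_ , ((ordered , _) , _) , eq) = addSingleton≢∷ʳ {w′ = w′} ordered (sym (cong proj₂ eq))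
    disjoint₂ : ∀ v → _ → _ → _
    disjoint₂ v (inj₁ (_ , _ , refl)) (_ , _ , eq) = fromℕ≢inject₁ (cong proj₁ eq)
    disjoint₂ v (inj₂ (_ , ((ordered , _) , _) , refl)) (w′ , _ , eq) = addSingleton≢∷ʳ {w′ = w′} ordered (cong proj₂ eq)
    sound : ∀ v → _ → IsPartitionWithLeader v
    sound _ (inj₁ (inj₁ ((_ , w′) , leader , refl))) = leader-addSingleton⁺ {w′ = w′} leader
    sound _ (inj₁ (inj₂ (((_ , w) , x) , (leader , _) , refl))) = leader-∷ʳ⁺ {w = w} {x = x} leader
    sound _ (inj₂ (w′ , (ordered , n≡k) , refl)) = leader-last⁺ {w′ = w′} ordered n≡k
    complete : ∀ v → IsPartitionWithLeader v → _
    complete (ℓ , v) leader@(ordered , _) with lastElement v ordered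
    ... | joined w x orderedʷ = inj₁ (inj₂ (((ℓ , w) , x) , (leader-∷ʳ⁻ {w = w} {x = x} orderedʷ leader , _) , refl))
    ... | singleton w′ orderedʷ with view ℓ
    ...   | ‵inject₁ ℓ′ = inj₁ (inj₁ ((ℓ′ , w′) , leader-addSingleton⁻ {w′ = w′} leader , refl))
    ...   | ‵fromℕ = inj₂ (w′ , (orderedʷ , leader-last⁻ {w′ = w′} leader) , refl)

module Permutations where

  open import Defs using (HasCount; IsPermutation; iter; IsCycleMin; HasCycles; IsPermutationWithLeader; sodd; δ)
  open CountOnFin using (inject₁⁺; inject₁⁻; inject₁-fromℕ⁺; inject₁-fromℕ⁻)
  open Triangle using (stirling₁; δ-count)
  open Snoc
  open import Data.Nat as ℕ using (ℕ; zero; suc; _+_; z≤n; s≤s⁻¹)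
  open import Data.Nat.Properties using (≤-refl; <⇒≤; <⇒≱; <⇒≢; n<1+n; *-comm; ≤-antisym; <-irrefl)
  open import Data.Fin as Fin using (Fin; zero; suc; toℕ; inject₁; fromℕ)
  open import Data.Fin.Properties
    using (_≟_; toℕ-injective; toℕ-inject₁; toℕ-fromℕ; toℕ<n; inject₁-injective; fromℕ≢inject₁; any?; pigeonhole)
  open import Data.Fin.Relation.Unary.Top using (view; ‵fromℕ; ‵inject₁)
  open import Data.Vec using (Vec; []; lookup; tabulate; _∷ʳ_; initLast)
  open import Data.Vec.Properties using (lookup∘tabulate)
  open import Data.Product using (∃; _×_; _,_; proj₁; proj₂; uncurry)
  open import Data.Sum using (_⊎_; inj₁; inj₂)
  open import Data.Empty using (⊥-elim)
  open import Function using (_∘_)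
  open import Function.Bundles using (_⇔_; mk⇔; Equivalence)
  open import Relation.Nullary using (¬_; yes; no; contradiction)
  open import Relation.Binary.PropositionalEquality

  open Equivalence

  private
    variable
      n k c : ℕ

  private
    redirect : Vec (Fin n) n → Fin n → Fin n → Fin (suc n)
    redirect {n} σ y z with z ≟ y
    ... | yes _ = fromℕ n
    ... | no _ = inject₁ (lookup σ z)

  -- The new point n is put into the cycle of y, right after y.
  insertAfter : Vec (Fin n) n → Fin n → Vec (Fin (suc n)) (suc n)
  insertAfter σ y = tabulate (redirect σ y) ∷ʳ inject₁ (lookup σ y)

  module _ (σ : Vec (Fin n) n) (y : Fin n) where

    lookup-insertAfter-at : lookup (insertAfter σ y) (inject₁ y) ≡ fromℕ n
    lookup-insertAfter-at = trans (lookup-∷ʳ-inject₁ (tabulate (redirect σ y)) _ y) (trans (lookup∘tabulate _ y) redirect-y)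
      where
      redirect-y : redirect σ y y ≡ fromℕ n
      redirect-y with y ≟ y
      ... | yes _ = refl
      ... | no y≢y = contradiction refl y≢y

    lookup-insertAfter-≢ : ∀ {z} → z ≢ y → lookup (insertAfter σ y) (inject₁ z) ≡ inject₁ (lookup σ z)
    lookup-insertAfter-≢ {z} z≢y = trans (lookup-∷ʳ-inject₁ (tabulate (redirect σ y)) _ z) (trans (lookup∘tabulate _ z) redirect-z)
      where
      redirect-z : redirect σ y z ≡ inject₁ (lookup σ z)
      redirect-z with z ≟ y
      ... | yes z≡y = contradiction z≡y z≢y
      ... | no _ = refl

    lookup-insertAfter-fromℕ : lookup (insertAfter σ y) (fromℕ n) ≡ inject₁ (lookup σ y)
    lookup-insertAfter-fromℕ = lookup-∷ʳ-fromℕ (tabulate (redirect σ y)) _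

    private
      τ = insertAfter σ y

      position : Fin n → Fin (suc n)
      position u with u ≟ y
      ... | yes _ = fromℕ n
      ... | no _ = inject₁ u

      lookup-position : ∀ u → lookup τ (position u) ≡ inject₁ (lookup σ u)
      lookup-position u with u ≟ y
      ... | yes refl = lookup-insertAfter-fromℕ
      ... | no u≢y = lookup-insertAfter-≢ u≢y

      position-injective : ∀ u v → position u ≡ position v → u ≡ v
      position-injective u v eq with u ≟ y | v ≟ y
      ... | yes refl | yes refl = refl
      ... | yes _ | no _ = contradiction eq fromℕ≢inject₁
      ... | no _ | yes _ = contradiction (sym eq) fromℕ≢inject₁
      ... | no _ | no _ = inject₁-injective eq

      positions : ∀ q → q ≡ inject₁ y ⊎ ∃ λ u → position u ≡ q
      positions q with view q
      ... | ‵fromℕ = inj₂ (y , position-y)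
        where
        position-y : position y ≡ fromℕ n
        position-y with y ≟ y
        ... | yes _ = refl
        ... | no y≢y = contradiction refl y≢y
      ... | ‵inject₁ z with z ≟ y
      ...   | yes refl = inj₁ refl
      ...   | no z≢y = inj₂ (z , position-z)
        where
        position-z : position z ≡ inject₁ z
        position-z with z ≟ y
        ... | yes z≡y = contradiction z≡y z≢y
        ... | no _ = refl

    permutation-insertAfter⁺ : IsPermutation σ → IsPermutation τ
    permutation-insertAfter⁺ σ-injective i j eq with positions i | positions j
    ... | inj₁ refl | inj₁ refl = refl
    ... | inj₁ refl | inj₂ (u , refl) = contradiction (trans (sym lookup-insertAfter-at) (trans eq (lookup-position u))) fromℕ≢inject₁
    ... | inj₂ (u , refl) | inj₁ refl = contradiction (trans (sym lookup-insertAfter-at) (trans (sym eq) (lookup-position u))) fromℕ≢inject₁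
    ... | inj₂ (u , refl) | inj₂ (v , refl) =
      cong position (σ-injective u v (inject₁-injective (trans (sym (lookup-position u)) (trans eq (lookup-position v)))))

    permutation-insertAfter⁻ : IsPermutation τ → IsPermutation σ
    permutation-insertAfter⁻ τ-injective u v eq =
      position-injective u v (τ-injective _ _ (trans (lookup-position u) (trans (cong inject₁ eq) (sym (lookup-position v)))))

  module _ (σ : Vec (Fin n) n) where

    permutation-addSingleton⁺ : IsPermutation σ → IsPermutation (addSingleton σ)
    permutation-addSingleton⁺ σ-injective i j eq with view i | view j
    ... | ‵inject₁ i′ | ‵inject₁ j′ =
      cong inject₁ (σ-injective i′ j′ (inject₁-injective
        (trans (sym (lookup-addSingleton-inject₁ σ i′)) (trans eq (lookup-addSingleton-inject₁ σ j′)))))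
    ... | ‵inject₁ i′ | ‵fromℕ =
      contradiction (trans (sym (lookup-addSingleton-fromℕ σ)) (trans (sym eq) (lookup-addSingleton-inject₁ σ i′))) fromℕ≢inject₁
    ... | ‵fromℕ | ‵inject₁ j′ =
      contradiction (trans (sym (lookup-addSingleton-fromℕ σ)) (trans eq (lookup-addSingleton-inject₁ σ j′))) fromℕ≢inject₁
    ... | ‵fromℕ | ‵fromℕ = refl

    permutation-addSingleton⁻ : IsPermutation (addSingleton σ) → IsPermutation σ
    permutation-addSingleton⁻ τ-injective i j eq = inject₁-injective (τ-injective (inject₁ i) (inject₁ j)
      (trans (lookup-addSingleton-inject₁ σ i) (trans (cong inject₁ eq) (sym (lookup-addSingleton-inject₁ σ j)))))

    iter-addSingleton-inject₁ : ∀ t x → iter (addSingleton σ) t (inject₁ x) ≡ inject₁ (iter σ t x)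
    iter-addSingleton-inject₁ zero x = refl
    iter-addSingleton-inject₁ (suc t) x =
      trans (cong (lookup (addSingleton σ)) (iter-addSingleton-inject₁ t x)) (lookup-addSingleton-inject₁ σ (iter σ t x))

    iter-addSingleton-fromℕ : ∀ t → iter (addSingleton σ) t (fromℕ n) ≡ fromℕ n
    iter-addSingleton-fromℕ zero = refl
    iter-addSingleton-fromℕ (suc t) = trans (cong (lookup (addSingleton σ)) (iter-addSingleton-fromℕ t)) (lookup-addSingleton-fromℕ σ)

    cycleMin-addSingleton : ∀ x → IsCycleMin (addSingleton σ) (inject₁ x) ⇔ IsCycleMin σ x
    cycleMin-addSingleton x = mk⇔
      (λ minimal t → inject₁-cancel-≤ (subst (inject₁ x Fin.≤_) (iter-addSingleton-inject₁ t x) (minimal t)))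
      (λ minimal t → subst (inject₁ x Fin.≤_) (sym (iter-addSingleton-inject₁ t x)) (inject₁-mono-≤ (minimal t)))

    cycleMin-addSingleton-fromℕ : IsCycleMin (addSingleton σ) (fromℕ n)
    cycleMin-addSingleton-fromℕ t = subst (fromℕ n Fin.≤_) (sym (iter-addSingleton-fromℕ t)) ≤-refl

  module _ (σ : Vec (Fin n) n) (y : Fin n) where

    private
      τ = insertAfter σ y

    module _ (x : Fin n) where

      private
        orbit⁻ : ∀ t → ∃ λ t′ →
          iter τ t (inject₁ x) ≡ inject₁ (iter σ t′ x) ⊎ (iter τ t (inject₁ x) ≡ fromℕ n × iter σ t′ x ≡ y)
        orbit⁻ zero = zero , inj₁ refl
        orbit⁻ (suc t) with orbit⁻ t
        ... | t′ , inj₂ (at-end , refl) = suc t′ , inj₁ (trans (cong (lookup τ) at-end) (lookup-insertAfter-fromℕ σ _))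
        ... | t′ , inj₁ eq with iter σ t′ x ≟ y
        ...   | yes refl = t′ , inj₂ (trans (cong (lookup τ) eq) (lookup-insertAfter-at σ _) , refl)
        ...   | no ≢y = suc t′ , inj₁ (trans (cong (lookup τ) eq) (lookup-insertAfter-≢ σ y ≢y))

        orbit⁺ : ∀ t′ → ∃ λ t → iter τ t (inject₁ x) ≡ inject₁ (iter σ t′ x)
        orbit⁺ zero = zero , refl
        orbit⁺ (suc t′) with orbit⁺ t′
        ... | t , eq with iter σ t′ x ≟ y
        ...   | yes refl = suc (suc t) , trans (cong (lookup τ) (trans (cong (lookup τ) eq) (lookup-insertAfter-at σ _)))
                                               (lookup-insertAfter-fromℕ σ _)
        ...   | no ≢y = suc t , trans (cong (lookup τ) eq) (lookup-insertAfter-≢ σ y ≢y)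

      cycleMin-insertAfter : IsCycleMin τ (inject₁ x) ⇔ IsCycleMin σ x
      cycleMin-insertAfter = mk⇔ from-τ to-τ
        where
        from-τ : IsCycleMin τ (inject₁ x) → IsCycleMin σ x
        from-τ minimal t′ = let t , eq = orbit⁺ t′ in inject₁-cancel-≤ (subst (inject₁ x Fin.≤_) eq (minimal t))
        to-τ : IsCycleMin σ x → IsCycleMin τ (inject₁ x)
        to-τ minimal t with orbit⁻ t
        ... | t′ , inj₁ eq = subst (inject₁ x Fin.≤_) (sym eq) (inject₁-mono-≤ (minimal t′))
        ... | t′ , inj₂ (at-end , _) = subst (inject₁ x Fin.≤_) (sym at-end) (<⇒≤ (inject₁<fromℕ x))

    ¬cycleMin-insertAfter-fromℕ : ¬ IsCycleMin τ (fromℕ n)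
    ¬cycleMin-insertAfter-fromℕ minimal =
      <⇒≱ (inject₁<fromℕ (lookup σ y)) (subst (fromℕ n Fin.≤_) (lookup-insertAfter-fromℕ σ y) (minimal 1))

  insertAfter-injective : ∀ (σ σ′ : Vec (Fin n) n) y y′ → insertAfter σ y ≡ insertAfter σ′ y′ → σ ≡ σ′ × y ≡ y′
  insertAfter-injective σ σ′ y y′ eq with y ≟ y′
  ... | no y≢y′ = contradiction
    (trans (sym (lookup-insertAfter-at σ y)) (trans (cong (λ τ → lookup τ (inject₁ y)) eq) (lookup-insertAfter-≢ σ′ y′ y≢y′)))
    fromℕ≢inject₁
  ... | yes refl = lookup-ext σ σ′ pointwise , refl
    where
    pointwise : ∀ u → lookup σ u ≡ lookup σ′ u
    pointwise u with u ≟ y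
    ... | yes refl = inject₁-injective (trans (sym (lookup-insertAfter-fromℕ σ u))
                       (trans (cong (λ τ → lookup τ (fromℕ _)) eq) (lookup-insertAfter-fromℕ σ′ u)))
    ... | no u≢y = inject₁-injective (trans (sym (lookup-insertAfter-≢ σ y u≢y))
                     (trans (cong (λ τ → lookup τ (inject₁ u)) eq) (lookup-insertAfter-≢ σ′ y u≢y)))

  addSingleton≢insertAfter : ∀ (σ σ′ : Vec (Fin n) n) y → addSingleton σ ≢ insertAfter σ′ y
  addSingleton≢insertAfter σ σ′ y eq = fromℕ≢inject₁
    (trans (sym (lookup-addSingleton-fromℕ σ)) (trans (cong (λ τ → lookup τ (fromℕ _)) eq) (lookup-insertAfter-fromℕ σ′ y)))

  data LastPoint : Vec (Fin (suc n)) (suc n) → Set where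
    fixed : (σ : Vec (Fin n) n) → IsPermutation σ → LastPoint (addSingleton σ)
    inserted : (σ : Vec (Fin n) n) (y : Fin n) → IsPermutation σ → LastPoint (insertAfter σ y)

  private
    lower : (q : Fin (suc n)) → q ≢ fromℕ n → Fin n
    lower q q≢last with view q
    ... | ‵inject₁ p = p
    ... | ‵fromℕ = contradiction refl q≢last

    inject₁-lower : ∀ (q : Fin (suc n)) q≢last → inject₁ (lower q q≢last) ≡ q
    inject₁-lower q q≢last with view q
    ... | ‵inject₁ p = refl
    ... | ‵fromℕ = contradiction refl q≢last

    surjective-onto-fromℕ : ∀ (τ : Vec (Fin (suc n)) (suc n)) → IsPermutation τ → ∃ λ z → lookup τ z ≡ fromℕ n
    surjective-onto-fromℕ {n} τ τ-injective with any? (λ z → lookup τ z ≟ fromℕ n)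
    ... | yes hit = hit
    ... | no miss with pigeonhole (n<1+n n) (λ z → lower (lookup τ z) (miss ∘ (z ,_)))
    ...   | i , j , i<j , same = contradiction
      (cong toℕ (τ-injective i j (trans (sym (inject₁-lower _ _)) (trans (cong inject₁ same) (inject₁-lower _ _)))))
      (<⇒≢ i<j)

  lastPoint : ∀ (τ : Vec (Fin (suc n)) (suc n)) → IsPermutation τ → LastPoint τ
  lastPoint {n} τ τ-injective with lookup τ (fromℕ n) ≟ fromℕ n
  ... | yes fixes-last = fixedCase τ τ-injective fixes-last
    where
    fixedCase : ∀ τ → IsPermutation τ → lookup τ (fromℕ n) ≡ fromℕ n → LastPoint τ
    fixedCase τ τ-injective fixes-last with initLast τ
    ... | w , x , refl with trans (sym (lookup-∷ʳ-fromℕ w x)) fixes-last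
    ...   | refl with avoiding-fromℕ w (λ q wq≡last → fromℕ≢inject₁ (sym (τ-injective (inject₁ q) (fromℕ n)
                        (trans (lookup-∷ʳ-inject₁ w x q) (trans wq≡last (sym fixes-last))))))
    ...     | σ , refl = fixed σ (permutation-addSingleton⁻ σ τ-injective)
  ... | no moves-last with surjective-onto-fromℕ τ τ-injective
  ...   | z , τz≡last with view z
  ...     | ‵fromℕ = contradiction τz≡last moves-last
  ...     | ‵inject₁ y = subst LastPoint (sym τ≡) (inserted σ y (permutation-insertAfter⁻ σ y (subst IsPermutation τ≡ τ-injective)))
    where
    shifted : Fin n → Fin n
    shifted u with u ≟ y
    ... | yes _ = lower (lookup τ (fromℕ n)) moves-last
    ... | no u≢y = lower (lookup τ (inject₁ u))
                    (λ τu≡last → u≢y (inject₁-injective (τ-injective _ _ (trans τu≡last (sym τz≡last)))))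

    σ = tabulate shifted

    pointwise : ∀ q → lookup τ q ≡ lookup (insertAfter σ y) q
    pointwise q with view q
    ... | ‵fromℕ = sym (trans (lookup-insertAfter-fromℕ σ y) (trans (cong inject₁ (lookup∘tabulate shifted y)) shifted-y))
      where
      shifted-y : inject₁ (shifted y) ≡ lookup τ (fromℕ n)
      shifted-y with y ≟ y
      ... | yes _ = inject₁-lower _ _
      ... | no y≢y = contradiction refl y≢y
    ... | ‵inject₁ u with u ≟ y
    ...   | yes refl = trans τz≡last (sym (lookup-insertAfter-at σ u))
    ...   | no u≢y = sym (trans (lookup-insertAfter-≢ σ y u≢y) (trans (cong inject₁ (lookup∘tabulate shifted u)) shifted-u))
      where
      shifted-u : inject₁ (shifted u) ≡ lookup τ (inject₁ u)
      shifted-u with u ≟ y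
      ... | yes u≡y = contradiction u≡y u≢y
      ... | no _ = inject₁-lower _ _

    τ≡ : τ ≡ insertAfter σ y
    τ≡ = lookup-ext τ (insertAfter σ y) pointwise

  MinimaBelow : Vec (Fin n) n → Fin n → Fin n → Set
  MinimaBelow σ x z = z Fin.< x × IsCycleMin σ z

  private
    minimaBelow-inject₁ : ∀ {σ : Vec (Fin n) n} {τ} x → (∀ z → IsCycleMin τ (inject₁ z) ⇔ IsCycleMin σ z) →
      ∀ z → MinimaBelow τ (inject₁ x) (inject₁ z) ⇔ MinimaBelow σ x z
    minimaBelow-inject₁ x cycleMin⇔ z =
      mk⇔ (λ (z<x , minimal) → inject₁-cancel-< z<x , to (cycleMin⇔ z) minimal)
          (λ (z<x , minimal) → inject₁-mono-< z<x , from (cycleMin⇔ z) minimal)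

    ¬minimaBelow-fromℕ : ∀ {τ : Vec (Fin (suc n)) (suc n)} x → ¬ MinimaBelow τ (inject₁ x) (fromℕ n)
    ¬minimaBelow-fromℕ x (last<x , _) = <⇒≱ last<x (<⇒≤ (inject₁<fromℕ x))

  module _ (σ : Vec (Fin n) n) where

    cycles-addSingleton⁺ : HasCycles σ c → HasCycles (addSingleton σ) (suc c)
    cycles-addSingleton⁺ = inject₁-fromℕ⁺ (cycleMin-addSingleton σ) (cycleMin-addSingleton-fromℕ σ)

    cycles-addSingleton⁻ : HasCycles (addSingleton σ) (suc c) → HasCycles σ c
    cycles-addSingleton⁻ = inject₁-fromℕ⁻ (cycleMin-addSingleton σ) (cycleMin-addSingleton-fromℕ σ)

    module _ (y : Fin n) where

      cycles-insertAfter⁺ : HasCycles σ c → HasCycles (insertAfter σ y) c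
      cycles-insertAfter⁺ = inject₁⁺ (cycleMin-insertAfter σ y) (¬cycleMin-insertAfter-fromℕ σ y)

      cycles-insertAfter⁻ : HasCycles (insertAfter σ y) c → HasCycles σ c
      cycles-insertAfter⁻ = inject₁⁻ (cycleMin-insertAfter σ y) (¬cycleMin-insertAfter-fromℕ σ y)

      leader-insertAfter⁺ : ∀ {ℓ : Fin k} → IsPermutationWithLeader (ℓ , σ) → IsPermutationWithLeader (ℓ , insertAfter σ y)
      leader-insertAfter⁺ (perm , cycles , x , x≡ℓ , minimal , below) =
        permutation-insertAfter⁺ σ y perm , cycles-insertAfter⁺ cycles ,
        inject₁ x , trans (toℕ-inject₁ x) x≡ℓ , from (cycleMin-insertAfter σ y x) minimal ,
        inject₁⁺ (minimaBelow-inject₁ x (cycleMin-insertAfter σ y)) (¬minimaBelow-fromℕ x) below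

      leader-insertAfter⁻ : ∀ {ℓ : Fin k} → IsPermutationWithLeader (ℓ , insertAfter σ y) → IsPermutationWithLeader (ℓ , σ)
      leader-insertAfter⁻ (perm , cycles , x , x≡ℓ , minimal , below) with view x
      ... | ‵fromℕ = contradiction minimal (¬cycleMin-insertAfter-fromℕ σ y)
      ... | ‵inject₁ x′ =
        permutation-insertAfter⁻ σ y perm , cycles-insertAfter⁻ cycles ,
        x′ , trans (sym (toℕ-inject₁ x′)) x≡ℓ , to (cycleMin-insertAfter σ y x′) minimal ,
        inject₁⁻ (minimaBelow-inject₁ x′ (cycleMin-insertAfter σ y)) (¬minimaBelow-fromℕ x′) below

    leader-addSingleton⁺ : ∀ {ℓ′ : Fin k} → IsPermutationWithLeader (ℓ′ , σ) →
      IsPermutationWithLeader (inject₁ ℓ′ , addSingleton σ)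
    leader-addSingleton⁺ {ℓ′ = ℓ′} (perm , cycles , x , x≡ℓ , minimal , below) =
      permutation-addSingleton⁺ σ perm , cycles-addSingleton⁺ cycles ,
      inject₁ x , trans (toℕ-inject₁ x) (trans x≡ℓ (sym (toℕ-inject₁ ℓ′))) , from (cycleMin-addSingleton σ x) minimal ,
      subst (HasCount _ _) (sym (toℕ-inject₁ ℓ′))
        (inject₁⁺ (minimaBelow-inject₁ x (cycleMin-addSingleton σ)) (¬minimaBelow-fromℕ x) below)

    private
      minimaBelow-fromℕ : ∀ z → MinimaBelow (addSingleton σ) (fromℕ n) (inject₁ z) ⇔ IsCycleMin σ z
      minimaBelow-fromℕ z =
        mk⇔ (to (cycleMin-addSingleton σ z) ∘ proj₂) (λ minimal → inject₁<fromℕ z , from (cycleMin-addSingleton σ z) minimal)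

    leader-last⁺ : IsPermutation σ × HasCycles σ n → n ≡ k → IsPermutationWithLeader (fromℕ k , addSingleton σ)
    leader-last⁺ (perm , cycles) refl =
      permutation-addSingleton⁺ σ perm , cycles-addSingleton⁺ cycles ,
      fromℕ n , refl , cycleMin-addSingleton-fromℕ σ ,
      subst (HasCount _ _) (sym (toℕ-fromℕ n)) (inject₁⁺ minimaBelow-fromℕ (λ (last<last , _) → <-irrefl refl last<last) cycles)

    data AddSingletonLeader : Fin (suc k) → Set where
      old : ∀ (ℓ′ : Fin k) → IsPermutationWithLeader (ℓ′ , σ) → AddSingletonLeader (inject₁ ℓ′)
      new : IsPermutation σ × HasCycles σ n → n ≡ k → AddSingletonLeader (fromℕ k)

    addSingletonLeader : ∀ {ℓ : Fin (suc k)} → IsPermutationWithLeader (ℓ , addSingleton σ) → AddSingletonLeader ℓ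
    addSingletonLeader {k} {ℓ} (perm , cycles , x , x≡ℓ , minimal , below) with view x
    ... | ‵inject₁ x′ with view ℓ
    ...   | ‵inject₁ ℓ′ = old ℓ′
      (permutation-addSingleton⁻ σ perm , cycles-addSingleton⁻ cycles ,
       x′ , trans (sym (toℕ-inject₁ x′)) (trans x≡ℓ (toℕ-inject₁ ℓ′)) , to (cycleMin-addSingleton σ x′) minimal ,
       inject₁⁻ (minimaBelow-inject₁ x′ (cycleMin-addSingleton σ)) (¬minimaBelow-fromℕ x′)
         (subst (HasCount _ _) (toℕ-inject₁ ℓ′) below))
    -- Leader ℓ = k at an old point x: the k minima below x, x and the fixed point n would be k + 2 > k + 1 cycles.
    ...   | ‵fromℕ = ⊥-elim (Count.one-outside cycles (subst (HasCount _ _) (toℕ-fromℕ k) below) (λ _ → proj₂)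
                       minimal (cycleMin-addSingleton-fromℕ σ) (λ (x<x , _) → <-irrefl refl x<x) (¬minimaBelow-fromℕ x′)
                       (fromℕ≢inject₁ ∘ sym))
    addSingletonLeader {k} {ℓ} (perm , cycles , x , n≡ℓ , minimal , below) | ‵fromℕ =
      subst AddSingletonLeader ℓ≡last (new (permutation-addSingleton⁻ σ perm , subst (HasCycles σ) (sym n≡k) cyclesσ) n≡k)
      where
      cyclesσ = cycles-addSingleton⁻ cycles
      -- n = ℓ ≤ k, while σ has k cycles on n points.
      n≡k : n ≡ k
      n≡k = ≤-antisym (subst (ℕ._≤ k) (trans (sym n≡ℓ) (toℕ-fromℕ n)) (s≤s⁻¹ (toℕ<n ℓ)))
                      (Count.mono cyclesσ (Count.allFin⁺ n) (λ _ _ → _))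
      ℓ≡last : fromℕ k ≡ ℓ
      ℓ≡last = toℕ-injective (trans (toℕ-fromℕ k) (trans (sym n≡k) (trans (sym (toℕ-fromℕ n)) n≡ℓ)))

  private
    noCycles-[] : ¬ HasCycles {0} [] (suc k)
    noCycles-[] cycles = contradiction (Count.functional (Count.none (λ ())) cycles) (λ ())

    noCycles-suc : ∀ (τ : Vec (Fin (suc n)) (suc n)) → ¬ HasCycles τ 0
    noCycles-suc τ cycles = contradiction (Count.mono (Count.single zero (λ _ eq → eq) refl) cycles (λ { _ refl _ → z≤n })) (λ ())

    insertPair : Vec (Fin n) n × Fin n → Vec (Fin (suc n)) (suc n)
    insertPair = uncurry insertAfter

    insertPair-injective : ∀ {a a′ : Vec (Fin n) n × Fin n} → insertPair a ≡ insertPair a′ → a ≡ a′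
    insertPair-injective {a = σ , y} {σ′ , y′} eq with insertAfter-injective σ σ′ y y′ eq
    ... | refl , refl = refl

    insertWithLeader : ∀ {A : Set} → (A × Vec (Fin n) n) × Fin n → A × Vec (Fin (suc n)) (suc n)
    insertWithLeader ((ℓ , σ) , y) = ℓ , insertAfter σ y

    insertWithLeader-injective : ∀ {A : Set} {a a′ : (A × Vec (Fin n) n) × Fin n} →
      insertWithLeader a ≡ insertWithLeader a′ → a ≡ a′
    insertWithLeader-injective {a = (ℓ , σ) , y} {(ℓ′ , σ′) , y′} eq
      with cong proj₁ eq | insertAfter-injective σ σ′ y y′ (cong proj₂ eq)
    ... | refl | refl , refl = refl

  cycles-count : ∀ n k → HasCount (Vec (Fin n) n) (λ σ → IsPermutation σ × HasCycles σ k) (stirling₁ n k)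
  cycles-count zero zero = Count.single [] (λ { [] _ → refl }) ((λ ()) , Count.none (λ ()))
  cycles-count zero (suc k) = Count.none (λ { [] (_ , cycles) → noCycles-[] cycles })
  cycles-count (suc n) zero = Count.none (λ τ (_ , cycles) → noCycles-suc τ cycles)
  cycles-count (suc n) (suc k) =
    subst (HasCount _ _) (cong (stirling₁ n k +_) (*-comm (stirling₁ n (suc k)) n))
      (Count.resp (λ τ → mk⇔ (sound τ) (complete τ)) (Count.⊎⁺ fixes inserts disjoint))
    where
    fixes = Count.image⁺ addSingleton (λ _ _ → addSingleton-injective _ _) (cycles-count n k)
    inserts = Count.image⁺ insertPair (λ _ _ → insertPair-injective)
                (Count.Σ⁺ (λ _ _ → Count.allFin⁺ n) (cycles-count n (suc k)))
    disjoint : ∀ τ → _ → _ → _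
    disjoint τ (σ , _ , refl) ((σ′ , y) , _ , eq) = addSingleton≢insertAfter σ σ′ y (sym eq)
    sound : ∀ τ → _ → IsPermutation τ × HasCycles τ (suc k)
    sound _ (inj₁ (σ , (perm , cycles) , refl)) = permutation-addSingleton⁺ σ perm , cycles-addSingleton⁺ σ cycles
    sound _ (inj₂ ((σ , y) , ((perm , cycles) , _) , refl)) = permutation-insertAfter⁺ σ y perm , cycles-insertAfter⁺ σ y cycles
    complete : ∀ τ → IsPermutation τ × HasCycles τ (suc k) → _
    complete τ (perm , cycles) with lastPoint τ perm
    ... | fixed σ permσ = inj₁ (σ , (permσ , cycles-addSingleton⁻ σ cycles) , refl)
    ... | inserted σ y permσ = inj₂ ((σ , y) , ((permσ , cycles-insertAfter⁻ σ y cycles) , _) , refl)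

  leader-count : ∀ n k → HasCount (Fin k × Vec (Fin n) n) IsPermutationWithLeader (sodd n k)
  leader-count zero zero = Count.none (λ { (() , _) _ })
  leader-count (suc n) zero = Count.none (λ { (() , _) _ })
  leader-count zero (suc k) = Count.none (λ { (_ , []) (_ , cycles , _) → noCycles-[] cycles })
  leader-count (suc n) (suc k) =
    subst (HasCount _ _) (cong (λ c → sodd n k + c + δ n k) (*-comm (sodd n (suc k)) n))
      (Count.resp (λ v → mk⇔ (sound v) (complete v)) (Count.⊎⁺ (Count.⊎⁺ oldLeader inserts disjoint₁) newLeader disjoint₂))
    where
    oldLeader = Count.image⁺ (λ (ℓ′ , σ) → inject₁ ℓ′ , addSingleton σ)
                  (λ _ _ eq → cong₂ _,_ (inject₁-injective (cong proj₁ eq)) (addSingleton-injective _ _ (cong proj₂ eq)))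
                  (leader-count n k)
    inserts = Count.image⁺ insertWithLeader (λ _ _ → insertWithLeader-injective)
                (Count.Σ⁺ (λ _ _ → Count.allFin⁺ n) (leader-count n (suc k)))
    newLeader = Count.image⁺ (λ σ → fromℕ k , addSingleton σ) (λ _ _ eq → addSingleton-injective _ _ (cong proj₂ eq))
                  (δ-count {A = λ _ → Vec (Fin n) n} {P = λ σ → IsPermutation σ × HasCycles σ n} _ n k (cycles-count n n))
    disjoint₁ : ∀ v → _ → _ → _
    disjoint₁ v ((_ , σ) , _ , refl) (((_ , σ′) , y) , _ , eq) = addSingleton≢insertAfter σ σ′ y (sym (cong proj₂ eq))
    disjoint₂ : ∀ v → _ → _ → _
    disjoint₂ v (inj₁ (_ , _ , refl)) (_ , _ , eq) = fromℕ≢inject₁ (cong proj₁ eq)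
    disjoint₂ v (inj₂ (((_ , σ′) , y) , _ , refl)) (σ , _ , eq) = addSingleton≢insertAfter σ σ′ y (cong proj₂ eq)
    sound : ∀ v → _ → IsPermutationWithLeader v
    sound _ (inj₁ (inj₁ ((_ , σ) , leader , refl))) = leader-addSingleton⁺ σ leader
    sound _ (inj₁ (inj₂ (((_ , σ) , y) , (leader , _) , refl))) = leader-insertAfter⁺ σ y leader
    sound _ (inj₂ (σ , (counted , n≡k) , refl)) = leader-last⁺ σ counted n≡k
    complete : ∀ v → IsPermutationWithLeader v → _
    complete (ℓ , τ) leader@(perm , _) with lastPoint τ perm
    ... | inserted σ y _ = inj₁ (inj₂ (((ℓ , σ) , y) , (leader-insertAfter⁻ σ y leader , _) , refl))
    ... | fixed σ _ with addSingletonLeader σ leader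
    ...   | old ℓ′ leaderσ = inj₁ (inj₁ ((ℓ′ , σ) , leaderσ , refl))
    ...   | new counted n≡k = inj₂ (σ , (counted , n≡k) , refl)

module PowerSeries where

  open import Defs using (Series; sumRange; _⋆_; one; geometric; invOneMinusXPow)
  open Sums
  open import Data.Nat using (ℕ; zero; suc; _+_; _*_; _∸_; _≤_; _<_; _≤?_; z≤n)
  open import Data.Nat.Properties
  open import Data.Nat.Solver using (module +-*-Solver)
  open import Algebra.Properties.CommutativeSemigroup +-commutativeSemigroup using (interchange)
  open import Relation.Nullary using (yes; no)
  open import Relation.Binary.PropositionalEquality
  open ≡-Reasoning
  open +-*-Solver

  shift : Series → Series
  shift f zero = 0
  shift f (suc m) = f m

  θ : Series → Series
  θ f m = m * f m

  -- The coefficients of f(x)/(1 − x)^r (⋆-invOneMinusXPow).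
  iteratedSum : ℕ → Series → Series
  iteratedSum zero f m = f m
  iteratedSum (suc r) f zero = iteratedSum r f zero
  iteratedSum (suc r) f (suc m) = iteratedSum (suc r) f m + iteratedSum r f (suc m)

  iteratedSum-zero : ∀ r f → iteratedSum r f 0 ≡ f 0
  iteratedSum-zero zero f = refl
  iteratedSum-zero (suc r) f = iteratedSum-zero r f

  iteratedSum-cong : ∀ r {f g} → (∀ m → f m ≡ g m) → ∀ m → iteratedSum r f m ≡ iteratedSum r g m
  iteratedSum-cong zero f≗g m = f≗g m
  iteratedSum-cong (suc r) f≗g zero = iteratedSum-cong r f≗g zero
  iteratedSum-cong (suc r) f≗g (suc m) = cong₂ _+_ (iteratedSum-cong (suc r) f≗g m) (iteratedSum-cong r f≗g (suc m))

  iteratedSum-+ : ∀ r f g m → iteratedSum r (λ j → f j + g j) m ≡ iteratedSum r f m + iteratedSum r g m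
  iteratedSum-+ zero f g m = refl
  iteratedSum-+ (suc r) f g zero = iteratedSum-+ r f g zero
  iteratedSum-+ (suc r) f g (suc m) =
    trans (cong₂ _+_ (iteratedSum-+ (suc r) f g m) (iteratedSum-+ r f g (suc m)))
          (interchange (iteratedSum (suc r) f m) (iteratedSum (suc r) g m) (iteratedSum r f (suc m)) (iteratedSum r g (suc m)))

  iteratedSum-* : ∀ r c f m → iteratedSum r (λ j → c * f j) m ≡ c * iteratedSum r f m
  iteratedSum-* zero c f m = refl
  iteratedSum-* (suc r) c f zero = iteratedSum-* r c f zero
  iteratedSum-* (suc r) c f (suc m) =
    trans (cong₂ _+_ (iteratedSum-* (suc r) c f m) (iteratedSum-* r c f (suc m))) (sym (*-distribˡ-+ c _ _))

  iteratedSum-shift : ∀ r f m → iteratedSum r (shift f) m ≡ shift (iteratedSum r f) m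
  iteratedSum-shift zero f m = refl
  iteratedSum-shift (suc r) f zero = iteratedSum-zero r (shift f)
  iteratedSum-shift (suc r) f (suc zero) = cong₂ _+_ (iteratedSum-shift (suc r) f zero) (iteratedSum-shift r f 1)
  iteratedSum-shift (suc r) f (suc (suc m)) = cong₂ _+_ (iteratedSum-shift (suc r) f (suc m)) (iteratedSum-shift r f (suc (suc m)))

  iteratedSum-suc : ∀ r f m → iteratedSum (suc r) f m ≡ shift (iteratedSum (suc r) f) m + iteratedSum r f m
  iteratedSum-suc r f zero = refl
  iteratedSum-suc r f (suc m) = refl

  iteratedSum-θ : ∀ r P m → m * iteratedSum r P m ≡ iteratedSum r (θ P) m + r * shift (iteratedSum (suc r) P) m
  iteratedSum-θ zero P m = sym (+-identityʳ (m * P m))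
  iteratedSum-θ (suc r) P zero = sym (trans (cong (_+ suc r * 0) (iteratedSum-zero r (θ P))) (*-zeroʳ (suc r)))
  iteratedSum-θ (suc r) P (suc m) = begin
    suc m * (V m + U (suc m))                              ≡⟨ *-distribˡ-+ (suc m) (V m) (U (suc m)) ⟩
    suc m * V m + suc m * U (suc m)
      ≡⟨ cong₂ _+_ (cong (V m +_) (iteratedSum-θ (suc r) P m)) (iteratedSum-θ r P (suc m)) ⟩
    V m + (Vθ m + suc r * shift W m) + (Uθ (suc m) + r * V m)  ≡⟨ rearrange (V m) (Vθ m) (shift W m) (Uθ (suc m)) r ⟩
    Vθ m + Uθ (suc m) + suc r * (shift W m + V m)
      ≡⟨ cong (λ z → Vθ m + Uθ (suc m) + suc r * z) (iteratedSum-suc (suc r) P m) ⟨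
    Vθ m + Uθ (suc m) + suc r * W m                        ∎
    where
    U = iteratedSum r P
    V = iteratedSum (suc r) P
    W = iteratedSum (suc (suc r)) P
    Uθ = iteratedSum r (θ P)
    Vθ = iteratedSum (suc r) (θ P)
    rearrange : ∀ v vt sw ut r → v + (vt + suc r * sw) + (ut + r * v) ≡ vt + ut + suc r * (sw + v)
    rearrange = solve 5 (λ v vt sw ut r → v :+ (vt :+ (con 1 :+ r) :* sw) :+ (ut :+ r :* v) := vt :+ ut :+ (con 1 :+ r) :* (sw :+ v)) refl

  -- Inserting a new largest pair into one of the r gaps of a word with d descents: the d gaps right after a descent
  -- keep the number of descents, the other r − d gaps raise it by one.
  descentStep : ℕ → Series → Series
  descentStep r P j = j * P j + (suc r ∸ j) * shift P j

  private
    descentStep-θ : ∀ r P → (∀ j → r < j → P j ≡ 0) → ∀ j → descentStep r P j + shift (θ P) j ≡ θ P j + r * shift P j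
    descentStep-θ r P _ zero = trans (+-identityʳ (0 + suc r * 0)) (trans (*-zeroʳ (suc r)) (sym (*-zeroʳ r)))
    descentStep-θ r P vanishes (suc j) with j ≤? r
    ... | yes j≤r = begin
      suc j * P (suc j) + (r ∸ j) * P j + j * P j    ≡⟨ +-assoc (suc j * P (suc j)) _ _ ⟩
      suc j * P (suc j) + ((r ∸ j) * P j + j * P j)  ≡⟨ cong (suc j * P (suc j) +_) (*-distribʳ-+ (P j) (r ∸ j) j) ⟨
      suc j * P (suc j) + (r ∸ j + j) * P j          ≡⟨ cong (λ c → suc j * P (suc j) + c * P j) (m∸n+n≡m j≤r) ⟩
      suc j * P (suc j) + r * P j                    ∎
    ... | no j≰r = begin
      suc j * P (suc j) + (r ∸ j) * P j + j * P j    ≡⟨ cong (λ z → suc j * P (suc j) + (r ∸ j) * z + j * z) Pj≡0 ⟩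
      suc j * P (suc j) + (r ∸ j) * 0 + j * 0        ≡⟨ cong₂ (λ a b → suc j * P (suc j) + a + b) (*-zeroʳ (r ∸ j)) (*-zeroʳ j) ⟩
      suc j * P (suc j) + 0 + 0                      ≡⟨ cong (_+ 0) (+-identityʳ _) ⟩
      suc j * P (suc j) + 0                          ≡⟨ cong (suc j * P (suc j) +_) (trans (cong (r *_) Pj≡0) (*-zeroʳ r)) ⟨
      suc j * P (suc j) + r * P j                    ∎
      where
      Pj≡0 : P j ≡ 0
      Pj≡0 = vanishes j (≰⇒> j≰r)

  iteratedSum-descentStep : ∀ r P → (∀ j → r < j → P j ≡ 0) → ∀ m →
    iteratedSum (suc r) (descentStep r P) m ≡ m * iteratedSum r P m
  iteratedSum-descentStep r P vanishes m = +-cancelʳ-≡ (shift (Vθ) m) _ _ (begin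
    Φ m + shift Vθ m                               ≡⟨ cong (Φ m +_) (iteratedSum-shift (suc r) (θ P) m) ⟨
    Φ m + iteratedSum (suc r) (shift (θ P)) m      ≡⟨ iteratedSum-+ (suc r) (descentStep r P) (shift (θ P)) m ⟨
    iteratedSum (suc r) (λ j → descentStep r P j + shift (θ P) j) m  ≡⟨ iteratedSum-cong (suc r) (descentStep-θ r P vanishes) m ⟩
    iteratedSum (suc r) (λ j → θ P j + r * shift P j) m              ≡⟨ iteratedSum-+ (suc r) (θ P) (λ j → r * shift P j) m ⟩
    Vθ m + iteratedSum (suc r) (λ j → r * shift P j) m
      ≡⟨ cong₂ _+_ (iteratedSum-suc r (θ P) m) (trans (iteratedSum-* (suc r) r (shift P) m) (cong (r *_) (iteratedSum-shift (suc r) P m))) ⟩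
    shift Vθ m + iteratedSum r (θ P) m + r * shift (iteratedSum (suc r) P) m  ≡⟨ +-assoc (shift Vθ m) _ _ ⟩
    shift Vθ m + (iteratedSum r (θ P) m + r * shift (iteratedSum (suc r) P) m) ≡⟨ cong (shift Vθ m +_) (iteratedSum-θ r P m) ⟨
    shift Vθ m + m * iteratedSum r P m             ≡⟨ +-comm (shift Vθ m) _ ⟩
    m * iteratedSum r P m + shift Vθ m             ∎)
    where
    Φ = iteratedSum (suc r) (descentStep r P)
    Vθ = iteratedSum (suc r) (θ P)

  ⋆-congˡ : ∀ {f f′} g m → (∀ j → f j ≡ f′ j) → (f ⋆ g) m ≡ (f′ ⋆ g) m
  ⋆-congˡ g m f≗f′ = sumRange-cong 0 m (λ j _ _ → cong (_* g (m ∸ j)) (f≗f′ j))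

  ⋆-one : ∀ f m → (f ⋆ one) m ≡ f m
  ⋆-one f zero = trans (+-identityʳ (f 0 * 1)) (*-identityʳ (f 0))
  ⋆-one f (suc m) = begin
    sumRange 0 (suc m) (λ j → f j * one (suc m ∸ j))  ≡⟨ sumRange-suc 0 m (λ j → f j * one (suc m ∸ j)) z≤n ⟩
    sumRange 0 m (λ j → f j * one (suc m ∸ j)) + f (suc m) * one (suc m ∸ suc m)
      ≡⟨ cong₂ _+_ (trans (sumRange-cong 0 m (λ j _ j≤m → trans (cong (λ z → f j * one z) (+-∸-assoc 1 j≤m)) (*-zeroʳ (f j))))
                          (sumRange-* 0 0 m (λ _ → 0)))
                   (cong (λ z → f (suc m) * one z) (n∸n≡0 m)) ⟩
    0 + f (suc m) * 1                                 ≡⟨ *-identityʳ (f (suc m)) ⟩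
    f (suc m)                                         ∎

  private
    geometric-⋆ : ∀ g k → (geometric ⋆ g) k ≡ sumRange 0 k g
    geometric-⋆ g k = trans (sumRange-cong 0 k (λ j _ _ → *-identityˡ (g (k ∸ j)))) (sumRange-reverse k g)

    geometric-⋆-suc : ∀ g k → (geometric ⋆ g) (suc k) ≡ (geometric ⋆ g) k + g (suc k)
    geometric-⋆-suc g k = trans (geometric-⋆ g (suc k)) (trans (sumRange-suc 0 k g z≤n) (cong (_+ g (suc k)) (sym (geometric-⋆ g k))))

    ⋆-geometric-zero : ∀ f g → (f ⋆ (geometric ⋆ g)) 0 ≡ (f ⋆ g) 0
    ⋆-geometric-zero f g = cong (λ z → f 0 * z + 0) (trans (+-identityʳ (1 * g 0)) (*-identityˡ (g 0)))

    ⋆-geometric-suc : ∀ f g m → (f ⋆ (geometric ⋆ g)) (suc m) ≡ (f ⋆ (geometric ⋆ g)) m + (f ⋆ g) (suc m)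
    ⋆-geometric-suc f g m = begin
      sumRange 0 (suc m) (λ j → f j * G (suc m ∸ j))   ≡⟨ sumRange-suc 0 m (λ j → f j * G (suc m ∸ j)) z≤n ⟩
      sumRange 0 m (λ j → f j * G (suc m ∸ j)) + f (suc m) * G (suc m ∸ suc m)
        ≡⟨ cong₂ _+_ (sumRange-cong 0 m split) (cong (λ z → f (suc m) * G z) (n∸n≡0 m)) ⟩
      sumRange 0 m (λ j → f j * G (m ∸ j) + f j * g (suc m ∸ j)) + f (suc m) * G 0
        ≡⟨ cong₂ _+_ (sumRange-+ 0 m (λ j → f j * G (m ∸ j)) (λ j → f j * g (suc m ∸ j)))
                     (cong (f (suc m) *_) (trans (⋆-one-left g) (cong g (sym (n∸n≡0 m))))) ⟩
      (f ⋆ G) m + sumRange 0 m (λ j → f j * g (suc m ∸ j)) + f (suc m) * g (suc m ∸ suc m)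
        ≡⟨ +-assoc ((f ⋆ G) m) _ _ ⟩
      (f ⋆ G) m + (sumRange 0 m (λ j → f j * g (suc m ∸ j)) + f (suc m) * g (suc m ∸ suc m))
        ≡⟨ cong ((f ⋆ G) m +_) (sumRange-suc 0 m (λ j → f j * g (suc m ∸ j)) z≤n) ⟨
      (f ⋆ G) m + (f ⋆ g) (suc m) ∎
      where
      G = geometric ⋆ g
      ⋆-one-left : ∀ g → (geometric ⋆ g) 0 ≡ g 0
      ⋆-one-left g = trans (+-identityʳ (1 * g 0)) (*-identityˡ (g 0))
      split : ∀ j → 0 ≤ j → j ≤ m → f j * G (suc m ∸ j) ≡ f j * G (m ∸ j) + f j * g (suc m ∸ j)
      split j _ j≤m = begin
        f j * G (suc m ∸ j)                  ≡⟨ cong (λ z → f j * G z) (+-∸-assoc 1 j≤m) ⟩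
        f j * G (suc (m ∸ j))                ≡⟨ cong (f j *_) (geometric-⋆-suc g (m ∸ j)) ⟩
        f j * (G (m ∸ j) + g (suc (m ∸ j)))  ≡⟨ *-distribˡ-+ (f j) _ _ ⟩
        f j * G (m ∸ j) + f j * g (suc (m ∸ j)) ≡⟨ cong (λ z → f j * G (m ∸ j) + f j * g z) (+-∸-assoc 1 j≤m) ⟨
        f j * G (m ∸ j) + f j * g (suc m ∸ j) ∎

  ⋆-invOneMinusXPow : ∀ r f m → (f ⋆ invOneMinusXPow r) m ≡ iteratedSum r f m
  ⋆-invOneMinusXPow zero f m = ⋆-one f m
  ⋆-invOneMinusXPow (suc r) f zero = trans (⋆-geometric-zero f (invOneMinusXPow r)) (⋆-invOneMinusXPow r f zero)
  ⋆-invOneMinusXPow (suc r) f (suc m) =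
    trans (⋆-geometric-suc f (invOneMinusXPow r) m) (cong₂ _+_ (⋆-invOneMinusXPow (suc r) f m) (⋆-invOneMinusXPow r f (suc m)))

module Eulerian where

  open import Defs using (Series; δ; Sodd; soddSub; window; Bpoly; bpoly; invOneMinusXPow; _⋆_)
  open OddStirling
  open PowerSeries
  open import Data.Nat using (ℕ; zero; suc; _+_; _*_; _∸_; _≤_; _<_; _≤?_; z≤n; s≤s; s≤s⁻¹; pred)
  open import Data.Nat.Properties
  open import Data.Bool using (Bool; if_then_else_)
  open import Data.Product using ()
  open import Relation.Nullary using (yes; no; does)
  open import Relation.Nullary.Decidable using (dec-true; dec-false)
  open import Function using (_∘_)
  open import Relation.Binary.PropositionalEquality
  open ≡-Reasoning

  -- K + 1 for k = (1,2,…,2) with n twos: the power of 1 − x in B_k and b_k.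
  R : ℕ → ℕ
  R n = suc (suc (2 * n))

  R-suc : ∀ n → R (suc n) ≡ suc (suc (R n))
  R-suc n = cong (λ z → suc (suc z)) (*-suc 2 n)

  -- The descent numbers A_{k,i}: eulerian n i Stirling permutations of {0,1²,…,n²} have i descents (stirling-count).
  eulerian : ℕ → Series
  eulerian zero i = δ i 1
  eulerian (suc n) = descentStep (R n) (eulerian n)

  eulerian-zero : ∀ n → eulerian n 0 ≡ 0
  eulerian-zero zero = refl
  eulerian-zero (suc n) = *-zeroʳ (suc (R n))

  eulerian-> : ∀ n j → suc n < j → eulerian n j ≡ 0
  eulerian-> zero j 1<j = δ-≢ (>⇒≢ 1<j)
  eulerian-> (suc n) (suc j) (s≤s n+1<j) = begin
    suc j * eulerian n (suc j) + (suc (R n) ∸ suc j) * eulerian n j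
      ≡⟨ cong₂ (λ a b → suc j * a + (R n ∸ j) * b) (eulerian-> n (suc j) (m<n⇒m<1+n n+1<j)) (eulerian-> n j n+1<j) ⟩
    suc j * 0 + (R n ∸ j) * 0  ≡⟨ cong₂ _+_ (*-zeroʳ (suc j)) (*-zeroʳ (R n ∸ j)) ⟩
    0                          ∎

  private
    suc-n<R : ∀ n → suc n < R n
    suc-n<R n = s≤s (s≤s (m≤m+n n (n + 0)))

  eulerian-beyondR : ∀ n j → R n < j → eulerian n j ≡ 0
  eulerian-beyondR n j R<j = eulerian-> n j (<-trans (suc-n<R n) R<j)

  eulerianReversed : ℕ → Series
  eulerianReversed n i = eulerian n (R n ∸ i)

  eulerianReversed-≥R : ∀ n j → R n ≤ j → eulerianReversed n j ≡ 0
  eulerianReversed-≥R n j R≤j = trans (cong (eulerian n) (m≤n⇒m∸n≡0 R≤j)) (eulerian-zero n)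

  private
    shift-pred : ∀ P k → P 0 ≡ 0 → shift P k ≡ P (pred k)
    shift-pred P zero P0 = sym P0
    shift-pred P (suc k) _ = refl

    descentStep-reverse : ∀ r P → P 0 ≡ 0 → P (suc r) ≡ 0 → ∀ j →
      descentStep r P (suc r ∸ j) ≡ descentStep r (λ i → P (r ∸ i)) j
    descentStep-reverse r P P0 Pr zero = begin
      suc r * P (suc r) + (r ∸ r) * shift P (suc r)  ≡⟨ cong (λ c → suc r * P (suc r) + c * P r) (n∸n≡0 r) ⟩
      suc r * P (suc r) + 0                          ≡⟨ +-identityʳ _ ⟩
      suc r * P (suc r)                              ≡⟨ cong (suc r *_) Pr ⟩
      suc r * 0                                      ∎
    descentStep-reverse r P P0 _ (suc j) with j ≤? r
    ... | yes j≤r = begin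
      (r ∸ j) * P (r ∸ j) + (suc r ∸ (r ∸ j)) * shift P (r ∸ j)
        ≡⟨ cong₂ (λ a b → (r ∸ j) * P (r ∸ j) + a * b) complement
                 (trans (shift-pred P (r ∸ j) P0) (cong P (pred[m∸n]≡m∸[1+n] r j))) ⟩
      (r ∸ j) * P (r ∸ j) + suc j * P (r ∸ suc j)   ≡⟨ +-comm ((r ∸ j) * P (r ∸ j)) _ ⟩
      suc j * P (r ∸ suc j) + (r ∸ j) * P (r ∸ j)   ∎
      where
      complement : suc r ∸ (r ∸ j) ≡ suc j
      complement = trans (+-∸-assoc 1 (m∸n≤m r j)) (cong suc (m∸[m∸n]≡n j≤r))
    ... | no j≰r = begin
      (r ∸ j) * P (r ∸ j) + (suc r ∸ (r ∸ j)) * shift P (r ∸ j)  ≡⟨ cong (λ k → k * P k + (suc r ∸ k) * shift P k) r∸j≡0 ⟩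
      suc r * 0                                                 ≡⟨ *-zeroʳ (suc r) ⟩
      0
        ≡⟨ cong₂ _+_ (trans (cong (λ k → suc j * P k) r∸1+j≡0) (trans (cong (suc j *_) P0) (*-zeroʳ (suc j))))
                                                                               (cong (λ k → k * P k) r∸j≡0) ⟨
      suc j * P (r ∸ suc j) + (r ∸ j) * P (r ∸ j)               ∎
      where
      r∸j≡0 : r ∸ j ≡ 0
      r∸j≡0 = m≤n⇒m∸n≡0 (<⇒≤ (≰⇒> j≰r))
      r∸1+j≡0 : r ∸ suc j ≡ 0
      r∸1+j≡0 = m≤n⇒m∸n≡0 (m≤n⇒m≤1+n (<⇒≤ (≰⇒> j≰r)))

  eulerianReversed-suc : ∀ n j → eulerianReversed (suc n) j ≡ shift (descentStep (R n) (eulerianReversed n)) j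
  eulerianReversed-suc n zero = eulerian-> (suc n) (R (suc n) ∸ 0) (suc-n<R (suc n))
  eulerianReversed-suc n (suc j) = trans (cong (λ r → descentStep (R n) (eulerian n) (r ∸ suc j)) (R-suc n))
    (descentStep-reverse (R n) (eulerian n) (eulerian-zero n) (eulerian-beyondR n (suc (R n)) ≤-refl) j)

  private
    iteratedSum-eulerian-zero : ∀ m → iteratedSum 2 (eulerian 0) m ≡ m
    iteratedSum-eulerian-zero zero = refl
    iteratedSum-eulerian-zero (suc m) = trans (cong₂ _+_ (iteratedSum-eulerian-zero m) (ones m)) (+-comm m 1)
      where
      ones : ∀ m → iteratedSum 1 (eulerian 0) (suc m) ≡ 1
      ones zero = refl
      ones (suc m) = cong (_+ 0) (ones m)

    iteratedSum-R-suc : ∀ n f m → iteratedSum (R (suc n)) f (suc m) ≡ iteratedSum (R (suc n)) f m + iteratedSum (suc (R n)) f (suc m)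
    iteratedSum-R-suc n f m = subst (λ r → iteratedSum r f (suc m) ≡ iteratedSum r f m + iteratedSum (suc (R n)) f (suc m)) (sym (R-suc n)) refl

  iteratedSum-eulerian : ∀ n m → iteratedSum (R n) (eulerian n) m ≡ Sodd (n + m) m
  iteratedSum-eulerian zero m = trans (iteratedSum-eulerian-zero m) (sym (Sodd-diag m))
  iteratedSum-eulerian (suc n) zero = trans (iteratedSum-zero (R (suc n)) (eulerian (suc n))) (eulerian-zero (suc n))
  iteratedSum-eulerian (suc n) (suc m) = begin
    iteratedSum (R (suc n)) (eulerian (suc n)) (suc m)  ≡⟨ iteratedSum-R-suc n (eulerian (suc n)) m ⟩
    iteratedSum (R (suc n)) (eulerian (suc n)) m + iteratedSum (suc (R n)) (descentStep (R n) (eulerian n)) (suc m)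
      ≡⟨ cong₂ _+_ (iteratedSum-eulerian (suc n) m) (iteratedSum-descentStep (R n) (eulerian n) (eulerian-beyondR n) (suc m)) ⟩
    Sodd (suc n + m) m + suc m * iteratedSum (R n) (eulerian n) (suc m)
      ≡⟨ cong (λ z → Sodd (suc n + m) m + suc m * z) (iteratedSum-eulerian n (suc m)) ⟩
    Sodd (suc n + m) m + suc m * Sodd (n + suc m) (suc m)                ≡⟨ Sodd-suc-+ n m ⟨
    Sodd (suc n + suc m) (suc m)                        ∎

  iteratedSum-eulerianReversed : ∀ n m → iteratedSum (R n) (eulerianReversed n) m ≡ soddSub m n
  iteratedSum-eulerianReversed zero m = begin
    iteratedSum 2 (eulerianReversed 0) m  ≡⟨ iteratedSum-cong 2 palindromic m ⟩
    iteratedSum 2 (eulerian 0) m          ≡⟨ iteratedSum-eulerian-zero m ⟩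
    m                                     ≡⟨ soddSub-zero m ⟨
    soddSub m 0                           ∎
    where
    palindromic : ∀ j → eulerianReversed 0 j ≡ eulerian 0 j
    palindromic zero = refl
    palindromic (suc zero) = refl
    palindromic (suc (suc j)) = cong (λ z → δ z 1) (0∸n≡0 j)
  iteratedSum-eulerianReversed (suc n) zero =
    trans (iteratedSum-zero (R (suc n)) (eulerianReversed (suc n))) (trans (eulerianReversed-suc n 0) (sym (soddSub-> {0} {suc n} (s≤s z≤n))))
  iteratedSum-eulerianReversed (suc n) (suc m) = begin
    iteratedSum (R (suc n)) (eulerianReversed (suc n)) (suc m)  ≡⟨ iteratedSum-R-suc n (eulerianReversed (suc n)) m ⟩
    iteratedSum (R (suc n)) (eulerianReversed (suc n)) m + iteratedSum (suc (R n)) (eulerianReversed (suc n)) (suc m)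
      ≡⟨ cong (iteratedSum (R (suc n)) (eulerianReversed (suc n)) m +_)
              (trans (iteratedSum-cong (suc (R n)) (eulerianReversed-suc n) (suc m))
                     (iteratedSum-shift (suc (R n)) (descentStep (R n) (eulerianReversed n)) (suc m))) ⟩
    iteratedSum (R (suc n)) (eulerianReversed (suc n)) m + iteratedSum (suc (R n)) (descentStep (R n) (eulerianReversed n)) m
      ≡⟨ cong₂ _+_ (iteratedSum-eulerianReversed (suc n) m)
                   (iteratedSum-descentStep (R n) (eulerianReversed n) (λ j → eulerianReversed-≥R n j ∘ <⇒≤) m) ⟩
    soddSub m (suc n) + m * iteratedSum (R n) (eulerianReversed n) m
      ≡⟨ cong (λ z → soddSub m (suc n) + m * z) (iteratedSum-eulerianReversed n m) ⟩
    soddSub m (suc n) + m * soddSub m n                                ≡⟨ soddSub-suc m n ⟨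
    soddSub (suc m) (suc n)                                            ∎

  private
    select : Series → ℕ → Bool → Bool → ℕ
    select f j a b = if a then (if b then f j else 0) else 0

  window-≗ : ∀ lo hi (f g : Series) j → (lo ≤ j → j ≤ hi → f j ≡ g j) → (j < lo → g j ≡ 0) → (hi < j → g j ≡ 0) →
    window lo hi f j ≡ g j
  window-≗ lo hi f g j inside below above with lo ≤? j | j ≤? hi
  ... | yes lo≤j | yes j≤hi = trans (cong₂ (select f j) (dec-true (lo ≤? j) lo≤j) (dec-true (j ≤? hi) j≤hi)) (inside lo≤j j≤hi)
  ... | yes lo≤j | no j≰hi =
    trans (cong₂ (select f j) (dec-true (lo ≤? j) lo≤j) (dec-false (j ≤? hi) j≰hi)) (sym (above (≰⇒> j≰hi)))
  ... | no lo≰j | _ = trans (cong (λ a → select f j a (does (j ≤? hi))) (dec-false (lo ≤? j) lo≰j)) (sym (below (≰⇒> lo≰j)))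

  Bpoly-eulerian : ∀ n A → (∀ i → A i ≡ eulerian n i) → ∀ m → Bpoly (suc n) (suc (2 * n)) A m ≡ Sodd (n + m) m
  Bpoly-eulerian n A A≗eulerian m = begin
    Bpoly (suc n) (suc (2 * n)) A m                     ≡⟨ ⋆-congˡ (invOneMinusXPow (R n)) m windowed ⟩
    (eulerian n ⋆ invOneMinusXPow (R n)) m              ≡⟨ ⋆-invOneMinusXPow (R n) (eulerian n) m ⟩
    iteratedSum (R n) (eulerian n) m                    ≡⟨ iteratedSum-eulerian n m ⟩
    Sodd (n + m) m                                      ∎
    where
    windowed : ∀ j → window 1 (suc n) A j ≡ eulerian n j
    windowed j = window-≗ 1 (suc n) A (eulerian n) j (λ _ _ → A≗eulerian j) (λ { (s≤s z≤n) → eulerian-zero n }) (eulerian-> n j)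

  bpoly-eulerian : ∀ n A → (∀ i → A i ≡ eulerian n i) → ∀ m → bpoly (suc n) (suc (2 * n)) A m ≡ soddSub m n
  bpoly-eulerian n A A≗eulerian m = begin
    bpoly (suc n) (suc (2 * n)) A m                     ≡⟨ ⋆-congˡ (invOneMinusXPow (R n)) m windowed ⟩
    (eulerianReversed n ⋆ invOneMinusXPow (R n)) m      ≡⟨ ⋆-invOneMinusXPow (R n) (eulerianReversed n) m ⟩
    iteratedSum (R n) (eulerianReversed n) m            ≡⟨ iteratedSum-eulerianReversed n m ⟩
    soddSub m n                                         ∎
    where
    R≡ : R n ≡ suc n + suc n
    R≡ = cong suc (trans (cong (λ z → suc (n + z)) (+-identityʳ n)) (sym (+-suc n n)))
    lo≡ : R n ∸ suc n ≡ suc n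
    lo≡ = trans (cong (_∸ suc n) R≡) (m+n∸m≡n (suc n) (suc n))
    below : ∀ j → j < R n ∸ suc n → eulerianReversed n j ≡ 0
    below j j<lo = eulerian-> n (R n ∸ j) (m+n≤o⇒m≤o∸n (suc (suc n))
      (subst (suc (suc n) + j ≤_) (sym (trans R≡ (cong suc (+-suc n n)))) (+-monoʳ-≤ (suc (suc n)) (s≤s⁻¹ (subst (j <_) lo≡ j<lo)))))
    windowed : ∀ j → window (R n ∸ suc n) (suc (2 * n)) (λ i → A (R n ∸ i)) j ≡ eulerianReversed n j
    windowed j = window-≗ (R n ∸ suc n) (suc (2 * n)) (λ i → A (R n ∸ i)) (eulerianReversed n) j
                   (λ _ _ → A≗eulerian (R n ∸ j)) (below j) (eulerianReversed-≥R n j)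

module StirlingPermutations where

  open import Defs using (HasCount; multiplicity; IsStirlingPermutation; IsStirlingDescentCount; IsDescent; oneTwos)
  open OddStirling using (δ-≢)
  open PowerSeries using (shift)
  open Eulerian using (eulerian; R)
  open CountOnFin using (toℕ⁺; toℕ⁻)
  open Snoc using (inject₁<fromℕ; inject₁-mono-≤; inject₁-cancel-≤)
  open import Data.Nat as ℕ using (ℕ; zero; suc; _+_; _*_; _∸_; _≤_; _<_; z≤n; s≤s; s≤s⁻¹)
  open import Data.Nat.Properties using (suc-injective; +-suc; *-suc; *-comm; <-irrefl; <-trans; <⇒≤; <⇒≱; n≤1+n)
  open import Data.Fin as Fin using (Fin; zero; suc; toℕ; inject₁; fromℕ; fromℕ<)
  open import Data.Fin.Properties using (toℕ-inject₁; toℕ-fromℕ<; toℕ<n; inject₁-injective; fromℕ≢inject₁)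
  open import Data.Fin.Relation.Unary.Top using (view; ‵fromℕ; ‵inject₁)
  import Data.Vec as Vec
  open import Data.Vec.Properties using (lookup-replicate)
  open import Data.List as List using (List; []; _∷_; length; map)
  open import Data.List.Properties using (length-map; map-injective; filter-accept; filter-reject; ∷-injective)
  open import Data.Maybe as Maybe using (Maybe; just; nothing)
  open import Data.Maybe.Properties using (just-injective)
  open import Data.Product using (∃; _×_; _,_; proj₁; proj₂; map₂)
  open import Data.Sum as Sum using (_⊎_; inj₁; inj₂)
  open import Data.Unit using (⊤; tt)
  open import Data.Empty using (⊥; ⊥-elim)
  open import Data.Bool using (if_then_else_)
  open import Function using (_∘_)
  open import Function.Bundles using (mk⇔)
  open import Relation.Nullary using (Dec; yes; no; ¬_; does; contradiction)
  open import Relation.Nullary.Decidable using (dec-true; dec-false)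
  open import Relation.Binary.PropositionalEquality

  private
    variable
      A : Set
      m : ℕ

  nth : List A → ℕ → Maybe A
  nth [] _ = nothing
  nth (x ∷ xs) zero = just x
  nth (x ∷ xs) (suc i) = nth xs i

  nth-lookup : ∀ (xs : List A) (i : Fin (length xs)) → nth xs (toℕ i) ≡ just (List.lookup xs i)
  nth-lookup (x ∷ xs) zero = refl
  nth-lookup (x ∷ xs) (suc i) = nth-lookup xs i

  nth-< : ∀ (xs : List A) i {a} → nth xs i ≡ just a → i ℕ.< length xs
  nth-< (x ∷ xs) zero _ = s≤s z≤n
  nth-< (x ∷ xs) (suc i) eq = s≤s (nth-< xs i eq)

  descentBit : Fin m → Fin m → ℕ
  descentBit x y = if does (toℕ y ℕ.<? toℕ x) then 1 else 0

  descentBit-< : ∀ {x y : Fin m} → y Fin.< x → descentBit x y ≡ 1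
  descentBit-< {x = x} {y} y<x = cong (λ b → if b then 1 else 0) (dec-true (toℕ y ℕ.<? toℕ x) y<x)

  descentBit-≮ : ∀ {x y : Fin m} → ¬ y Fin.< x → descentBit x y ≡ 0
  descentBit-≮ {x = x} {y} y≮x = cong (λ b → if b then 1 else 0) (dec-false (toℕ y ℕ.<? toℕ x) y≮x)

  descents : List (Fin m) → ℕ
  descents [] = 0
  descents (x ∷ []) = 1
  descents (x ∷ y ∷ w) = descentBit x y + descents (y ∷ w)

  DescentAt : List (Fin m) → ℕ → Set
  DescentAt [] d = ⊥
  DescentAt (x ∷ []) zero = ⊤
  DescentAt (x ∷ []) (suc d) = ⊥
  DescentAt (x ∷ y ∷ w) zero = y Fin.< x
  DescentAt (x ∷ y ∷ w) (suc d) = DescentAt (y ∷ w) d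

  descentAt? : ∀ (w : List (Fin m)) d → Dec (DescentAt w d)
  descentAt? [] d = no (λ ())
  descentAt? (x ∷ []) zero = yes tt
  descentAt? (x ∷ []) (suc d) = no (λ ())
  descentAt? (x ∷ y ∷ w) zero = toℕ y ℕ.<? toℕ x
  descentAt? (x ∷ y ∷ w) (suc d) = descentAt? (y ∷ w) d

  descentAt-< : ∀ (w : List (Fin m)) d → DescentAt w d → d ℕ.< length w
  descentAt-< (x ∷ []) zero _ = s≤s z≤n
  descentAt-< (x ∷ y ∷ w) zero _ = s≤s z≤n
  descentAt-< (x ∷ y ∷ w) (suc d) descent = s≤s (descentAt-< (y ∷ w) d descent)

  descentAt-count : ∀ (w : List (Fin m)) → HasCount ℕ (DescentAt w) (descents w)
  descentAt-count [] = Count.none (λ _ ())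
  descentAt-count (x ∷ []) = Count.single 0 (λ { zero _ → refl ; (suc _) () }) tt
  descentAt-count (x ∷ y ∷ w) =
    Count.resp (λ d → mk⇔ (sound d) (complete d))
      (Count.⊎⁺ first (Count.image⁺ suc (λ _ _ → suc-injective) (descentAt-count (y ∷ w))) (λ { _ (refl , _) (_ , _ , ()) }))
    where
    first : HasCount ℕ (λ d → d ≡ 0 × y Fin.< x) (descentBit x y)
    first with toℕ y ℕ.<? toℕ x
    ... | yes y<x = subst (HasCount _ _) (sym (descentBit-< y<x)) (Count.single 0 (λ _ → proj₁) (refl , y<x))
    ... | no y≮x = subst (HasCount _ _) (sym (descentBit-≮ y≮x)) (Count.none (λ _ → y≮x ∘ proj₂))
    sound : ∀ d → (d ≡ 0 × y Fin.< x) ⊎ (∃ λ d′ → DescentAt (y ∷ w) d′ × suc d′ ≡ d) → DescentAt (x ∷ y ∷ w) d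
    sound _ (inj₁ (refl , y<x)) = y<x
    sound _ (inj₂ (_ , descent , refl)) = descent
    complete : ∀ d → DescentAt (x ∷ y ∷ w) d → (d ≡ 0 × y Fin.< x) ⊎ (∃ λ d′ → DescentAt (y ∷ w) d′ × suc d′ ≡ d)
    complete zero y<x = inj₁ (refl , y<x)
    complete (suc d) descent = inj₂ (d , descent , refl)

  isDescent⇒descentAt : ∀ (w : List (Fin m)) d → IsDescent w d → DescentAt w (toℕ d)
  isDescent⇒descentAt (x ∷ []) zero _ = tt
  isDescent⇒descentAt (x ∷ y ∷ w) zero (inj₂ (suc zero , _ , y<x)) = y<x
  isDescent⇒descentAt (x ∷ y ∷ w) (suc d) (inj₁ last) = isDescent⇒descentAt (y ∷ w) d (inj₁ (suc-injective last))
  isDescent⇒descentAt (x ∷ y ∷ w) (suc d) (inj₂ (suc e , e≡ , less)) =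
    isDescent⇒descentAt (y ∷ w) d (inj₂ (e , suc-injective e≡ , less))

  descentAt⇒isDescent : ∀ (w : List (Fin m)) d → DescentAt w (toℕ d) → IsDescent w d
  descentAt⇒isDescent (x ∷ []) zero _ = inj₁ refl
  descentAt⇒isDescent (x ∷ y ∷ w) zero y<x = inj₂ (suc zero , refl , y<x)
  descentAt⇒isDescent (x ∷ y ∷ w) (suc d) descent with descentAt⇒isDescent (y ∷ w) d descent
  ... | inj₁ last = inj₁ (cong suc last)
  ... | inj₂ (e , e≡ , less) = inj₂ (suc e , cong suc e≡ , less)

  isDescent-count : ∀ (w : List (Fin m)) → HasCount (Fin (length w)) (IsDescent w) (descents w)
  isDescent-count w =
    Count.resp (λ d → mk⇔ (descentAt⇒isDescent w d) (isDescent⇒descentAt w d)) (toℕ⁻ (descentAt-< w) (descentAt-count w))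

  -- The condition of IsStirlingPermutation with positions in ℕ, so that insertions shift them arithmetically.
  StirlingCondition : List (Fin m) → Set
  StirlingCondition w = ∀ i s j a b → i < s → s < j → nth w i ≡ just a → nth w j ≡ just a → nth w s ≡ just b → a Fin.≤ b

  private
    PositionCondition : List (Fin m) → Set
    PositionCondition w = ∀ (i s j : Fin (length w)) → i Fin.< s → s Fin.< j →
      List.lookup w i ≡ List.lookup w j → List.lookup w i Fin.≤ List.lookup w s

    stirlingCondition⁺ : ∀ (w : List (Fin m)) → PositionCondition w → StirlingCondition w
    stirlingCondition⁺ w condition i s j a b i<s s<j wi≡a wj≡a ws≡b =
      subst₂ Fin._≤_ (lookup≡ i wi≡a) (lookup≡ s ws≡b)
        (condition (position i wi≡a) (position s ws≡b) (position j wj≡a)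
          (subst₂ _<_ (sym (toℕ-fromℕ< _)) (sym (toℕ-fromℕ< _)) i<s)
          (subst₂ _<_ (sym (toℕ-fromℕ< _)) (sym (toℕ-fromℕ< _)) s<j)
          (trans (lookup≡ i wi≡a) (sym (lookup≡ j wj≡a))))
      where
      position : ∀ k {c} → nth w k ≡ just c → Fin (length w)
      position k wk≡c = fromℕ< (nth-< w k wk≡c)
      lookup≡ : ∀ k {c} (wk≡c : nth w k ≡ just c) → List.lookup w (position k wk≡c) ≡ c
      lookup≡ k wk≡c = just-injective (trans (sym (nth-lookup w _)) (trans (cong (nth w) (toℕ-fromℕ< _)) wk≡c))

    stirlingCondition⁻ : ∀ (w : List (Fin m)) → StirlingCondition w → PositionCondition w
    stirlingCondition⁻ w condition i s j i<s s<j wi≡wj =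
      condition (toℕ i) (toℕ s) (toℕ j) _ _ i<s s<j (nth-lookup w i) (trans (nth-lookup w j) (cong just (sym wi≡wj))) (nth-lookup w s)

  -- Insert two copies of the new largest letter into gap g, i.e. after the first g letters.
  insertTop : ℕ → List (Fin m) → List (Fin (suc m))
  insertTop {m} zero w = fromℕ m ∷ fromℕ m ∷ map inject₁ w
  insertTop {m} (suc g) [] = fromℕ m ∷ fromℕ m ∷ []
  insertTop (suc g) (x ∷ w) = inject₁ x ∷ insertTop g w

  length-insertTop : ∀ g (w : List (Fin m)) → length (insertTop g w) ≡ suc (suc (length w))
  length-insertTop zero w = cong (λ l → suc (suc l)) (length-map inject₁ w)
  length-insertTop (suc g) [] = refl
  length-insertTop (suc g) (x ∷ w) = cong suc (length-insertTop g w)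

  insertTop-injective : ∀ g g′ (w w′ : List (Fin m)) → g ≤ length w → g′ ≤ length w′ →
    insertTop g w ≡ insertTop g′ w′ → g ≡ g′ × w ≡ w′
  insertTop-injective zero zero w w′ _ _ eq = refl , map-injective inject₁-injective (proj₂ (∷-injective (proj₂ (∷-injective eq))))
  insertTop-injective zero (suc g′) w (x′ ∷ w′) _ _ eq = contradiction (proj₁ (∷-injective eq)) fromℕ≢inject₁
  insertTop-injective (suc g) zero (x ∷ w) w′ _ _ eq = contradiction (sym (proj₁ (∷-injective eq))) fromℕ≢inject₁
  insertTop-injective (suc g) (suc g′) (x ∷ w) (x′ ∷ w′) (s≤s g≤) (s≤s g′≤) eq with ∷-injective eq
  ... | x≡x′ , rest≡ with insertTop-injective g g′ w w′ g≤ g′≤ rest≡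
  ...   | refl , refl = refl , cong (_∷ w) (inject₁-injective x≡x′)

  GapAfterDescent : ℕ → List (Fin m) → Set
  GapAfterDescent zero w = ⊥
  GapAfterDescent (suc d) w = DescentAt w d

  gapAfterDescent? : ∀ g (w : List (Fin m)) → Dec (GapAfterDescent g w)
  gapAfterDescent? zero w = no (λ ())
  gapAfterDescent? (suc d) w = descentAt? w d

  gap-count : ∀ L → HasCount ℕ (_≤ L) (suc L)
  gap-count L = toℕ⁺ (λ _ → s≤s) (Count.resp (λ i → mk⇔ (λ _ → s≤s⁻¹ (toℕ<n i)) _) (Count.allFin⁺ (suc L)))

  gapAfterDescent-count : ∀ (w : List (Fin m)) → HasCount ℕ (λ g → g ≤ length w × GapAfterDescent g w) (descents w)
  gapAfterDescent-count w = Count.resp (λ g → mk⇔ (sound g) (complete g)) (Count.image⁺ suc (λ _ _ → suc-injective) (descentAt-count w))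
    where
    sound : ∀ g → (∃ λ d → DescentAt w d × suc d ≡ g) → g ≤ length w × GapAfterDescent g w
    sound _ (d , descent , refl) = descentAt-< w d descent , descent
    complete : ∀ g → g ≤ length w × GapAfterDescent g w → ∃ λ d → DescentAt w d × suc d ≡ g
    complete (suc d) (_ , descent) = d , descent , refl

  private
    fromℕ≮inject₁ : ∀ (x : Fin m) → ¬ fromℕ m Fin.< inject₁ x
    fromℕ≮inject₁ x last<x = <⇒≱ last<x (<⇒≤ (inject₁<fromℕ x))

    descentBit-inject₁ : ∀ (x y : Fin m) → descentBit (inject₁ x) (inject₁ y) ≡ descentBit x y
    descentBit-inject₁ x y = cong₂ (λ a b → if does (b ℕ.<? a) then 1 else 0) (toℕ-inject₁ x) (toℕ-inject₁ y)

    descents-map-inject₁ : ∀ (w : List (Fin m)) → descents (map inject₁ w) ≡ descents w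
    descents-map-inject₁ [] = refl
    descents-map-inject₁ (x ∷ []) = refl
    descents-map-inject₁ (x ∷ y ∷ w) = cong₂ _+_ (descentBit-inject₁ x y) (descents-map-inject₁ (y ∷ w))

    descents-insertTop-zero : ∀ (w : List (Fin m)) → descents (insertTop 0 w) ≡ suc (descents w)
    descents-insertTop-zero {m} [] = cong (_+ 1) (descentBit-≮ (<-irrefl {toℕ (fromℕ m)} refl))
    descents-insertTop-zero {m} (y ∷ w) =
      cong₂ _+_ (descentBit-≮ (<-irrefl {toℕ (fromℕ m)} refl))
                (cong₂ _+_ (descentBit-< (inject₁<fromℕ y)) (descents-map-inject₁ (y ∷ w)))

  descents-insertTop : ∀ g (w : List (Fin m)) → g ≤ length w →
    (GapAfterDescent g w → descents (insertTop g w) ≡ descents w) × (¬ GapAfterDescent g w → descents (insertTop g w) ≡ suc (descents w))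
  descents-insertTop zero w _ = (λ ()) , (λ _ → descents-insertTop-zero w)
  descents-insertTop {m} (suc zero) (x ∷ []) _ =
    (λ _ → cong₂ _+_ (descentBit-≮ (fromℕ≮inject₁ x)) (descents-insertTop-zero {m} [])) , (λ notAfter → contradiction _ notAfter)
  descents-insertTop (suc zero) (x ∷ y ∷ w) _ =
    (λ y<x → trans top (sym (cong (_+ descents (y ∷ w)) (descentBit-< y<x)))) ,
    (λ y≮x → trans top (cong suc (sym (cong (_+ descents (y ∷ w)) (descentBit-≮ y≮x)))))
    where
    top : descents (insertTop 1 (x ∷ y ∷ w)) ≡ suc (descents (y ∷ w))
    top = cong₂ _+_ (descentBit-≮ (fromℕ≮inject₁ x)) (descents-insertTop-zero (y ∷ w))
  descents-insertTop (suc (suc g)) (x ∷ y ∷ w) (s≤s g≤) with descents-insertTop (suc g) (y ∷ w) g≤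
  ... | after , notAfter =
    (λ isAfter → cong₂ _+_ (descentBit-inject₁ x y) (after isAfter)) ,
    (λ isNotAfter → trans (cong₂ _+_ (descentBit-inject₁ x y) (notAfter isNotAfter)) (+-suc (descentBit x y) (descents (y ∷ w))))

  private
    multiplicity-≡ : ∀ (a x : Fin m) l → x ≡ a → multiplicity a (x ∷ l) ≡ suc (multiplicity a l)
    multiplicity-≡ a x l x≡a = cong length (filter-accept (Fin._≟ a) x≡a)

    multiplicity-≢ : ∀ (a x : Fin m) l → x ≢ a → multiplicity a (x ∷ l) ≡ multiplicity a l
    multiplicity-≢ a x l x≢a = cong length (filter-reject (Fin._≟ a) x≢a)

    multiplicity-∷-inject₁ : ∀ (a x : Fin m) l l′ → multiplicity (inject₁ a) l′ ≡ multiplicity a l →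
      multiplicity (inject₁ a) (inject₁ x ∷ l′) ≡ multiplicity a (x ∷ l)
    multiplicity-∷-inject₁ a x l l′ same with x Fin.≟ a
    ... | yes x≡a = trans (multiplicity-≡ _ _ l′ (cong inject₁ x≡a)) (cong suc same)
    ... | no x≢a = trans (multiplicity-≢ _ _ l′ (x≢a ∘ inject₁-injective)) same

    multiplicity-map-inject₁ : ∀ (a : Fin m) w → multiplicity (inject₁ a) (map inject₁ w) ≡ multiplicity a w
    multiplicity-map-inject₁ a [] = refl
    multiplicity-map-inject₁ a (x ∷ w) = multiplicity-∷-inject₁ a x w _ (multiplicity-map-inject₁ a w)

    multiplicity-map-fromℕ : ∀ (w : List (Fin m)) → multiplicity (fromℕ m) (map inject₁ w) ≡ 0
    multiplicity-map-fromℕ [] = refl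
    multiplicity-map-fromℕ {m} (x ∷ w) =
      trans (multiplicity-≢ (fromℕ m) (inject₁ x) _ (fromℕ≢inject₁ ∘ sym)) (multiplicity-map-fromℕ w)

  multiplicity-insertTop-fromℕ : ∀ g (w : List (Fin m)) → multiplicity (fromℕ m) (insertTop g w) ≡ 2
  multiplicity-insertTop-fromℕ {m} zero w =
    trans (multiplicity-≡ top top _ refl) (cong suc (trans (multiplicity-≡ top top _ refl) (cong suc (multiplicity-map-fromℕ w))))
    where top = fromℕ m
  multiplicity-insertTop-fromℕ {m} (suc g) [] = trans (multiplicity-≡ top top _ refl) (cong suc (multiplicity-≡ top top [] refl))
    where top = fromℕ m
  multiplicity-insertTop-fromℕ {m} (suc g) (x ∷ w) =
    trans (multiplicity-≢ (fromℕ m) (inject₁ x) _ (fromℕ≢inject₁ ∘ sym)) (multiplicity-insertTop-fromℕ g w)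

  multiplicity-insertTop-inject₁ : ∀ (a : Fin m) g w → multiplicity (inject₁ a) (insertTop g w) ≡ multiplicity a w
  multiplicity-insertTop-inject₁ {m} a zero w =
    trans (multiplicity-≢ (inject₁ a) (fromℕ m) _ fromℕ≢inject₁)
          (trans (multiplicity-≢ (inject₁ a) (fromℕ m) _ fromℕ≢inject₁) (multiplicity-map-inject₁ a w))
  multiplicity-insertTop-inject₁ {m} a (suc g) [] =
    trans (multiplicity-≢ (inject₁ a) (fromℕ m) _ fromℕ≢inject₁) (multiplicity-≢ (inject₁ a) (fromℕ m) [] fromℕ≢inject₁)
  multiplicity-insertTop-inject₁ a (suc g) (x ∷ w) = multiplicity-∷-inject₁ a x w _ (multiplicity-insertTop-inject₁ a g w)

  shiftPast : ℕ → ℕ → ℕ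
  shiftPast zero q = suc (suc q)
  shiftPast (suc g) zero = zero
  shiftPast (suc g) (suc q) = suc (shiftPast g q)

  private
    nth-map : ∀ {A B : Set} (f : A → B) (w : List A) q → nth (map f w) q ≡ Maybe.map f (nth w q)
    nth-map f [] q = refl
    nth-map f (x ∷ w) zero = refl
    nth-map f (x ∷ w) (suc q) = nth-map f w q

    nth-shiftPast : ∀ g (w : List (Fin m)) q → g ≤ length w → nth (insertTop g w) (shiftPast g q) ≡ Maybe.map inject₁ (nth w q)
    nth-shiftPast zero w q _ = nth-map inject₁ w q
    nth-shiftPast (suc g) (x ∷ w) zero _ = refl
    nth-shiftPast (suc g) (x ∷ w) (suc q) (s≤s g≤) = nth-shiftPast g w q g≤

    shiftPast-mono : ∀ g {q q′} → q < q′ → shiftPast g q < shiftPast g q′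
    shiftPast-mono zero q<q′ = s≤s (s≤s q<q′)
    shiftPast-mono (suc g) {zero} {suc q′} _ = s≤s z≤n
    shiftPast-mono (suc g) {suc q} {suc q′} (s≤s q<q′) = s≤s (shiftPast-mono g q<q′)

    shiftPast-cancel : ∀ g {q q′} → shiftPast g q < shiftPast g q′ → q < q′
    shiftPast-cancel zero (s≤s (s≤s q<q′)) = q<q′
    shiftPast-cancel (suc g) {zero} {suc q′} _ = s≤s z≤n
    shiftPast-cancel (suc g) {suc q} {suc q′} (s≤s lt) = s≤s (shiftPast-cancel g lt)

    map-inject₁-just : ∀ (mx : Maybe (Fin m)) {z} → Maybe.map inject₁ mx ≡ just z → ∃ λ a → mx ≡ just a × z ≡ inject₁ a
    map-inject₁-just (just a) refl = a , refl , refl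

    data Position (g : ℕ) (w : List (Fin m)) : ℕ → Set where
      inGap : ∀ {q} → q ≡ g ⊎ q ≡ suc g → nth (insertTop g w) q ≡ just (fromℕ m) → Position g w q
      shifted : ∀ q → nth (insertTop g w) (shiftPast g q) ≡ Maybe.map inject₁ (nth w q) → Position g w (shiftPast g q)

    position : ∀ g (w : List (Fin m)) q → g ≤ length w → Position g w q
    position zero w zero g≤ = inGap (inj₁ refl) refl
    position zero w (suc zero) g≤ = inGap (inj₂ refl) refl
    position zero w (suc (suc q)) _ = shifted q (nth-map inject₁ w q)
    position (suc g) (x ∷ w) zero _ = shifted zero refl
    position (suc g) (x ∷ w) (suc q) (s≤s g≤) with position g w q g≤
    ... | inGap q≡ nth≡ = inGap (Sum.map (cong suc) (cong suc) q≡) nth≡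
    ... | shifted q′ nth≡ = shifted (suc q′) nth≡

  stirling-insertTop⁺ : ∀ g (w : List (Fin m)) → g ≤ length w → StirlingCondition w → StirlingCondition (insertTop g w)
  stirling-insertTop⁺ g w g≤ condition i s j a b i<s s<j wi≡a wj≡a ws≡b with position g w i g≤ | position g w j g≤
  ... | inGap i∈gap _ | inGap j∈gap _ = ⊥-elim (gap-too-narrow i∈gap j∈gap)
    where
    gap-too-narrow : i ≡ g ⊎ i ≡ suc g → j ≡ g ⊎ j ≡ suc g → ⊥
    gap-too-narrow (inj₁ refl) (inj₁ refl) = <-irrefl refl (<-trans i<s s<j)
    gap-too-narrow (inj₁ refl) (inj₂ refl) = <⇒≱ i<s (s≤s⁻¹ s<j)
    gap-too-narrow (inj₂ refl) (inj₁ refl) = <⇒≱ (<-trans i<s s<j) (n≤1+n g)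
    gap-too-narrow (inj₂ refl) (inj₂ refl) = <-irrefl refl (<-trans i<s s<j)
  ... | inGap _ top | shifted j′ nth≡ with map-inject₁-just (nth w j′) (trans (sym nth≡) wj≡a)
  ...   | a′ , _ , refl = contradiction (just-injective (trans (sym top) wi≡a)) fromℕ≢inject₁
  stirling-insertTop⁺ g w g≤ condition i s j a b i<s s<j wi≡a wj≡a ws≡b | shifted i′ nth≡ | inGap _ top
    with map-inject₁-just (nth w i′) (trans (sym nth≡) wi≡a)
  ... | a′ , _ , refl = contradiction (just-injective (trans (sym top) wj≡a)) fromℕ≢inject₁
  stirling-insertTop⁺ g w g≤ condition _ s _ a b i<s s<j wi≡a wj≡a ws≡b | shifted i′ nthi≡ | shifted j′ nthj≡
    with map-inject₁-just (nth w i′) (trans (sym nthi≡) wi≡a) | map-inject₁-just (nth w j′) (trans (sym nthj≡) wj≡a)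
  ... | a′ , wi′≡a′ , refl | a″ , wj′≡a″ , a≡a″ with position g w s g≤
  ...   | inGap _ top = subst (inject₁ a′ Fin.≤_) (just-injective (trans (sym top) ws≡b)) (<⇒≤ (inject₁<fromℕ a′))
  ...   | shifted s′ nths≡ with map-inject₁-just (nth w s′) (trans (sym nths≡) ws≡b)
  ...     | b′ , ws′≡b′ , refl = inject₁-mono-≤ (condition i′ s′ j′ a′ b′ (shiftPast-cancel g i<s) (shiftPast-cancel g s<j)
                                   wi′≡a′ (trans wj′≡a″ (cong just (inject₁-injective (sym a≡a″)))) ws′≡b′)

  stirling-insertTop⁻ : ∀ g (w : List (Fin m)) → g ≤ length w → StirlingCondition (insertTop g w) → StirlingCondition w
  stirling-insertTop⁻ g w g≤ condition i s j a b i<s s<j wi≡a wj≡a ws≡b =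
    inject₁-cancel-≤ (condition (shiftPast g i) (shiftPast g s) (shiftPast g j) (inject₁ a) (inject₁ b)
      (shiftPast-mono g i<s) (shiftPast-mono g s<j)
      (trans (nth-shiftPast g w i g≤) (cong (Maybe.map inject₁) wi≡a))
      (trans (nth-shiftPast g w j g≤) (cong (Maybe.map inject₁) wj≡a))
      (trans (nth-shiftPast g w s g≤) (cong (Maybe.map inject₁) ws≡b)))

  private
    stirling-tail : ∀ {x : Fin m} {u} → StirlingCondition (x ∷ u) → StirlingCondition u
    stirling-tail condition i s j a b i<s s<j = condition (suc i) (suc s) (suc j) a b (s≤s i<s) (s≤s s<j)

    occurs : ∀ (a : Fin m) u {k} → multiplicity a u ≡ suc k → ∃ λ j → nth u j ≡ just a
    occurs a (x ∷ u) occ with x Fin.≟ a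
    ... | yes refl = 0 , refl
    ... | no _ = let j , uj≡a = occurs a u occ in suc j , uj≡a

    avoiding-top : ∀ (u : List (Fin (suc m))) → multiplicity (fromℕ m) u ≡ 0 → ∃ λ w → u ≡ map inject₁ w
    avoiding-top [] _ = [] , refl
    avoiding-top {m} (x ∷ u) none with view x
    ... | ‵inject₁ x′ =
      let w , u≡ = avoiding-top u (trans (sym (multiplicity-≢ (fromℕ m) (inject₁ x′) u (fromℕ≢inject₁ ∘ sym))) none) in
                        x′ ∷ w , cong (inject₁ x′ ∷_) u≡
    ... | ‵fromℕ = contradiction (trans (sym (multiplicity-≡ (fromℕ m) (fromℕ m) u refl)) none) (λ ())

  data TopPair : List (Fin (suc m)) → Set where
    insertedAt : ∀ g (w : List (Fin m)) → g ≤ length w → TopPair (insertTop g w)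

  topPair : ∀ (u : List (Fin (suc m))) → multiplicity (fromℕ m) u ≡ 2 → StirlingCondition u → TopPair u
  topPair {m} (x ∷ u) twice condition with view x
  ... | ‵inject₁ x′
    with topPair u (trans (sym (multiplicity-≢ (fromℕ m) (inject₁ x′) u (fromℕ≢inject₁ ∘ sym))) twice) (stirling-tail condition)
  ...   | insertedAt g w g≤ = insertedAt (suc g) (x′ ∷ w) (s≤s g≤)
  topPair {m} (x ∷ []) twice condition | ‵fromℕ = contradiction (trans (sym (multiplicity-≡ (fromℕ m) (fromℕ m) [] refl)) twice) (λ ())
  topPair {m} (x ∷ y ∷ u) twice condition | ‵fromℕ with view y
  ... | ‵fromℕ with avoiding-top u (suc-injective (trans (sym (multiplicity-≡ (fromℕ m) (fromℕ m) u refl))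
                    (suc-injective (trans (sym (multiplicity-≡ (fromℕ m) (fromℕ m) (fromℕ m ∷ u) refl)) twice))))
  ...   | w , refl = insertedAt 0 w z≤n
  topPair {m} (x ∷ y ∷ u) twice condition | ‵fromℕ | ‵inject₁ y′
    with occurs (fromℕ m) u (trans (sym (multiplicity-≢ (fromℕ m) (inject₁ y′) u (fromℕ≢inject₁ ∘ sym)))
                                   (suc-injective (trans (sym (multiplicity-≡ (fromℕ m) (fromℕ m) (inject₁ y′ ∷ u) refl)) twice)))
  ... | j , uj≡top = contradiction (condition 0 1 (suc (suc j)) (fromℕ m) (inject₁ y′) (s≤s z≤n) (s≤s (s≤s z≤n)) refl uj≡top refl)
                       (<⇒≱ (inject₁<fromℕ y′))

  IsStirling : ∀ n → List (Fin (suc n)) → Set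
  IsStirling n w = (∀ a → multiplicity a w ≡ Vec.lookup (oneTwos n) a) × StirlingCondition w

  private
    oneTwos-inject₁ : ∀ n (a : Fin (suc n)) → Vec.lookup (oneTwos (suc n)) (inject₁ a) ≡ Vec.lookup (oneTwos n) a
    oneTwos-inject₁ n zero = refl
    oneTwos-inject₁ n (suc a) = trans (lookup-replicate (inject₁ a) 2) (sym (lookup-replicate a 2))

    oneTwos-fromℕ : ∀ n → Vec.lookup (oneTwos (suc n)) (fromℕ (suc n)) ≡ 2
    oneTwos-fromℕ n = lookup-replicate (fromℕ n) 2

  module _ {n} (g : ℕ) (w : List (Fin (suc n))) (g≤ : g ≤ length w) where

    isStirling-insertTop⁺ : IsStirling n w → IsStirling (suc n) (insertTop g w)
    isStirling-insertTop⁺ (multiplicities , condition) = multiplicities′ , stirling-insertTop⁺ g w g≤ condition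
      where
      multiplicities′ : ∀ a → multiplicity a (insertTop g w) ≡ Vec.lookup (oneTwos (suc n)) a
      multiplicities′ a with view a
      ... | ‵inject₁ a′ = trans (multiplicity-insertTop-inject₁ a′ g w) (trans (multiplicities a′) (sym (oneTwos-inject₁ n a′)))
      ... | ‵fromℕ = trans (multiplicity-insertTop-fromℕ g w) (sym (oneTwos-fromℕ n))

    isStirling-insertTop⁻ : IsStirling (suc n) (insertTop g w) → IsStirling n w
    isStirling-insertTop⁻ (multiplicities , condition) =
      (λ a → trans (sym (multiplicity-insertTop-inject₁ a g w)) (trans (multiplicities (inject₁ a)) (oneTwos-inject₁ n a))) ,
      stirling-insertTop⁻ g w g≤ condition

  isStirling-topPair : ∀ {n} u → IsStirling (suc n) u → TopPair u
  isStirling-topPair {n} u (multiplicities , condition) = topPair u (trans (multiplicities (fromℕ (suc n))) (oneTwos-fromℕ n)) condition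

  isStirling-zero : ∀ w → IsStirling 0 w → w ≡ zero ∷ []
  isStirling-zero w (multiplicities , _) = singleton w (trans (sym (multiplicity-zero w)) (multiplicities zero))
    where
    multiplicity-zero : ∀ (w : List (Fin 1)) → multiplicity zero w ≡ length w
    multiplicity-zero [] = refl
    multiplicity-zero (zero ∷ w) = cong suc (multiplicity-zero w)
    singleton : ∀ (w : List (Fin 1)) → length w ≡ 1 → w ≡ zero ∷ []
    singleton (zero ∷ []) _ = refl

  isStirling-[0] : IsStirling 0 (zero ∷ [])
  isStirling-[0] =
    (λ { zero → refl }) ,
    λ { _ _ (suc (suc _)) _ _ _ _ _ () _ ; _ _ zero _ _ _ () _ _ _ ; _ _ (suc zero) _ _ () (s≤s z≤n) _ _ _ }

  length-isStirling : ∀ n w → IsStirling n w → length w ≡ suc (2 * n)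
  length-isStirling zero w stirling = cong length (isStirling-zero w stirling)
  length-isStirling (suc n) u stirling with isStirling-topPair u stirling
  ... | insertedAt g w g≤ = begin
    length (insertTop g w)   ≡⟨ length-insertTop g w ⟩
    suc (suc (length w))     ≡⟨ cong (λ l → suc (suc l)) (length-isStirling n w (isStirling-insertTop⁻ g w g≤ stirling)) ⟩
    suc (suc (suc (2 * n)))  ≡⟨ cong suc (*-suc 2 n) ⟨
    suc (2 * suc n)          ∎
    where open ≡-Reasoning

  private
    insertGap : List (Fin m) × ℕ → List (Fin (suc m))
    insertGap (w , g) = insertTop g w

    insertGap-injective : ∀ {Q : List (Fin m) × ℕ → Set} → (∀ {wg} → Q wg → proj₂ wg ≤ length (proj₁ wg)) →
      ∀ {wg wg′} → Q wg → Q wg′ → insertGap wg ≡ insertGap wg′ → wg ≡ wg′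
    insertGap-injective bounded {w , g} {w′ , g′} Qwg Qwg′ eq with insertTop-injective g g′ w w′ (bounded Qwg) (bounded Qwg′) eq
    ... | refl , refl = refl

  stirling-descents-count : ∀ n i → HasCount (List (Fin (suc n))) (λ w → IsStirling n w × descents w ≡ i) (eulerian n i)
  stirling-descents-count zero i with i ℕ.≟ 1
  ... | yes refl = Count.single (zero ∷ []) (λ w (stirling , _) → isStirling-zero w stirling) (isStirling-[0] , refl)
  ... | no i≢1 = subst (HasCount _ _) (sym (δ-≢ i≢1))
                   (Count.none (λ w (stirling , d≡i) → i≢1 (trans (sym d≡i) (cong descents (isStirling-zero w stirling)))))
  stirling-descents-count (suc n) i =
    subst (HasCount _ _) (cong₂ _+_ (*-comm (eulerian n i) i) (*-comm (shift (eulerian n) i) (suc (R n) ∸ i)))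
      (Count.resp (λ u → mk⇔ (sound u) (complete u)) (Count.⊎⁺ afterDescent elsewhere disjoint))
    where
    oneFewer : ∀ i → HasCount _ (λ w → IsStirling n w × suc (descents w) ≡ i) (shift (eulerian n) i)
    oneFewer zero = Count.none (λ { _ (_ , ()) })
    oneFewer (suc i) = Count.resp (λ w → mk⇔ (map₂ (cong suc)) (map₂ suc-injective)) (stirling-descents-count n i)
    nonDescentGaps : ∀ w → IsStirling n w × suc (descents w) ≡ i →
      HasCount ℕ (λ g → g ≤ length w × ¬ GapAfterDescent g w) (suc (R n) ∸ i)
    nonDescentGaps w (stirling , refl) =
      subst (HasCount _ _) (cong (λ l → suc l ∸ descents w) (length-isStirling n w stirling))
        (Count.complement (gap-count (length w)) (gapAfterDescent-count w) (λ g → gapAfterDescent? g w))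
    afterDescent = Count.image⁺ insertGap (insertGap-injective (proj₁ ∘ proj₂))
      (Count.Σ⁺ (λ w (_ , d≡i) → subst (HasCount _ _) d≡i (gapAfterDescent-count w)) (stirling-descents-count n i))
    elsewhere = Count.image⁺ insertGap (insertGap-injective (proj₁ ∘ proj₂))
      (Count.Σ⁺ nonDescentGaps (oneFewer i))
    disjoint : ∀ u → _ → _ → ⊥
    disjoint u ((w , g) , (_ , (g≤ , after)) , refl) ((w′ , g′) , (_ , (g′≤ , notAfter)) , eq)
      with insertTop-injective g′ g w′ w g′≤ g≤ eq
    ... | refl , refl = notAfter after
    sound : ∀ u → _ → IsStirling (suc n) u × descents u ≡ i
    sound _ (inj₁ ((w , g) , ((stirling , d≡i) , (g≤ , after)) , refl)) =
      isStirling-insertTop⁺ g w g≤ stirling , trans (proj₁ (descents-insertTop g w g≤) after) d≡i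
    sound _ (inj₂ ((w , g) , ((stirling , d≡i) , (g≤ , notAfter)) , refl)) =
      isStirling-insertTop⁺ g w g≤ stirling , trans (proj₂ (descents-insertTop g w g≤) notAfter) d≡i
    complete : ∀ u → IsStirling (suc n) u × descents u ≡ i → _
    complete u (stirling , d≡i) with isStirling-topPair u stirling
    ... | insertedAt g w g≤ with gapAfterDescent? g w
    ...   | yes after =
      inj₁ ((w , g) , ((isStirling-insertTop⁻ g w g≤ stirling , trans (sym (proj₁ (descents-insertTop g w g≤) after)) d≡i) , (g≤ , after)) , refl)
    ...   | no notAfter =
      inj₂ ((w , g) , ((isStirling-insertTop⁻ g w g≤ stirling , trans (sym (proj₂ (descents-insertTop g w g≤) notAfter)) d≡i) , (g≤ , notAfter)) , refl)

  stirling-count : ∀ n i → IsStirlingDescentCount (oneTwos n) i (eulerian n i)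
  stirling-count n i = Count.resp (λ w → mk⇔ (sound w) (complete w)) (stirling-descents-count n i)
    where
    sound : ∀ w → IsStirling n w × descents w ≡ i → IsStirlingPermutation (oneTwos n) w × HasCount (Fin (length w)) (IsDescent w) i
    sound w ((multiplicities , condition) , d≡i) =
      (multiplicities , stirlingCondition⁻ w condition) , subst (HasCount _ _) d≡i (isDescent-count w)
    complete : ∀ w → IsStirlingPermutation (oneTwos n) w × HasCount (Fin (length w)) (IsDescent w) i → IsStirling n w × descents w ≡ i
    complete w ((multiplicities , condition) , counted) =
      (multiplicities , stirlingCondition⁺ w condition) , Count.functional (isDescent-count w) counted

open import Defs
open import Data.Nat using (ℕ; suc; _+_; _*_; _≤_)
open import Data.Fin using (Fin)
open import Data.Vec using (Vec)
open import Data.Product using (_×_; _,_)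
open import Relation.Binary.PropositionalEquality using (_≡_)
open StirlingPermutations using (stirling-count)
open Eulerian using (Bpoly-eulerian; bpoly-eulerian)
open ClosedForms using (Sodd-sumWeak; soddSub-sumStrict)

theorem4 :
    (∀ (n k : ℕ) → 1 ≤ k → k ≤ n →
       HasCount (Fin k × Vec (Fin k) n) IsPartitionWithLeader (Sodd n k))
    × (∀ (n k : ℕ) → 1 ≤ k → k ≤ n →
       HasCount (Fin k × Vec (Fin n) n) IsPermutationWithLeader (sodd n k))
    × (∀ (n : ℕ) (A : ℕ → ℕ) →
       (∀ i → IsStirlingDescentCount (oneTwos n) i (A i)) →
       ∀ (m : ℕ) → 1 ≤ m →
         (Bpoly (suc n) (suc (2 * n)) A m ≡ Sodd (n + m) m)
         × (bpoly (suc n) (suc (2 * n)) A m ≡ soddSub m n))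
    × (∀ (n m : ℕ) → 1 ≤ n → 1 ≤ m →
         (Sodd (n + m) m ≡ sumWeak n 1 m weight)
         × (soddSub m n ≡ sumStrict n 1 m weight))
-- The counts hold for all n, k and m, so only 1 ≤ n, needed in (4), is used.
theorem4 =
  (λ n k _ _ → Partitions.leader-count n k) ,
  (λ n k _ _ → Permutations.leader-count n k) ,
  (λ n A counted m _ →
    let A≗eulerian = λ i → Count.functional (counted i) (stirling-count n i)
    in Bpoly-eulerian n A A≗eulerian m , bpoly-eulerian n A A≗eulerian m) ,
  (λ n m 1≤n _ → Sodd-sumWeak n m 1≤n , soddSub-sumStrict n m 1≤n)
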